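{- Let $\mu=(\mu_1,\mu_2)\vdash n$ be a partition with at most two rows and let $S$ be a semistandard tableau of content $\mu$. Then $S$ has at most two rows, say the bottom row of length $n-d$ and the top row of length $d$. If $T$ is a filling of the same shape as $S$ with $1,\ldots,n$ each used once, having entries $t_1,\ldots,t_d$ in the top row and $b_1,\ldots,b_{n-d}$ in the bottom row (each read left to right), then $$F_T^S=d!\,(n-d)!\prod_{i=1}^{d}(x_{t_i}-x_{b_i}).$$
   Context: Tableaux are in French convention (first row at the bottom); semistandard means rows weakly increasing left to right and columns strictly increasing upward; content $\mu$ means $\mu_i$ entries equal to $i$. $S_n$ acts on polynomials by $\omega\cdot x_i=x_{\omega(i)}$. Cocharge labels: for a standard word (letters $1,\ldots,m$ once each), label $1$ by $0$; if $i$ has label $j$, $i+1$ gets $j$ if it is right of $i$, else $j+1$. For a word $w$ of content $\mu$: $\mathrm{cprev}(m,w_j)$ is the rightmost $m$ strictly left of $w_j$ if one exists, else the rightmost $m$ of $w$; the first standard subword starts at the rightmost $1$ and recursively takes $\mathrm{cprev}(j+1,\cdot)$ of the chosen $j$ for $j<\ell(\mu)$; the standard subword decomposition repeatedly extracts first standard subwords from the remaining letters; each letter receives its label within its subword. For $S$, the reading word concatenates rows top to bottom, each left to right, and $\mathrm{cw}_S(s)$ is the label of box $s$. Define $\mathbf{x}_T^S=\prod_s x_{T(s)}^{\mathrm{cw}_S(s)}$ and $F_T^S=\varepsilon_T\cdot\mathbf{x}_T^S$, where $\varepsilon_T=\sum_{\tau\in C(T)}\sum_{\sigma\in R(T)}\mathrm{sgn}(\tau)\tau\sigma$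 and $C(T)$, $R(T)$ are the subgroups of $S_n$ preserving each column, resp. each row, of $T$ setwise. -}

module Defs where

open import Data.Nat as ℕ using (ℕ; zero; suc; _<ᵇ_; _≡ᵇ_; _≤_; _<_; _∸_)
open import Data.Nat.Base using (_!)
open import Data.Integer as ℤ using (ℤ; +_; -_)
open import Data.Bool using (Bool; true; false; if_then_else_; _∧_; not)
open import Data.Fin as Fin using (Fin; toℕ)
open import Data.Fin.Properties using () renaming (_≟_ to _≟ᶠ_)
open import Data.List as List using (List; []; _∷_; _++_; length; map; concat; concatMap; reverse; zipWith; foldr; filter; allFin; lookup)
open import Data.Maybe using (Maybe; just; nothing)
open import Data.Product using (_×_; _,_; proj₁; proj₂)
open import Data.Vec as Vec using (Vec; tabulate)
open import Data.Vec.Properties using (≡-dec)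
open import Relation.Binary.PropositionalEquality using (_≡_)
open import Relation.Nullary using (does; yes; no)
open import Relation.Nullary.Decidable using (⌊_⌋; ¬?)
import Data.List.Relation.Unary.Unique.Propositional
import Data.List.Membership.Propositional

-- Polynomials in ℤ[x₀,…,x_{n-1}] (variable x_i ↔ paper's x_{i+1}),
-- as formal sums of terms c·x^e, compared coefficientwise.

Exps : ℕ → Set
Exps n = Vec ℕ n

Poly : ℕ → Set
Poly n = List (ℤ × Exps n)

coeff : ∀ {n} → Poly n → Exps n → ℤ
coeff []             a = + 0
coeff ((c , e) ∷ p)  a with ≡-dec ℕ._≟_ e a
... | yes _ = c ℤ.+ coeff p a
... | no  _ = coeff p a

infix 4 _≈P_
_≈P_ : ∀ {n} → Poly n → Poly n → Set
p ≈P q = ∀ a → coeff p a ≡ coeff q a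

constP : ∀ {n} → ℤ → Poly n
constP c = (c , Vec.replicate _ 0) ∷ []

var : ∀ {n} → Fin n → Poly n
var i = (+ 1 , tabulate (λ j → if does (i ≟ᶠ j) then 1 else 0)) ∷ []

_+P_ : ∀ {n} → Poly n → Poly n → Poly n
p +P q = p ++ q

scaleP : ∀ {n} → ℤ → Poly n → Poly n
scaleP c = map (λ t → c ℤ.* proj₁ t , proj₂ t)

_-P_ : ∀ {n} → Poly n → Poly n → Poly n
p -P q = p ++ scaleP (- (+ 1)) q

_*P_ : ∀ {n} → Poly n → Poly n → Poly n
p *P q = concatMap (λ s → map (λ t → proj₁ s ℤ.* proj₁ t , Vec.zipWith ℕ._+_ (proj₂ s) (proj₂ t)) q) p

prodP : ∀ {n} → List (Poly n) → Poly n
prodP = foldr _*P_ (constP (+ 1))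

sumP : ∀ {n} → List (Poly n) → Poly n
sumP = concat

monomial : ∀ {n} → Exps n → Poly n
monomial e = (+ 1 , e) ∷ []

filterB : ∀ {A : Set} → (A → Bool) → List A → List A
filterB p []       = []
filterB p (x ∷ xs) = if p x then x ∷ filterB p xs else filterB p xs

allB : ∀ {A : Set} → (A → Bool) → List A → Bool
allB p = foldr (λ x b → p x ∧ b) true

anyB : ∀ {A : Set} → (A → Bool) → List A → Bool
anyB p = foldr (λ x b → if p x then true else b) false

countB : ∀ {A : Set} → (A → Bool) → List A → ℕ
countB p = foldr (λ x c → if p x then suc c else c) 0

Map : ℕ → Set
Map n = Fin n → Fin n

sumℕ : List ℕ → ℕ
sumℕ = foldr ℕ._+_ 0

-- ω · (c ∏ x_i^{e_i}) = c ∏ x_{ω(i)}^{e_i}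
actExps : ∀ {n} → Map n → Exps n → Exps n
actExps {n} ω e = tabulate (λ j → sumℕ (map (λ i → if does (ω i ≟ᶠ j) then Vec.lookup e i else 0) (allFin n)))

act : ∀ {n} → Map n → Poly n → Poly n
act ω = map (λ t → proj₁ t , actExps ω (proj₂ t))

allVecs : ∀ (m k : ℕ) → List (Vec (Fin k) m)
allVecs zero    k = Vec.[] ∷ []
allVecs (suc m) k = concatMap (λ v → map (λ a → a Vec.∷ v) (allFin k)) (allVecs m k)

pairsLt : ∀ n → List (Fin n × Fin n)
pairsLt n = concatMap (λ i → map (λ j → i , j) (filterB (λ j → toℕ i <ᵇ toℕ j) (allFin n))) (allFin n)

isInjective : ∀ {n} → Map n → Bool
isInjective {n} ω = allB (λ ij → not (does (ω (proj₁ ij) ≟ᶠ ω (proj₂ ij)))) (pairsLt n)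

allPerms : ∀ n → List (Map n)
allPerms n = filterB isInjective (map Vec.lookup (allVecs n n))

inversions : ∀ {n} → Map n → ℕ
inversions {n} ω = countB (λ ij → toℕ (ω (proj₂ ij)) <ᵇ toℕ (ω (proj₁ ij))) (pairsLt n)

sgn : ∀ {n} → Map n → ℤ
sgn ω = if does (inversions ω ℕ.% 2 ℕ.≟ 0) then + 1 else - (+ 1)

-- Tableaux in French convention: a list of rows, row 0 = bottom row,
-- each row listed left to right.

Tab : Set → Set
Tab A = List (List A)

data IsShape {A : Set} : Tab A → Set where
  []  : IsShape []
  one : ∀ {r} → 0 < length r → IsShape (r ∷ [])
  two : ∀ {r r′ rs} → 0 < length r → length r′ ≤ length r → IsShape (r′ ∷ rs) → IsShape (r ∷ r′ ∷ rs)

data WeaklyInc : List ℕ → Set where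
  []  : WeaklyInc []
  one : ∀ {a} → WeaklyInc (a ∷ [])
  two : ∀ {a b r} → a ≤ b → WeaklyInc (b ∷ r) → WeaklyInc (a ∷ b ∷ r)

data StrictAbove : List ℕ → List ℕ → Set where
  endUp : ∀ {lo} → StrictAbove lo []
  step  : ∀ {a b lo up} → a < b → StrictAbove lo up → StrictAbove (a ∷ lo) (b ∷ up)

data ColsStrict : Tab ℕ → Set where
  []  : ColsStrict []
  one : ∀ {r} → ColsStrict (r ∷ [])
  two : ∀ {r r′ rs} → StrictAbove r r′ → ColsStrict (r′ ∷ rs) → ColsStrict (r ∷ r′ ∷ rs)

data AllRows {A : Set} (P : List A → Set) : Tab A → Set where
  []  : AllRows P []
  _∷_ : ∀ {r rs} → P r → AllRows P rs → AllRows P (r ∷ rs)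

record Semistandard (S : Tab ℕ) : Set where
  field
    shape   : IsShape S
    rowsInc : AllRows WeaklyInc S
    colsInc : ColsStrict S

μ-part : ℕ → ℕ → ℕ → ℕ
μ-part μ₁ μ₂ 1 = μ₁
μ-part μ₁ μ₂ 2 = μ₂
μ-part μ₁ μ₂ _ = 0

HasContent : Tab ℕ → ℕ → ℕ → Set
HasContent S μ₁ μ₂ = ∀ i → countB (λ x → x ≡ᵇ i) (concat S) ≡ μ-part μ₁ μ₂ i

rowOr[] : ∀ {A : Set} → Tab A → ℕ → List A
rowOr[] []       _       = []
rowOr[] (r ∷ rs) zero    = r
rowOr[] (r ∷ rs) (suc k) = rowOr[] rs k

-- remaining letters as (position , letter)
Rem : Set
Rem = List (ℕ × ℕ)

rightmost : ℕ → Rem → Maybe ℕ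
rightmost m = List.foldl (λ acc pl → if proj₂ pl ≡ᵇ m then just (proj₁ pl) else acc) nothing

rightmostBefore : ℕ → ℕ → Rem → Maybe ℕ
rightmostBefore m p = List.foldl (λ acc pl → if (proj₂ pl ≡ᵇ m) ∧ (proj₁ pl <ᵇ p) then just (proj₁ pl) else acc) nothing

cprev : ℕ → ℕ → Rem → Maybe ℕ
cprev m p rem with rightmostBefore m p rem
... | just q  = just q
... | nothing = rightmost m rem

-- continue a standard subword: letter j at position p with label lab;
-- returns the list of (position , label) for the letters j+1, j+2, …
chain : ℕ → ℕ → ℕ → ℕ → Rem → List (ℕ × ℕ)
chain zero       j p lab rem = []
chain (suc fuel) j p lab rem with cprev (suc j) p rem
... | nothing = []
... | just q  = let lab′ = if p <ᵇ q then lab else suc lab in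
                (q , lab′) ∷ chain fuel (suc j) q lab′ rem

firstSubword : ℕ → Rem → List (ℕ × ℕ)
firstSubword fuel rem with rightmost 1 rem
... | nothing = []
... | just p  = (p , 0) ∷ chain fuel 1 p 0 rem

removePos : List (ℕ × ℕ) → Rem → Rem
removePos chosen = filterB (λ pl → not (anyB (λ c → proj₁ c ≡ᵇ proj₁ pl) chosen))

decompose : ℕ → Rem → List (ℕ × ℕ)
decompose zero       rem = []
decompose (suc fuel) rem = let sw = firstSubword (length rem) rem in
                           sw ++ decompose fuel (removePos sw rem)

cocharge : List ℕ → List ℕ
cocharge w = map labelAt (List.upTo (length w))
  where
  pls = decompose (length w) (List.zip (List.upTo (length w)) w)
  labelAt : ℕ → ℕ
  labelAt i = List.foldr (λ pl acc → if proj₁ pl ≡ᵇ i then proj₂ pl else acc) 0 pls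

readingWord : ∀ {A : Set} → Tab A → List A
readingWord S = concat (reverse S)

xTS : ∀ {n} → Tab (Fin n) → Tab ℕ → Poly n
xTS {n} T S = monomial (tabulate λ k → sumℕ (zipWith (λ t c → if does (t ≟ᶠ k) then c else 0)
                                              (readingWord T) (cocharge (readingWord S))))

findIn : ∀ {n} → List (Fin n) → Fin n → Maybe ℕ
findIn [] k = nothing
findIn (x ∷ xs) k = if does (x ≟ᶠ k) then just 0 else Data.Maybe.map suc (findIn xs k)
  where import Data.Maybe

rowOf : ∀ {n} → Tab (Fin n) → Fin n → ℕ
rowOf []       k = 0
rowOf (r ∷ rs) k with findIn r k
... | just _  = 0
... | nothing = suc (rowOf rs k)

colOf : ∀ {n} → Tab (Fin n) → Fin n → ℕ
colOf []       k = 0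
colOf (r ∷ rs) k with findIn r k
... | just c  = c
... | nothing = colOf rs k

inR : ∀ {n} → Tab (Fin n) → Map n → Bool
inR {n} T ω = allB (λ k → rowOf T (ω k) ≡ᵇ rowOf T k) (allFin n)

inC : ∀ {n} → Tab (Fin n) → Map n → Bool
inC {n} T ω = allB (λ k → colOf T (ω k) ≡ᵇ colOf T k) (allFin n)


εT : ∀ {n} → Tab (Fin n) → Poly n → Poly n
εT {n} T f = sumP (concatMap (λ τ → map (λ σ → scaleP (sgn τ) (act τ (act σ f)))
                                        (filterB (inR T) (allPerms n)))
                             (filterB (inC T) (allPerms n)))

F : ∀ {n} → Tab (Fin n) → Tab ℕ → Poly n
F T S = εT T (xTS T S)

-- T is a filling of the shape of S with 0,…,n-1 (paper: 1,…,n) each once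
record IsFilling {n} (T : Tab (Fin n)) (S : Tab ℕ) : Set where
  field
    sameShape : map length T ≡ map length S
    unique    : Data.List.Relation.Unary.Unique.Propositional.Unique (concat T)
    covers    : ∀ k → k Data.List.Membership.Propositional.∈ concat T

module Submission where

-- The content forces S to have at most two rows: a bottom row 1…1 2…2 and a top row 2…2 of
-- length d ≤ μ₁, so the reading word of S is 2^d 1^x 2^y.  Each round of the standard subword
-- decomposition of this word takes the rightmost remaining 1 together with the nearest 2 to its
-- left; after d rounds the leading 2s are used up and every remaining letter gets label 0.  So
-- only the d top-row boxes have cocharge label 1, and x_T^S = x_{t_1}⋯x_{t_d}.  Row permutations
-- fix this monomial, and there are d!(n−d)! of them.  A column permutation of a two-row filling
-- swaps some of the columns (t_i, b_i) and has sign (−1)^(number of swaps), so the signed sum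
-- over C(T) of the images of x_{t_1}⋯x_{t_d} is the expansion of ∏(x_{t_i} − x_{b_i}).

open import Relation.Binary.PropositionalEquality using (_≡_)

module BigOp {A : Set} (_∙_ : A → A → A) (ε : A)
  (∙-assoc : ∀ x y z → (x ∙ y) ∙ z ≡ x ∙ (y ∙ z))
  (∙-comm : ∀ x y → x ∙ y ≡ y ∙ x)
  (∙-identityˡ : ∀ x → ε ∙ x ≡ x) where

  open import Data.Nat using (zero; suc)
  open import Data.Bool using (Bool; true; false; if_then_else_)
  open import Data.Fin as Fin using (Fin; _≟_)
  open import Data.Fin.Properties using (suc-injective)
  open import Data.List using (List; []; _∷_; _++_; map; concatMap; allFin; tabulate)
  open import Data.Vec as Vec using (Vec)
  open import Data.Empty using (⊥-elim)
  open import Relation.Binary.PropositionalEquality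
  open import Relation.Nullary using (¬_; yes; no; does)
  open import Function using (_∘_)
  open import Defs using (filterB; allVecs)
  open ≡-Reasoning

  ∙-identityʳ : ∀ x → x ∙ ε ≡ x
  ∙-identityʳ x = trans (∙-comm x ε) (∙-identityˡ x)

  ∙-interchange : ∀ a b c d → (a ∙ b) ∙ (c ∙ d) ≡ (a ∙ c) ∙ (b ∙ d)
  ∙-interchange a b c d = begin
    (a ∙ b) ∙ (c ∙ d)  ≡⟨ ∙-assoc a b (c ∙ d) ⟩
    a ∙ (b ∙ (c ∙ d))  ≡⟨ cong (a ∙_) (sym (∙-assoc b c d)) ⟩
    a ∙ ((b ∙ c) ∙ d)  ≡⟨ cong (λ x → a ∙ (x ∙ d)) (∙-comm b c) ⟩
    a ∙ ((c ∙ b) ∙ d)  ≡⟨ cong (a ∙_) (∙-assoc c b d) ⟩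
    a ∙ (c ∙ (b ∙ d))  ≡⟨ sym (∙-assoc a c (b ∙ d)) ⟩
    (a ∙ c) ∙ (b ∙ d)  ∎

  Σ : ∀ {B : Set} → List B → (B → A) → A
  Σ [] f = ε
  Σ (x ∷ xs) f = f x ∙ Σ xs f

  Σ-++ : ∀ {B : Set} (xs ys : List B) (f : B → A) → Σ (xs ++ ys) f ≡ Σ xs f ∙ Σ ys f
  Σ-++ [] ys f = sym (∙-identityˡ _)
  Σ-++ (x ∷ xs) ys f = trans (cong (f x ∙_) (Σ-++ xs ys f)) (sym (∙-assoc _ _ _))

  Σ-cong : ∀ {B : Set} (xs : List B) {f g : B → A} → (∀ x → f x ≡ g x) → Σ xs f ≡ Σ xs g
  Σ-cong [] eq = refl
  Σ-cong (x ∷ xs) eq = cong₂ _∙_ (eq x) (Σ-cong xs eq)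

  Σ-ε : ∀ {B : Set} (xs : List B) → Σ xs (λ _ → ε) ≡ ε
  Σ-ε [] = refl
  Σ-ε (x ∷ xs) = trans (∙-identityˡ _) (Σ-ε xs)

  Σ-zero : ∀ {B : Set} (xs : List B) {f : B → A} → (∀ x → f x ≡ ε) → Σ xs f ≡ ε
  Σ-zero xs eq = trans (Σ-cong xs eq) (Σ-ε xs)

  Σ-∙ : ∀ {B : Set} (xs : List B) (f g : B → A) → Σ xs (λ x → f x ∙ g x) ≡ Σ xs f ∙ Σ xs g
  Σ-∙ [] f g = sym (∙-identityˡ ε)
  Σ-∙ (x ∷ xs) f g = trans (cong ((f x ∙ g x) ∙_) (Σ-∙ xs f g)) (∙-interchange _ _ _ _)

  Σ-filterB : ∀ {B : Set} (p : B → Bool) (xs : List B) (f : B → A) →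
    Σ (filterB p xs) f ≡ Σ xs (λ x → if p x then f x else ε)
  Σ-filterB p [] f = refl
  Σ-filterB p (x ∷ xs) f with p x
  ... | true = cong (f x ∙_) (Σ-filterB p xs f)
  ... | false = trans (Σ-filterB p xs f) (sym (∙-identityˡ _))

  Σ-map : ∀ {B C : Set} (g : C → B) (xs : List C) (f : B → A) → Σ (map g xs) f ≡ Σ xs (f ∘ g)
  Σ-map g [] f = refl
  Σ-map g (x ∷ xs) f = cong (f (g x) ∙_) (Σ-map g xs f)

  Σ-concatMap : ∀ {B C : Set} (g : C → List B) (xs : List C) (f : B → A) →
    Σ (concatMap g xs) f ≡ Σ xs (λ x → Σ (g x) f)
  Σ-concatMap g [] f = refl
  Σ-concatMap g (x ∷ xs) f =
    trans (Σ-++ (g x) (concatMap g xs) f) (cong (Σ (g x) f ∙_) (Σ-concatMap g xs f))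

  Σ-swap : ∀ {B C : Set} (xs : List B) (ys : List C) (f : B → C → A) →
    Σ xs (λ x → Σ ys (λ y → f x y)) ≡ Σ ys (λ y → Σ xs (λ x → f x y))
  Σ-swap [] ys f = sym (Σ-ε ys)
  Σ-swap (x ∷ xs) ys f =
    trans (cong (Σ ys (f x) ∙_) (Σ-swap xs ys f)) (sym (Σ-∙ ys (f x) (λ y → Σ xs (λ x′ → f x′ y))))

  Σ-tabulate : ∀ {B : Set} n (g : Fin n → B) (f : B → A) → Σ (tabulate g) f ≡ Σ (allFin n) (f ∘ g)
  Σ-tabulate zero g f = refl
  Σ-tabulate (suc n) g f =
    cong (f (g Fin.zero) ∙_) (trans (Σ-tabulate n (g ∘ Fin.suc) f) (sym (Σ-tabulate n Fin.suc (f ∘ g))))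

  Σ-allFin-suc : ∀ n (f : Fin (suc n) → A) → Σ (allFin (suc n)) f ≡ f Fin.zero ∙ Σ (allFin n) (f ∘ Fin.suc)
  Σ-allFin-suc n f = cong (f Fin.zero ∙_) (Σ-tabulate n Fin.suc f)

  Σ-allFin-single : ∀ n (f : Fin n → A) (i₀ : Fin n) → (∀ i → ¬ i ≡ i₀ → f i ≡ ε) → Σ (allFin n) f ≡ f i₀
  Σ-allFin-single (suc n) f Fin.zero h = begin
    Σ (allFin (suc n)) f                      ≡⟨ Σ-allFin-suc n f ⟩
    f Fin.zero ∙ Σ (allFin n) (f ∘ Fin.suc)   ≡⟨ cong (f Fin.zero ∙_) (Σ-zero (allFin n) (λ i → h (Fin.suc i) (λ ()))) ⟩
    f Fin.zero ∙ ε                            ≡⟨ ∙-identityʳ _ ⟩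
    f Fin.zero                                ∎
  Σ-allFin-single (suc n) f (Fin.suc i₀) h = begin
    Σ (allFin (suc n)) f                      ≡⟨ Σ-allFin-suc n f ⟩
    f Fin.zero ∙ Σ (allFin n) (f ∘ Fin.suc)   ≡⟨ cong₂ _∙_ (h Fin.zero (λ ())) (Σ-allFin-single n (f ∘ Fin.suc) i₀ h-suc) ⟩
    ε ∙ f (Fin.suc i₀)                        ≡⟨ ∙-identityˡ _ ⟩
    f (Fin.suc i₀)                            ∎
    where
    h-suc : ∀ i → ¬ i ≡ i₀ → f (Fin.suc i) ≡ ε
    h-suc i i≢i₀ = h (Fin.suc i) (i≢i₀ ∘ suc-injective)

  Σ-allVecs-single : ∀ m k (f : Vec (Fin k) m → A) (v₀ : Vec (Fin k) m) → (∀ v → ¬ v ≡ v₀ → f v ≡ ε) →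
    Σ (allVecs m k) f ≡ f v₀
  Σ-allVecs-single zero k f Vec.[] h = ∙-identityʳ _
  Σ-allVecs-single (suc m) k f (a₀ Vec.∷ v₀) h = begin
    Σ (allVecs (suc m) k) f
      ≡⟨ Σ-concatMap (λ v → map (λ a → a Vec.∷ v) (allFin k)) (allVecs m k) f ⟩
    Σ (allVecs m k) (λ v → Σ (map (λ a → a Vec.∷ v) (allFin k)) f)
      ≡⟨ Σ-cong (allVecs m k) (λ v → Σ-map (λ a → a Vec.∷ v) (allFin k) f) ⟩
    Σ (allVecs m k) (λ v → Σ (allFin k) (λ a → f (a Vec.∷ v)))
      ≡⟨ Σ-allVecs-single m k _ v₀ (λ v v≢v₀ → Σ-zero (allFin k) (λ a → h (a Vec.∷ v) (v≢v₀ ∘ cong Vec.tail))) ⟩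
    Σ (allFin k) (λ a → f (a Vec.∷ v₀))
      ≡⟨ Σ-allFin-single k _ a₀ (λ a a≢a₀ → h (a Vec.∷ v₀) (a≢a₀ ∘ cong Vec.head)) ⟩
    f (a₀ Vec.∷ v₀) ∎

  Σ-allFin-indicator : ∀ n (g : Fin n → A) (k : Fin n) → Σ (allFin n) (λ i → if does (i ≟ k) then g i else ε) ≡ g k
  Σ-allFin-indicator n g k = trans (Σ-allFin-single n _ k off) on
    where
    off : ∀ i → ¬ i ≡ k → (if does (i ≟ k) then g i else ε) ≡ ε
    off i i≢k with i ≟ k
    ... | yes i≡k = ⊥-elim (i≢k i≡k)
    ... | no _ = refl
    on : (if does (k ≟ k) then g k else ε) ≡ g k
    on with k ≟ k
    ... | yes _ = refl
    ... | no k≢k = ⊥-elim (k≢k refl)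

  Σ-allFin-involution : ∀ n (s : Fin n → Fin n) → (∀ i → s (s i) ≡ i) → (g : Fin n → A) →
    Σ (allFin n) (λ i → g (s i)) ≡ Σ (allFin n) g
  Σ-allFin-involution n s s-inv g = begin
    Σ (allFin n) (λ i → g (s i))
      ≡⟨ Σ-cong (allFin n) (λ i → sym (Σ-allFin-indicator n g (s i))) ⟩
    Σ (allFin n) (λ i → Σ (allFin n) (λ k → if does (k ≟ s i) then g k else ε))
      ≡⟨ Σ-swap (allFin n) (allFin n) _ ⟩
    Σ (allFin n) (λ k → Σ (allFin n) (λ i → if does (k ≟ s i) then g k else ε))
      ≡⟨ Σ-cong (allFin n) (λ k → Σ-cong (allFin n) (λ i → flip k i)) ⟩
    Σ (allFin n) (λ k → Σ (allFin n) (λ i → if does (i ≟ s k) then g k else ε))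
      ≡⟨ Σ-cong (allFin n) (λ k → Σ-allFin-indicator n (λ _ → g k) (s k)) ⟩
    Σ (allFin n) g ∎
    where
    flip : ∀ k i → (if does (k ≟ s i) then g k else ε) ≡ (if does (i ≟ s k) then g k else ε)
    flip k i with k ≟ s i | i ≟ s k
    ... | yes _ | yes _ = refl
    ... | no _ | no _ = refl
    ... | yes k≡si | no i≢sk = ⊥-elim (i≢sk (trans (sym (s-inv i)) (cong s (sym k≡si))))
    ... | no k≢si | yes i≡sk = ⊥-elim (k≢si (trans (sym (s-inv k)) (cong s (sym i≡sk))))


module BooleanTests where

  open import Data.Nat using (_<ᵇ_; _≡ᵇ_; _<_; _≤_)
  open import Data.Nat.Properties using (<⇒<ᵇ; <ᵇ⇒<; ≡⇒≡ᵇ; ≡ᵇ⇒≡; <⇒≱)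
  open import Data.Bool using (Bool; true; false; T)
  open import Data.Bool.Properties using (T-≡)
  open import Data.Empty using (⊥-elim)
  open import Function using (Equivalence)
  open import Relation.Binary.PropositionalEquality
  open import Relation.Nullary using (¬_)

  T⇒≡true : ∀ {b} → T b → b ≡ true
  T⇒≡true = Equivalence.to T-≡

  ≡true⇒T : ∀ {b} → b ≡ true → T b
  ≡true⇒T = Equivalence.from T-≡

  bool-ext : ∀ {x y : Bool} → (x ≡ true → y ≡ true) → (y ≡ true → x ≡ true) → x ≡ y
  bool-ext {true} {true} _ _ = refl
  bool-ext {false} {false} _ _ = refl
  bool-ext {true} {false} x⇒y _ = sym (x⇒y refl)
  bool-ext {false} {true} _ y⇒x = y⇒x refl

  <⇒<ᵇ≡true : ∀ {m n} → m < n → (m <ᵇ n) ≡ true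
  <⇒<ᵇ≡true m<n = T⇒≡true (<⇒<ᵇ m<n)

  <ᵇ≡true⇒< : ∀ {m n} → (m <ᵇ n) ≡ true → m < n
  <ᵇ≡true⇒< {m} {n} eq = <ᵇ⇒< m n (≡true⇒T eq)

  ≥⇒<ᵇ≡false : ∀ {m n} → n ≤ m → (m <ᵇ n) ≡ false
  ≥⇒<ᵇ≡false {m} {n} n≤m with m <ᵇ n in eq
  ... | false = refl
  ... | true = ⊥-elim (<⇒≱ (<ᵇ≡true⇒< eq) n≤m)

  ≡ᵇ-refl : ∀ m → (m ≡ᵇ m) ≡ true
  ≡ᵇ-refl m = T⇒≡true (≡⇒≡ᵇ m m refl)

  ≡⇒≡ᵇ≡true : ∀ {m n} → m ≡ n → (m ≡ᵇ n) ≡ true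
  ≡⇒≡ᵇ≡true {m} refl = ≡ᵇ-refl m

  ≡ᵇ≡true⇒≡ : ∀ {m n} → (m ≡ᵇ n) ≡ true → m ≡ n
  ≡ᵇ≡true⇒≡ {m} {n} eq = ≡ᵇ⇒≡ m n (≡true⇒T eq)

  false≢true : ¬ false ≡ true
  false≢true ()

  true≢false : ¬ true ≡ false
  true≢false ()

  ≢⇒≡ᵇ≡false : ∀ {m n} → ¬ m ≡ n → (m ≡ᵇ n) ≡ false
  ≢⇒≡ᵇ≡false {m} {n} m≢n with m ≡ᵇ n in eq
  ... | false = refl
  ... | true = ⊥-elim (m≢n (≡ᵇ≡true⇒≡ eq))


module Sign where

  open import Data.Nat as ℕ using (ℕ; zero; suc; _+_; _<ᵇ_; _<_)
  import Data.Nat.Properties as ℕP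
  open import Data.Nat.DivMod using (_%_; [m+n]%n≡m%n)
  open import Data.Integer using (ℤ; +_; -_)
  open import Data.Bool using (Bool; true; false; if_then_else_; _∧_; not; _xor_)
  open import Data.Bool.Properties
    using (xor-assoc; xor-comm; xor-same; ∧-assoc; ∧-identityʳ; ∧-zeroʳ; ∧-distribʳ-xor; ∧-distribˡ-xor; not-involutive)
  open import Data.Fin using (Fin; toℕ; _≟_)
  open import Data.Fin.Properties using (toℕ-injective)
  open import Data.List using (List; []; _∷_; map; allFin)
  open import Data.Product using (_×_; _,_; proj₁; proj₂)
  open import Data.Empty using (⊥-elim)
  open import Function using (_∘_)
  open import Relation.Binary.PropositionalEquality
  open import Relation.Binary.Definitions using (tri<; tri≈; tri>)
  open import Relation.Nullary using (¬_; yes; no; does)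
  open import Defs
  open BooleanTests
  open ≡-Reasoning

  module X = BigOp _xor_ false xor-assoc xor-comm (λ _ → refl)
  open X using () renaming (Σ to ⊕)

  Inj : ∀ {n} → Map n → Set
  Inj ω = ∀ x y → ω x ≡ ω y → x ≡ y

  swap : ∀ {n} → Fin n → Fin n → Fin n → Fin n
  swap p q k = if does (k ≟ p) then q else (if does (k ≟ q) then p else k)

  swap-matchˡ : ∀ {n} (p q : Fin n) → swap p q p ≡ q
  swap-matchˡ p q with p ≟ p
  ... | yes _ = refl
  ... | no p≢p = ⊥-elim (p≢p refl)

  swap-matchʳ : ∀ {n} (p q : Fin n) → ¬ p ≡ q → swap p q q ≡ p
  swap-matchʳ p q p≢q with q ≟ p
  ... | yes q≡p = ⊥-elim (p≢q (sym q≡p))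
  ... | no _ with q ≟ q
  ...   | yes _ = refl
  ...   | no q≢q = ⊥-elim (q≢q refl)

  swap-other : ∀ {n} (p q i : Fin n) → ¬ i ≡ p → ¬ i ≡ q → swap p q i ≡ i
  swap-other p q i i≢p i≢q with i ≟ p
  ... | yes i≡p = ⊥-elim (i≢p i≡p)
  ... | no _ with i ≟ q
  ...   | yes i≡q = ⊥-elim (i≢q i≡q)
  ...   | no _ = refl

  swap-involutive : ∀ {n} (p q : Fin n) → ¬ p ≡ q → ∀ i → swap p q (swap p q i) ≡ i
  swap-involutive p q p≢q i with i ≟ p
  ... | yes refl = swap-matchʳ i q p≢q
  ... | no i≢p with i ≟ q
  ...   | yes refl = swap-matchˡ p i
  ...   | no i≢q = swap-other p q i i≢p i≢q

  swap-injective : ∀ {n} (p q : Fin n) → ¬ p ≡ q → Inj (swap p q)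
  swap-injective p q p≢q x y eq =
    trans (sym (swap-involutive p q p≢q x)) (trans (cong (swap p q) eq) (swap-involutive p q p≢q y))

  swap-comm : ∀ {n} (p q : Fin n) → ¬ p ≡ q → ∀ k → swap p q k ≡ swap q p k
  swap-comm p q p≢q k with k ≟ p | k ≟ q
  ... | yes refl | yes refl = ⊥-elim (p≢q refl)
  ... | yes refl | no _ = refl
  ... | no _ | yes refl = refl
  ... | no _ | no _ = refl

  ltᵇ : ∀ {n} → Fin n → Fin n → Bool
  ltᵇ i j = toℕ i <ᵇ toℕ j

  inverts : ∀ {n} → Map n → Fin n → Fin n → Bool
  inverts ω i j = toℕ (ω j) <ᵇ toℕ (ω i)

  parity : ∀ {n} → Map n → Bool
  parity {n} ω = ⊕ (pairsLt n) (λ ij → inverts ω (proj₁ ij) (proj₂ ij))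

  if-then-false≡∧ : ∀ b x → (if b then x else false) ≡ b ∧ x
  if-then-false≡∧ true x = refl
  if-then-false≡∧ false x = refl

  ⊕-pairsLt : ∀ n (f : Fin n × Fin n → Bool) →
    ⊕ (pairsLt n) f ≡ ⊕ (allFin n) (λ i → ⊕ (allFin n) (λ j → ltᵇ i j ∧ f (i , j)))
  ⊕-pairsLt n f = begin
    ⊕ (pairsLt n) f
      ≡⟨ X.Σ-concatMap (λ i → map (λ j → i , j) (filterB (ltᵇ i) (allFin n))) (allFin n) f ⟩
    ⊕ (allFin n) (λ i → ⊕ (map (λ j → i , j) (filterB (ltᵇ i) (allFin n))) f)
      ≡⟨ X.Σ-cong (allFin n) (λ i → X.Σ-map (λ j → i , j) (filterB (ltᵇ i) (allFin n)) f) ⟩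
    ⊕ (allFin n) (λ i → ⊕ (filterB (ltᵇ i) (allFin n)) (λ j → f (i , j)))
      ≡⟨ X.Σ-cong (allFin n) (λ i → X.Σ-filterB (ltᵇ i) (allFin n) (λ j → f (i , j))) ⟩
    ⊕ (allFin n) (λ i → ⊕ (allFin n) (λ j → if ltᵇ i j then f (i , j) else false))
      ≡⟨ X.Σ-cong (allFin n) (λ i → X.Σ-cong (allFin n) (λ j → if-then-false≡∧ (ltᵇ i j) (f (i , j)))) ⟩
    ⊕ (allFin n) (λ i → ⊕ (allFin n) (λ j → ltᵇ i j ∧ f (i , j))) ∎

  isEven : ℕ → Bool
  isEven zero = true
  isEven (suc m) = not (isEven m)

  isEven-countB : ∀ {A : Set} (p : A → Bool) (l : List A) → isEven (countB p l) ≡ not (⊕ l p)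
  isEven-countB p [] = refl
  isEven-countB p (x ∷ xs) with p x
  ... | true = cong not (isEven-countB p xs)
  ... | false = isEven-countB p xs

  isEven-%2 : ∀ m → does (m % 2 ℕ.≟ 0) ≡ isEven m
  isEven-%2 zero = refl
  isEven-%2 (suc zero) = refl
  isEven-%2 (suc (suc m)) = begin
    does (suc (suc m) % 2 ℕ.≟ 0)  ≡⟨ cong (λ x → does (x % 2 ℕ.≟ 0)) (ℕP.+-comm 2 m) ⟩
    does ((m + 2) % 2 ℕ.≟ 0)      ≡⟨ cong (λ x → does (x ℕ.≟ 0)) ([m+n]%n≡m%n m 2) ⟩
    does (m % 2 ℕ.≟ 0)            ≡⟨ isEven-%2 m ⟩
    isEven m                      ≡⟨ sym (not-involutive (isEven m)) ⟩
    isEven (suc (suc m))          ∎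

  signOf : Bool → ℤ
  signOf b = if b then - (+ 1) else + 1

  sgn≡signOf-parity : ∀ {n} (ω : Map n) → sgn ω ≡ signOf (parity ω)
  sgn≡signOf-parity ω = begin
    sgn ω                                        ≡⟨ cong (λ b → if b then + 1 else - (+ 1)) (isEven-%2 (inversions ω)) ⟩
    (if isEven (inversions ω) then + 1 else - (+ 1))
      ≡⟨ cong (λ b → if b then + 1 else - (+ 1)) (isEven-countB (λ ij → inverts ω (proj₁ ij) (proj₂ ij)) (pairsLt _)) ⟩
    (if not (parity ω) then + 1 else - (+ 1))   ≡⟨ if-not (parity ω) ⟩
    signOf (parity ω)                            ∎
    where
    if-not : ∀ b → (if not b then + 1 else - (+ 1)) ≡ signOf b
    if-not true = refl
    if-not false = refl

  parity-cong : ∀ {n} (f g : Map n) → (∀ k → f k ≡ g k) → parity f ≡ parity g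
  parity-cong {n} f g f≗g =
    X.Σ-cong (pairsLt n) (λ ij → cong₂ _<ᵇ_ (cong toℕ (f≗g (proj₂ ij))) (cong toℕ (f≗g (proj₁ ij))))

  parity-id : ∀ n → parity {n} (λ k → k) ≡ false
  parity-id n = trans (⊕-pairsLt n _) (X.Σ-zero (allFin n) (λ i → X.Σ-zero (allFin n) (λ j → <ᵇ-asym (toℕ i) (toℕ j))))
    where
    <ᵇ-asym : ∀ a b → ((a <ᵇ b) ∧ (b <ᵇ a)) ≡ false
    <ᵇ-asym a b with a <ᵇ b in a<b
    ... | false = refl
    ... | true = ≥⇒<ᵇ≡false {b} {a} (ℕP.<⇒≤ (<ᵇ≡true⇒< a<b))

  data Position (a P Q : ℕ) : Set where
    below : (a <ᵇ P) ≡ true → (P <ᵇ a) ≡ false → (a <ᵇ Q) ≡ true → (Q <ᵇ a) ≡ false → Position a P Q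
    inside : (a <ᵇ P) ≡ false → (P <ᵇ a) ≡ true → (a <ᵇ Q) ≡ true → (Q <ᵇ a) ≡ false → Position a P Q
    above : (a <ᵇ P) ≡ false → (P <ᵇ a) ≡ true → (a <ᵇ Q) ≡ false → (Q <ᵇ a) ≡ true → Position a P Q

  position : ∀ a P Q → P < Q → ¬ a ≡ P → ¬ a ≡ Q → Position a P Q
  position a P Q P<Q a≢P a≢Q with ℕP.<-cmp a P
  ... | tri≈ _ a≡P _ = ⊥-elim (a≢P a≡P)
  ... | tri< a<P _ _ = below (<⇒<ᵇ≡true a<P) (≥⇒<ᵇ≡false (ℕP.<⇒≤ a<P))
                             (<⇒<ᵇ≡true a<Q) (≥⇒<ᵇ≡false (ℕP.<⇒≤ a<Q))
    where a<Q = ℕP.<-trans a<P P<Q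
  ... | tri> _ _ P<a with ℕP.<-cmp a Q
  ...   | tri≈ _ a≡Q _ = ⊥-elim (a≢Q a≡Q)
  ...   | tri< a<Q _ _ = inside (≥⇒<ᵇ≡false (ℕP.<⇒≤ P<a)) (<⇒<ᵇ≡true P<a) (<⇒<ᵇ≡true a<Q) (≥⇒<ᵇ≡false (ℕP.<⇒≤ a<Q))
  ...   | tri> _ _ Q<a = above (≥⇒<ᵇ≡false (ℕP.<⇒≤ P<a)) (<⇒<ᵇ≡true P<a) (≥⇒<ᵇ≡false (ℕP.<⇒≤ Q<a)) (<⇒<ᵇ≡true Q<a)

  ltᵇ-irrefl : ∀ {n} (x : Fin n) → ltᵇ x x ≡ false
  ltᵇ-irrefl x = ≥⇒<ᵇ≡false (ℕP.≤-refl {toℕ x})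

  ≢⇒toℕ-≢ : ∀ {n} {x y : Fin n} → ¬ x ≡ y → ¬ toℕ x ≡ toℕ y
  ≢⇒toℕ-≢ x≢y = x≢y ∘ toℕ-injective

  ≢⇒<ᵇ-xor-<ᵇ : ∀ a b → ¬ a ≡ b → (b <ᵇ a) xor (a <ᵇ b) ≡ true
  ≢⇒<ᵇ-xor-<ᵇ a b a≢b with ℕP.<-cmp a b
  ... | tri≈ _ a≡b _ = ⊥-elim (a≢b a≡b)
  ... | tri< a<b _ _ rewrite <⇒<ᵇ≡true a<b | ≥⇒<ᵇ≡false {b} {a} (ℕP.<⇒≤ a<b) = refl
  ... | tri> _ _ b<a rewrite <⇒<ᵇ≡true b<a | ≥⇒<ᵇ≡false {a} {b} (ℕP.<⇒≤ b<a) = refl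

  xor≡true⇒≡not : ∀ a b → a xor b ≡ true → a ≡ not b
  xor≡true⇒≡not true false _ = refl
  xor≡true⇒≡not false true _ = refl

  module _ {n : ℕ} where

    ⊕² : (Fin n → Fin n → Bool) → Bool
    ⊕² f = ⊕ (allFin n) (λ i → ⊕ (allFin n) (λ j → f i j))

    ⊕²-xor : ∀ (f g : Fin n → Fin n → Bool) → ⊕² (λ i j → f i j xor g i j) ≡ ⊕² f xor ⊕² g
    ⊕²-xor f g = trans (X.Σ-cong (allFin n) (λ i → X.Σ-∙ (allFin n) (f i) (g i))) (X.Σ-∙ (allFin n) _ _)

    ⊕²-cong : ∀ (f g : Fin n → Fin n → Bool) → (∀ i j → f i j ≡ g i j) → ⊕² f ≡ ⊕² g
    ⊕²-cong f g f≗g = X.Σ-cong (allFin n) (λ i → X.Σ-cong (allFin n) (f≗g i))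

    ⊕²-xor-∧ : ∀ (f g h : Fin n → Fin n → Bool) →
      ⊕² (λ i j → (f i j xor g i j) ∧ h i j) ≡ ⊕² (λ i j → f i j ∧ h i j) xor ⊕² (λ i j → g i j ∧ h i j)
    ⊕²-xor-∧ f g h = trans (⊕²-cong (λ i j → (f i j xor g i j) ∧ h i j) (λ i j → (f i j ∧ h i j) xor (g i j ∧ h i j))
                             (λ i j → ∧-distribʳ-xor (h i j) (f i j) (g i j)))
                           (⊕²-xor (λ i j → f i j ∧ h i j) (λ i j → g i j ∧ h i j))

    ⊕-∧ˡ : ∀ {A : Set} (b : Bool) (l : List A) (f : A → Bool) → ⊕ l (λ x → b ∧ f x) ≡ b ∧ ⊕ l f
    ⊕-∧ˡ true l f = refl
    ⊕-∧ˡ false l f = X.Σ-ε l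

    ⊕-point : ∀ (a : Fin n) (f : Fin n → Bool) → ⊕ (allFin n) (λ j → does (j ≟ a) ∧ f j) ≡ f a
    ⊕-point a f = trans (X.Σ-cong (allFin n) (λ j → sym (if-then-false≡∧ (does (j ≟ a)) (f j)))) (X.Σ-allFin-indicator n f a)

    ⊕²-pointˡ : ∀ (a : Fin n) (f : Fin n → Fin n → Bool) → ⊕² (λ i j → does (i ≟ a) ∧ f i j) ≡ ⊕ (allFin n) (f a)
    ⊕²-pointˡ a f = trans (X.Σ-cong (allFin n) (λ i → ⊕-∧ˡ (does (i ≟ a)) (allFin n) (f i))) (⊕-point a (λ i → ⊕ (allFin n) (f i)))

    ⊕²-pointʳ : ∀ (a : Fin n) (f : Fin n → Fin n → Bool) → ⊕² (λ i j → does (j ≟ a) ∧ f i j) ≡ ⊕ (allFin n) (λ i → f i a)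
    ⊕²-pointʳ a f = X.Σ-cong (allFin n) (λ i → ⊕-point a (f i))

  -- Transposing p < q reverses the order of the pair (p, q) and of the pairs (p, j), (j, q) with
  -- p < j < q; for an injective ω these pairs contribute matching inversions, which cancel mod 2.
  module SwapDefect {n : ℕ} (p q : Fin n) (p<q : toℕ p < toℕ q) where

    between : Fin n → Bool
    between j = ltᵇ p j ∧ ltᵇ j q

    pairTerm : Fin n → Fin n → Fin n → Fin n → Bool
    pairTerm a b i j = does (i ≟ a) ∧ does (j ≟ b)

    rowTerm : Fin n → Fin n → Fin n → Bool
    rowTerm a i j = (does (i ≟ a) ∧ between j) xor (does (j ≟ a) ∧ between i)

    defect : Fin n → Fin n → Bool
    defect i j = (pairTerm p q i j xor pairTerm q p i j) xor (rowTerm p i j xor rowTerm q i j)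

    ltᵇ-swap-xor : ∀ i j → ltᵇ (swap p q i) (swap p q j) xor ltᵇ i j ≡ defect i j
    ltᵇ-swap-xor i j with i ≟ p | i ≟ q | j ≟ p | j ≟ q
    ... | yes refl | yes i≡q | _ | _ = ⊥-elim (ℕP.<-irrefl (cong toℕ i≡q) p<q)
    ... | _ | _ | yes refl | yes j≡q = ⊥-elim (ℕP.<-irrefl (cong toℕ j≡q) p<q)
    ... | yes refl | no _ | yes refl | no _ rewrite ltᵇ-irrefl i | ltᵇ-irrefl q = refl
    ... | yes refl | no _ | no _ | yes refl rewrite ltᵇ-irrefl i | ltᵇ-irrefl j | <⇒<ᵇ≡true p<q | ≥⇒<ᵇ≡false (ℕP.<⇒≤ p<q) = refl
    ... | no _ | yes refl | yes refl | no _ rewrite ltᵇ-irrefl i | ltᵇ-irrefl j | <⇒<ᵇ≡true p<q | ≥⇒<ᵇ≡false (ℕP.<⇒≤ p<q) = refl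
    ... | no _ | yes refl | no _ | yes refl rewrite ltᵇ-irrefl i | ltᵇ-irrefl p | <⇒<ᵇ≡true p<q = refl
    ... | yes refl | no _ | no j≢p | no j≢q with position (toℕ j) (toℕ i) (toℕ q) p<q (≢⇒toℕ-≢ j≢p) (≢⇒toℕ-≢ j≢q)
    ...   | below _ b _ d rewrite b | d = refl
    ...   | inside _ b c d rewrite b | c | d = refl
    ...   | above _ b c d rewrite b | c | d = refl
    ltᵇ-swap-xor i j | no _ | yes refl | no j≢p | no j≢q with position (toℕ j) (toℕ p) (toℕ i) p<q (≢⇒toℕ-≢ j≢p) (≢⇒toℕ-≢ j≢q)
    ...   | below _ b _ d rewrite b | d = refl
    ...   | inside _ b c d rewrite b | c | d = refl
    ...   | above _ b c d rewrite b | c | d = refl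
    ltᵇ-swap-xor i j | no i≢p | no i≢q | yes refl | no _ with position (toℕ i) (toℕ j) (toℕ q) p<q (≢⇒toℕ-≢ i≢p) (≢⇒toℕ-≢ i≢q)
    ...   | below a b c _ rewrite a | b | c = refl
    ...   | inside a b c _ rewrite a | b | c = refl
    ...   | above a b c _ rewrite a | b | c = refl
    ltᵇ-swap-xor i j | no i≢p | no i≢q | no _ | yes refl with position (toℕ i) (toℕ p) (toℕ j) p<q (≢⇒toℕ-≢ i≢p) (≢⇒toℕ-≢ i≢q)
    ...   | below a b c _ rewrite a | b | c = refl
    ...   | inside a b c _ rewrite a | b | c = refl
    ...   | above a b c _ rewrite a | b | c = refl
    ltᵇ-swap-xor i j | no _ | no _ | no _ | no _ = xor-same (ltᵇ i j)

    p≢q : ¬ p ≡ q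
    p≢q p≡q = ℕP.<-irrefl (cong toℕ p≡q) p<q

    between-p : between p ≡ false
    between-p = cong (_∧ ltᵇ p q) (ltᵇ-irrefl p)

    between-q : between q ≡ false
    between-q = trans (cong (ltᵇ p q ∧_) (ltᵇ-irrefl q)) (∧-zeroʳ (ltᵇ p q))

    module _ (ω : Map n) (ω-inj : Inj ω) where

      W : Fin n → Fin n → Bool
      W = inverts ω

      ⊕²-pairTerm : ∀ a b → ⊕² (λ i j → pairTerm a b i j ∧ W i j) ≡ W a b
      ⊕²-pairTerm a b = begin
        ⊕² (λ i j → pairTerm a b i j ∧ W i j)
          ≡⟨ ⊕²-cong _ _ (λ i j → ∧-assoc (does (i ≟ a)) (does (j ≟ b)) (W i j)) ⟩
        ⊕² (λ i j → does (i ≟ a) ∧ (does (j ≟ b) ∧ W i j))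
          ≡⟨ ⊕²-pointˡ a _ ⟩
        ⊕ (allFin n) (λ j → does (j ≟ b) ∧ W a j)
          ≡⟨ ⊕-point b (W a) ⟩
        W a b ∎

      between-inverts-xor : ∀ a → between a ≡ false → ∀ j → between j ∧ (W a j xor W j a) ≡ between j
      between-inverts-xor a a-out j with j ≟ a
      ... | yes refl = trans (cong (_∧ (W j j xor W j j)) a-out) (sym a-out)
      ... | no j≢a = trans (cong (between j ∧_) (≢⇒<ᵇ-xor-<ᵇ (toℕ (ω a)) (toℕ (ω j)) ωa≢ωj)) (∧-identityʳ (between j))
        where
        ωa≢ωj : ¬ toℕ (ω a) ≡ toℕ (ω j)
        ωa≢ωj eq = j≢a (sym (ω-inj a j (toℕ-injective eq)))

      ⊕²-rowTerm : ∀ a → between a ≡ false → ⊕² (λ i j → rowTerm a i j ∧ W i j) ≡ ⊕ (allFin n) between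
      ⊕²-rowTerm a a-out = begin
        ⊕² (λ i j → rowTerm a i j ∧ W i j)
          ≡⟨ ⊕²-xor-∧ (λ i j → does (i ≟ a) ∧ between j) (λ i j → does (j ≟ a) ∧ between i) W ⟩
        ⊕² (λ i j → (does (i ≟ a) ∧ between j) ∧ W i j) xor ⊕² (λ i j → (does (j ≟ a) ∧ between i) ∧ W i j)
          ≡⟨ cong₂ _xor_ (trans (⊕²-cong _ _ (λ i j → ∧-assoc (does (i ≟ a)) (between j) (W i j))) (⊕²-pointˡ a _))
                         (trans (⊕²-cong _ _ (λ i j → ∧-assoc (does (j ≟ a)) (between i) (W i j))) (⊕²-pointʳ a _)) ⟩
        ⊕ (allFin n) (λ j → between j ∧ W a j) xor ⊕ (allFin n) (λ j → between j ∧ W j a)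
          ≡⟨ sym (X.Σ-∙ (allFin n) _ _) ⟩
        ⊕ (allFin n) (λ j → (between j ∧ W a j) xor (between j ∧ W j a))
          ≡⟨ X.Σ-cong (allFin n) (λ j → sym (∧-distribˡ-xor (between j) (W a j) (W j a))) ⟩
        ⊕ (allFin n) (λ j → between j ∧ (W a j xor W j a))
          ≡⟨ X.Σ-cong (allFin n) (between-inverts-xor a a-out) ⟩
        ⊕ (allFin n) between ∎

      ⊕²-defect : ⊕² (λ i j → defect i j ∧ W i j) ≡ true
      ⊕²-defect = begin
        ⊕² (λ i j → defect i j ∧ W i j)
          ≡⟨ ⊕²-xor-∧ pairs rows W ⟩
        ⊕² (λ i j → pairs i j ∧ W i j) xor ⊕² (λ i j → rows i j ∧ W i j)
          ≡⟨ cong₂ _xor_ (⊕²-xor-∧ (pairTerm p q) (pairTerm q p) W) (⊕²-xor-∧ (rowTerm p) (rowTerm q) W) ⟩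
        (⊕² (λ i j → pairTerm p q i j ∧ W i j) xor ⊕² (λ i j → pairTerm q p i j ∧ W i j)) xor
        (⊕² (λ i j → rowTerm p i j ∧ W i j) xor ⊕² (λ i j → rowTerm q i j ∧ W i j))
          ≡⟨ cong₂ _xor_ (cong₂ _xor_ (⊕²-pairTerm p q) (⊕²-pairTerm q p))
                         (cong₂ _xor_ (⊕²-rowTerm p between-p) (⊕²-rowTerm q between-q)) ⟩
        (W p q xor W q p) xor (⊕ (allFin n) between xor ⊕ (allFin n) between)
          ≡⟨ cong₂ _xor_ (≢⇒<ᵇ-xor-<ᵇ (toℕ (ω p)) (toℕ (ω q)) (p≢q ∘ ω-inj p q ∘ toℕ-injective))
                         (xor-same (⊕ (allFin n) between)) ⟩
        true ∎
        where
        pairs rows : Fin n → Fin n → Bool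
        pairs i j = pairTerm p q i j xor pairTerm q p i j
        rows i j = rowTerm p i j xor rowTerm q i j

      parity-∘swap : parity (ω ∘ swap p q) ≡ ⊕² (λ i j → ltᵇ (swap p q i) (swap p q j) ∧ W i j)
      parity-∘swap = begin
        parity (ω ∘ s)
          ≡⟨ ⊕-pairsLt n _ ⟩
        ⊕² (λ i j → ltᵇ i j ∧ W (s i) (s j))
          ≡⟨ ⊕²-cong _ _ (λ i j → cong₂ (λ x y → ltᵇ x y ∧ W (s i) (s j)) (sym (s-inv i)) (sym (s-inv j))) ⟩
        ⊕² (λ i j → f (s i) (s j))
          ≡⟨ X.Σ-cong (allFin n) (λ i → X.Σ-allFin-involution n s s-inv (f (s i))) ⟩
        ⊕ (allFin n) (λ i → ⊕ (allFin n) (f (s i)))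
          ≡⟨ X.Σ-allFin-involution n s s-inv (λ i → ⊕ (allFin n) (f i)) ⟩
        ⊕² f ∎
        where
        s : Fin n → Fin n
        s = swap p q
        s-inv : ∀ i → s (s i) ≡ i
        s-inv = swap-involutive p q p≢q
        f : Fin n → Fin n → Bool
        f i j = ltᵇ (s i) (s j) ∧ W i j

      parity-swap< : parity (ω ∘ swap p q) ≡ not (parity ω)
      parity-swap< = xor≡true⇒≡not _ _ (begin
        parity (ω ∘ swap p q) xor parity ω
          ≡⟨ cong₂ _xor_ parity-∘swap (⊕-pairsLt n _) ⟩
        ⊕² (λ i j → ltᵇ (swap p q i) (swap p q j) ∧ W i j) xor ⊕² (λ i j → ltᵇ i j ∧ W i j)
          ≡⟨ sym (⊕²-xor-∧ (λ i j → ltᵇ (swap p q i) (swap p q j)) ltᵇ W) ⟩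
        ⊕² (λ i j → (ltᵇ (swap p q i) (swap p q j) xor ltᵇ i j) ∧ W i j)
          ≡⟨ ⊕²-cong _ _ (λ i j → cong (_∧ W i j) (ltᵇ-swap-xor i j)) ⟩
        ⊕² (λ i j → defect i j ∧ W i j)
          ≡⟨ ⊕²-defect ⟩
        true ∎)

  parity-swap : ∀ {n} (ω : Map n) (p q : Fin n) → ¬ p ≡ q → Inj ω → parity (ω ∘ swap p q) ≡ not (parity ω)
  parity-swap ω p q p≢q ω-inj with ℕP.<-cmp (toℕ p) (toℕ q)
  ... | tri< p<q _ _ = SwapDefect.parity-swap< p q p<q ω ω-inj
  ... | tri≈ _ p≡q _ = ⊥-elim (p≢q (toℕ-injective p≡q))
  ... | tri> _ _ q<p = trans (parity-cong _ _ (cong ω ∘ swap-comm p q p≢q)) (SwapDefect.parity-swap< q p q<p ω ω-inj)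

  sgn-swap : ∀ {n} (ω : Map n) (p q : Fin n) → ¬ p ≡ q → Inj ω → sgn (ω ∘ swap p q) ≡ - sgn ω
  sgn-swap ω p q p≢q ω-inj = begin
    sgn (ω ∘ swap p q)               ≡⟨ sgn≡signOf-parity (ω ∘ swap p q) ⟩
    signOf (parity (ω ∘ swap p q))   ≡⟨ cong signOf (parity-swap ω p q p≢q ω-inj) ⟩
    signOf (not (parity ω))          ≡⟨ signOf-not (parity ω) ⟩
    - signOf (parity ω)              ≡⟨ cong -_ (sym (sgn≡signOf-parity ω)) ⟩
    - sgn ω                          ∎
    where
    signOf-not : ∀ b → signOf (not b) ≡ - signOf b
    signOf-not true = refl
    signOf-not false = refl

  sgn-cong : ∀ {n} (f g : Map n) → (∀ k → f k ≡ g k) → sgn f ≡ sgn g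
  sgn-cong f g f≗g = trans (sgn≡signOf-parity f) (trans (cong signOf (parity-cong f g f≗g)) (sym (sgn≡signOf-parity g)))

  sgn-id : ∀ n → sgn {n} (λ k → k) ≡ + 1
  sgn-id n = trans (sgn≡signOf-parity {n} (λ k → k)) (cong signOf (parity-id n))


module Coefficients where

  open import Data.Nat as ℕ using (ℕ)
  open import Data.Integer as ℤ using (ℤ; +_; -_)
  open import Data.Integer.Properties as ℤP using (+-assoc; +-comm; +-identityˡ; +-identityʳ)
  open import Data.Bool using (Bool; true; false; if_then_else_)
  open import Data.Fin using (Fin)
  open import Data.Fin.Properties using () renaming (_≟_ to _≟ᶠ_)
  open import Data.List using (List; []; _∷_; _++_; map; concat; concatMap; zipWith)
  open import Data.Vec as Vec using (tabulate)
  open import Data.Vec.Properties using (≡-dec)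
  open import Data.Product using (_×_; _,_; proj₁; proj₂)
  open import Function using (_∘_)
  open import Relation.Binary.PropositionalEquality
  open import Relation.Nullary using (does; yes; no)
  open import Defs
  open ≡-Reasoning

  module Z = BigOp ℤ._+_ (+ 0) +-assoc +-comm +-identityˡ
  open Z using () renaming (Σ to Σz)

  contribution : ∀ {n} → Exps n → Exps n → ℤ → ℤ
  contribution e a c = if does (≡-dec ℕ._≟_ e a) then c else + 0

  coeff≡Σ : ∀ {n} (p : Poly n) (a : Exps n) → coeff p a ≡ Σz p (λ t → contribution (proj₂ t) a (proj₁ t))
  coeff≡Σ [] a = refl
  coeff≡Σ ((c , e) ∷ p) a with ≡-dec ℕ._≟_ e a
  ... | yes _ = cong (λ x → c ℤ.+ x) (coeff≡Σ p a)
  ... | no _ = trans (coeff≡Σ p a) (sym (+-identityˡ _))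

  Σz-concat : ∀ {A : Set} (L : List (List A)) (f : A → ℤ) → Σz (concat L) f ≡ Σz L (λ l → Σz l f)
  Σz-concat [] f = refl
  Σz-concat (l ∷ L) f = trans (Z.Σ-++ l (concat L) f) (cong (λ x → Σz l f ℤ.+ x) (Σz-concat L f))

  Σz-*ˡ : ∀ {A : Set} (c : ℤ) (l : List A) (f : A → ℤ) → Σz l (λ x → c ℤ.* f x) ≡ c ℤ.* Σz l f
  Σz-*ˡ c [] f = sym (ℤP.*-zeroʳ c)
  Σz-*ˡ c (x ∷ l) f = trans (cong (λ y → c ℤ.* f x ℤ.+ y) (Σz-*ˡ c l f)) (sym (ℤP.*-distribˡ-+ c (f x) (Σz l f)))

  contribution-*ˡ : ∀ {n} (e a : Exps n) c x → contribution e a (c ℤ.* x) ≡ c ℤ.* contribution e a x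
  contribution-*ˡ e a c x with does (≡-dec ℕ._≟_ e a)
  ... | true = refl
  ... | false = sym (ℤP.*-zeroʳ c)

  coeff-scaleP : ∀ {n} c (p : Poly n) a → coeff (scaleP c p) a ≡ c ℤ.* coeff p a
  coeff-scaleP c p a = begin
    coeff (scaleP c p) a
      ≡⟨ coeff≡Σ (scaleP c p) a ⟩
    Σz (scaleP c p) (λ t → contribution (proj₂ t) a (proj₁ t))
      ≡⟨ Z.Σ-map _ p _ ⟩
    Σz p (λ t → contribution (proj₂ t) a (c ℤ.* proj₁ t))
      ≡⟨ Z.Σ-cong p (λ t → contribution-*ˡ (proj₂ t) a c (proj₁ t)) ⟩
    Σz p (λ t → c ℤ.* contribution (proj₂ t) a (proj₁ t))
      ≡⟨ Σz-*ˡ c p _ ⟩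
    c ℤ.* Σz p (λ t → contribution (proj₂ t) a (proj₁ t))
      ≡⟨ cong (c ℤ.*_) (sym (coeff≡Σ p a)) ⟩
    c ℤ.* coeff p a ∎

  coeff-εT-monomial : ∀ {n} (T : Tab (Fin n)) (E a : Exps n) →
    coeff (εT T (monomial E)) a ≡
    Σz (filterB (inC T) (allPerms n)) (λ τ → Σz (filterB (inR T) (allPerms n)) (λ σ →
      contribution (actExps τ (actExps σ E)) a (sgn τ ℤ.* + 1)))
  coeff-εT-monomial {n} T E a = begin
    coeff (sumP (concatMap terms C)) a
      ≡⟨ coeff≡Σ (concat (concatMap terms C)) a ⟩
    Σz (concat (concatMap terms C)) f
      ≡⟨ Σz-concat (concatMap terms C) f ⟩
    Σz (concatMap terms C) (λ l → Σz l f)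
      ≡⟨ Z.Σ-concatMap terms C (λ l → Σz l f) ⟩
    Σz C (λ τ → Σz (map (term τ) R) (λ l → Σz l f))
      ≡⟨ Z.Σ-cong C (λ τ → Z.Σ-map (term τ) R (λ l → Σz l f)) ⟩
    Σz C (λ τ → Σz R (λ σ → Σz (term τ σ) f))
      ≡⟨ Z.Σ-cong C (λ τ → Z.Σ-cong R (λ σ → +-identityʳ _)) ⟩
    Σz C (λ τ → Σz R (λ σ → contribution (actExps τ (actExps σ E)) a (sgn τ ℤ.* + 1))) ∎
    where
    C R : List (Map n)
    C = filterB (inC T) (allPerms n)
    R = filterB (inR T) (allPerms n)
    term : Map n → Map n → Poly n
    term τ σ = scaleP (sgn τ) (act τ (act σ (monomial E)))
    terms : Map n → List (Poly n)
    terms τ = map (term τ) R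
    f : ℤ × Exps n → ℤ
    f t = contribution (proj₂ t) a (proj₁ t)

  unitExps : ∀ {n} → Fin n → Exps n
  unitExps t = tabulate (λ j → if does (t ≟ᶠ j) then 1 else 0)

  varDiff : ∀ {n} → Fin n → Fin n → Poly n
  varDiff t b = var t -P var b

  choices : ∀ {n} → List (Fin n) → List (Fin n) → List (List Bool)
  choices (t ∷ ts) (b ∷ bs) = map (false ∷_) (choices ts bs) ++ map (true ∷_) (choices ts bs)
  choices [] _ = [] ∷ []
  choices (t ∷ ts) [] = [] ∷ []

  -- the factor -1 * 1 is the coefficient that _-P_ gives the subtracted variable
  choiceSign : List Bool → ℤ
  choiceSign [] = + 1
  choiceSign (false ∷ c) = + 1 ℤ.* choiceSign c
  choiceSign (true ∷ c) = (- (+ 1) ℤ.* + 1) ℤ.* choiceSign c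

  choiceExps : ∀ {n} → List (Fin n) → List (Fin n) → List Bool → Exps n
  choiceExps (t ∷ ts) (b ∷ bs) (x ∷ c) = Vec.zipWith ℕ._+_ (unitExps (if x then b else t)) (choiceExps ts bs c)
  choiceExps [] _ _ = Vec.replicate _ 0
  choiceExps (t ∷ ts) [] _ = Vec.replicate _ 0
  choiceExps (t ∷ ts) (b ∷ bs) [] = Vec.replicate _ 0

  Σz-prodP-varDiff : ∀ {n} (ts bs : List (Fin n)) (g : ℤ × Exps n → ℤ) →
    Σz (prodP (zipWith varDiff ts bs)) g ≡ Σz (choices ts bs) (λ c → g (choiceSign c , choiceExps ts bs c))
  Σz-prodP-varDiff [] bs g = refl
  Σz-prodP-varDiff (t ∷ ts) [] g = refl
  Σz-prodP-varDiff {n} (t ∷ ts) (b ∷ bs) g = begin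
    Σz (concatMap (λ s → map (s ·_) Q) (tTerm ∷ bTerm ∷ [])) g
      ≡⟨ Z.Σ-concatMap (λ s → map (s ·_) Q) (tTerm ∷ bTerm ∷ []) g ⟩
    Σz (map (tTerm ·_) Q) g ℤ.+ (Σz (map (bTerm ·_) Q) g ℤ.+ + 0)
      ≡⟨ cong₂ ℤ._+_ (branch tTerm) (trans (+-identityʳ _) (branch bTerm)) ⟩
    Σz C (λ c → h (false ∷ c)) ℤ.+ Σz C (λ c → h (true ∷ c))
      ≡⟨ sym (cong₂ ℤ._+_ (Z.Σ-map (false ∷_) C h) (Z.Σ-map (true ∷_) C h)) ⟩
    Σz (map (false ∷_) C) h ℤ.+ Σz (map (true ∷_) C) h
      ≡⟨ sym (Z.Σ-++ (map (false ∷_) C) (map (true ∷_) C) h) ⟩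
    Σz (choices (t ∷ ts) (b ∷ bs)) h ∎
    where
    Q : Poly n
    Q = prodP (zipWith varDiff ts bs)
    C : List (List Bool)
    C = choices ts bs
    _·_ : ℤ × Exps n → ℤ × Exps n → ℤ × Exps n
    s · s′ = proj₁ s ℤ.* proj₁ s′ , Vec.zipWith ℕ._+_ (proj₂ s) (proj₂ s′)
    tTerm bTerm : ℤ × Exps n
    tTerm = + 1 , unitExps t
    bTerm = - (+ 1) ℤ.* + 1 , unitExps b
    h : List Bool → ℤ
    h c = g (choiceSign c , choiceExps (t ∷ ts) (b ∷ bs) c)
    branch : ∀ s → Σz (map (s ·_) Q) g ≡ Σz C (λ c → g (s · (choiceSign c , choiceExps ts bs c)))
    branch s = trans (Z.Σ-map (s ·_) Q g) (Σz-prodP-varDiff ts bs (g ∘ (s ·_)))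


module Permutations where

  open import Data.Nat as ℕ using (ℕ; suc; _<_)
  import Data.Nat.Properties as ℕP
  open import Data.Bool using (Bool; true; false; if_then_else_; _∧_; not)
  open import Data.Bool.Properties using (∧-assoc; ∧-comm; ∧-conicalˡ; ∧-conicalʳ)
  open import Data.Fin using (Fin; toℕ; _≟_; punchOut)
  open import Data.Fin.Properties using (toℕ-injective; pigeonhole; punchOut-injective; any?)
  open import Data.List using (List; []; _∷_; map; allFin)
  open import Data.List.Membership.Propositional using (_∈_)
  open import Data.List.Membership.Propositional.Properties using (∈-allFin)
  open import Data.List.Relation.Unary.Any using (here; there)
  open import Data.Vec using (Vec; lookup)
  open import Data.Vec.Properties using (lookup∘tabulate; tabulate∘lookup; tabulate-cong)
  open import Data.Product using (_×_; _,_; ∃)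
  open import Data.Empty using (⊥; ⊥-elim)
  open import Relation.Binary.PropositionalEquality
  open import Relation.Binary.Definitions using (tri<; tri≈; tri>)
  open import Relation.Nullary using (¬_; yes; no; does)
  open import Defs
  open BooleanTests
  open Sign using (Inj; ltᵇ)

  module N = BigOp ℕ._+_ 0 ℕP.+-assoc ℕP.+-comm (λ _ → refl)
  module A = BigOp _∧_ true ∧-assoc ∧-comm (λ _ → refl)

  vec-ext : ∀ {A : Set} {n} (xs ys : Vec A n) → (∀ i → lookup xs i ≡ lookup ys i) → xs ≡ ys
  vec-ext xs ys p = trans (sym (tabulate∘lookup xs)) (trans (tabulate-cong p) (tabulate∘lookup ys))

  sumℕ≡Σ : ∀ {A : Set} (l : List A) (f : A → ℕ) → sumℕ (map f l) ≡ N.Σ l f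
  sumℕ≡Σ [] f = refl
  sumℕ≡Σ (x ∷ l) f = cong (f x ℕ.+_) (sumℕ≡Σ l f)

  allB≡Σ : ∀ {A : Set} (p : A → Bool) (l : List A) → allB p l ≡ A.Σ l p
  allB≡Σ p [] = refl
  allB≡Σ p (x ∷ l) = cong (p x ∧_) (allB≡Σ p l)

  all-true⇒ : ∀ {B : Set} (l : List B) (f : B → Bool) → A.Σ l f ≡ true → ∀ {x} → x ∈ l → f x ≡ true
  all-true⇒ (y ∷ l) f eq (here refl) = ∧-conicalˡ _ _ eq
  all-true⇒ (y ∷ l) f eq (there x∈l) = all-true⇒ l f (∧-conicalʳ _ _ eq) x∈l

  all-true⇐ : ∀ {B : Set} (l : List B) (f : B → Bool) → (∀ x → f x ≡ true) → A.Σ l f ≡ true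
  all-true⇐ [] f h = refl
  all-true⇐ (y ∷ l) f h rewrite h y = all-true⇐ l f h

  allB-allFin-true⇒ : ∀ n (f : Fin n → Bool) → allB f (allFin n) ≡ true → ∀ i → f i ≡ true
  allB-allFin-true⇒ n f eq i = all-true⇒ (allFin n) f (trans (sym (allB≡Σ f (allFin n))) eq) (∈-allFin i)

  allB-allFin-true⇐ : ∀ n (f : Fin n → Bool) → (∀ i → f i ≡ true) → allB f (allFin n) ≡ true
  allB-allFin-true⇐ n f h = trans (allB≡Σ f (allFin n)) (all-true⇐ (allFin n) f h)

  allB-pairsLt : ∀ n (f : Fin n × Fin n → Bool) →
    allB f (pairsLt n) ≡ A.Σ (allFin n) (λ i → A.Σ (allFin n) (λ j → if ltᵇ i j then f (i , j) else true))
  allB-pairsLt n f =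
    trans (allB≡Σ f (pairsLt n))
    (trans (A.Σ-concatMap (λ i → map (λ j → i , j) (filterB (ltᵇ i) (allFin n))) (allFin n) f)
    (A.Σ-cong (allFin n) (λ i →
      trans (A.Σ-map (λ j → i , j) (filterB (ltᵇ i) (allFin n)) f)
      (A.Σ-filterB (ltᵇ i) (allFin n) (λ j → f (i , j))))))

  isInjective-true⇒ : ∀ {n} (ω : Map n) → isInjective ω ≡ true → ∀ i j → toℕ i < toℕ j → ¬ ω i ≡ ω j
  isInjective-true⇒ {n} ω eq i j i<j ωi≡ωj with all-true⇒ (allFin n) _ (trans (sym (allB-pairsLt n _)) eq) (∈-allFin i)
  ... | row-i with all-true⇒ (allFin n) _ row-i (∈-allFin j)
  ... | entry-ij rewrite <⇒<ᵇ≡true i<j with ω i ≟ ω j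
  ...   | yes _ = false≢true entry-ij
  ...   | no ωi≢ωj = ωi≢ωj ωi≡ωj

  isInjective-sound : ∀ {n} (ω : Map n) → isInjective ω ≡ true → Inj ω
  isInjective-sound ω eq x y ωx≡ωy with ℕP.<-cmp (toℕ x) (toℕ y)
  ... | tri≈ _ x≡y _ = toℕ-injective x≡y
  ... | tri< x<y _ _ = ⊥-elim (isInjective-true⇒ ω eq x y x<y ωx≡ωy)
  ... | tri> _ _ y<x = ⊥-elim (isInjective-true⇒ ω eq y x y<x (sym ωx≡ωy))

  isInjective-complete : ∀ {n} (ω : Map n) → Inj ω → isInjective ω ≡ true
  isInjective-complete {n} ω ω-inj =
    trans (allB-pairsLt n _) (all-true⇐ (allFin n) _ (λ i → all-true⇐ (allFin n) _ (entry i)))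
    where
    entry : ∀ i j → (if ltᵇ i j then not (does (ω i ≟ ω j)) else true) ≡ true
    entry i j with ltᵇ i j in i<j
    ... | false = refl
    ... | true with ω i ≟ ω j
    ...   | no _ = refl
    ...   | yes ωi≡ωj = ⊥-elim (ℕP.<-irrefl (cong toℕ (ω-inj i j ωi≡ωj)) (<ᵇ≡true⇒< i<j))

  injective⇒surjective : ∀ {n} (σ : Map n) → Inj σ → ∀ j → ∃ λ i → σ i ≡ j
  injective⇒surjective {suc m} σ σ-inj j with any? (λ i → σ i ≟ j)
  ... | yes hit = hit
  ... | no miss with pigeonhole (ℕP.n<1+n m) (λ i → punchOut {i = j} {j = σ i} (λ e → miss (i , sym e)))
  ... | i₁ , i₂ , i₁<i₂ , eq =
    ⊥-elim (ℕP.<-irrefl (cong toℕ (σ-inj i₁ i₂ (punchOut-injective (λ e → miss (i₁ , sym e)) (λ e → miss (i₂ , sym e)) eq))) i₁<i₂)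

  lookup-actExps : ∀ {n} (ω : Map n) (e : Exps n) j →
    lookup (actExps ω e) j ≡ N.Σ (allFin n) (λ i → if does (ω i ≟ j) then lookup e i else 0)
  lookup-actExps {n} ω e j = trans (lookup∘tabulate _ j) (sumℕ≡Σ (allFin n) _)

  lookup-actExps-preimage : ∀ {n} (ω : Map n) → Inj ω → (e : Exps n) → ∀ {i₀ j} → ω i₀ ≡ j →
    lookup (actExps ω e) j ≡ lookup e i₀
  lookup-actExps-preimage {n} ω ω-inj e {i₀} {j} ωi₀≡j =
    trans (lookup-actExps ω e j) (trans (N.Σ-allFin-single n _ i₀ off) on)
    where
    off : ∀ i → ¬ i ≡ i₀ → (if does (ω i ≟ j) then lookup e i else 0) ≡ 0
    off i i≢i₀ with ω i ≟ j
    ... | yes ωi≡j = ⊥-elim (i≢i₀ (ω-inj i i₀ (trans ωi≡j (sym ωi₀≡j))))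
    ... | no _ = refl
    on : (if does (ω i₀ ≟ j) then lookup e i₀ else 0) ≡ lookup e i₀
    on with ω i₀ ≟ j
    ... | yes _ = refl
    ... | no ωi₀≢j = ⊥-elim (ωi₀≢j ωi₀≡j)

  involution⇒injective : ∀ {n} (ω : Map n) → (∀ i → ω (ω i) ≡ i) → Inj ω
  involution⇒injective ω ω-inv x y ωx≡ωy = trans (sym (ω-inv x)) (trans (cong ω ωx≡ωy) (ω-inv y))

  lookup-actExps-involution : ∀ {n} (ω : Map n) → (∀ i → ω (ω i) ≡ i) → (e : Exps n) → ∀ j →
    lookup (actExps ω e) j ≡ lookup e (ω j)
  lookup-actExps-involution ω ω-inv e j = lookup-actExps-preimage ω (involution⇒injective ω ω-inv) e (ω-inv j)

  actExps-invariant : ∀ {n} (σ : Map n) → Inj σ → (e : Exps n) → (∀ i → lookup e (σ i) ≡ lookup e i) → actExps σ e ≡ e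
  actExps-invariant σ σ-inj e e∘σ≗e = vec-ext _ _ (λ j →
    let (i₀ , σi₀≡j) = injective⇒surjective σ σ-inj j in
    trans (lookup-actExps-preimage σ σ-inj e σi₀≡j) (trans (sym (e∘σ≗e i₀)) (cong (lookup e) σi₀≡j)))


module Arrangements where

  open import Data.Nat using (ℕ; zero; suc; _+_; _*_; _∸_)
  open import Data.Nat.Base using (_!)
  open import Data.Nat.Properties using (*-comm; *-assoc; *-zeroʳ; *-distribˡ-+; m+n∸n≡m)
  open import Data.Nat.Combinatorics.Base using (_P′_)
  open import Data.Nat.Combinatorics.Specification using (nP′n≡n!)
  open import Data.Bool using (Bool; true; false; if_then_else_; _∧_; not)
  open import Data.Bool.Properties using (∧-zeroʳ) renaming (_≟_ to _≟B_)
  open import Data.Fin as Fin using (Fin; _≟_)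
  open import Data.Fin.Properties using (suc-injective; 0≢1+n)
  open import Data.List using (List; []; _∷_; map; allFin)
  open import Data.Vec as Vec using (Vec; tabulate; lookup)
  open import Data.Product using (_,_; ∃)
  open import Data.Empty using (⊥-elim)
  open import Relation.Binary.PropositionalEquality
  open import Relation.Nullary using (yes; no; does)
  open import Function using (_∘_)
  open import Defs
  open BooleanTests using (false≢true; true≢false)
  open Permutations using (module N)
  open ≡-Reasoning

  b2n : Bool → ℕ
  b2n true = 1
  b2n false = 0

  eqB : Bool → Bool → Bool
  eqB x y = does (x ≟B y)

  b2n-split : ∀ p m → b2n (p ∧ not m) + b2n (p ∧ m) ≡ b2n p
  b2n-split true true = refl
  b2n-split true false = refl
  b2n-split false m = refl

  b2n-∧-true : ∀ p → b2n (p ∧ true) ≡ b2n p + b2n (p ∧ false)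
  b2n-∧-true true = refl
  b2n-∧-true false = refl

  b2n-regroup : ∀ p q r s → b2n ((p ∧ q) ∧ (r ∧ s)) ≡ b2n (q ∧ s) * b2n (r ∧ p)
  b2n-regroup true true true true = refl
  b2n-regroup true true true false = refl
  b2n-regroup true true false true = refl
  b2n-regroup true true false false = refl
  b2n-regroup true false true true = refl
  b2n-regroup true false true false = refl
  b2n-regroup true false false true = refl
  b2n-regroup true false false false = refl
  b2n-regroup false true true true = refl
  b2n-regroup false true true false = refl
  b2n-regroup false true false true = refl
  b2n-regroup false true false false = refl
  b2n-regroup false false true true = refl
  b2n-regroup false false true false = refl
  b2n-regroup false false false true = refl
  b2n-regroup false false false false = refl

  N-Σ-*ˡ : ∀ {B : Set} (c : ℕ) (l : List B) (f : B → ℕ) → N.Σ l (λ x → c * f x) ≡ c * N.Σ l f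
  N-Σ-*ˡ c [] f = sym (*-zeroʳ c)
  N-Σ-*ˡ c (x ∷ l) f = trans (cong (c * f x +_) (N-Σ-*ˡ c l f)) (sym (*-distribˡ-+ c (f x) (N.Σ l f)))

  N-Σ-*ʳ : ∀ {B : Set} (c : ℕ) (l : List B) (f : B → ℕ) → N.Σ l (λ x → f x * c) ≡ N.Σ l f * c
  N-Σ-*ʳ c l f = trans (N.Σ-cong l (λ x → *-comm (f x) c)) (trans (N-Σ-*ˡ c l f) (*-comm c _))

  module _ {n : ℕ} (colour : Fin n → Bool) where

    elemᵇ : ∀ {m} → Fin n → Vec (Fin n) m → Bool
    elemᵇ a Vec.[] = false
    elemᵇ a (x Vec.∷ v) = if does (x ≟ a) then true else elemᵇ a v

    distinctᵇ : ∀ {m} → Vec (Fin n) m → Bool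
    distinctᵇ Vec.[] = true
    distinctᵇ (a Vec.∷ v) = not (elemᵇ a v) ∧ distinctᵇ v

    hasColoursᵇ : ∀ {m} → Vec Bool m → Vec (Fin n) m → Bool
    hasColoursᵇ Vec.[] Vec.[] = true
    hasColoursᵇ (w Vec.∷ ws) (a Vec.∷ v) = eqB (colour a) w ∧ hasColoursᵇ ws v

    countColour : ∀ {m} → Bool → Vec Bool m → ℕ
    countColour w Vec.[] = 0
    countColour w (x Vec.∷ ws) = if eqB x w then suc (countColour w ws) else countColour w ws

    classSize : Bool → ℕ
    classSize w = N.Σ (allFin n) (λ a → b2n (eqB (colour a) w))

    arrangements : ∀ {m} → Vec Bool m → ℕ
    arrangements ws = (classSize true P′ countColour true ws) * (classSize false P′ countColour false ws)

    countColourIn : ∀ {m} → Bool → Vec (Fin n) m → ℕ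
    countColourIn w Vec.[] = 0
    countColourIn w (x Vec.∷ v) = b2n (eqB (colour x) w) + countColourIn w v

    usedOfColour unusedOfColour : ∀ {m} → Bool → Vec (Fin n) m → ℕ
    usedOfColour w v = N.Σ (allFin n) (λ a → b2n (eqB (colour a) w ∧ elemᵇ a v))
    unusedOfColour w v = N.Σ (allFin n) (λ a → b2n (eqB (colour a) w ∧ not (elemᵇ a v)))

    unused+used≡classSize : ∀ {m} w (v : Vec (Fin n) m) → unusedOfColour w v + usedOfColour w v ≡ classSize w
    unused+used≡classSize w v =
      trans (sym (N.Σ-∙ (allFin n) _ _)) (N.Σ-cong (allFin n) (λ a → b2n-split (eqB (colour a) w) (elemᵇ a v)))

    usedOfColour-∷ : ∀ {m} w x (v : Vec (Fin n) m) → elemᵇ x v ≡ false →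
      usedOfColour w (x Vec.∷ v) ≡ b2n (eqB (colour x) w) + usedOfColour w v
    usedOfColour-∷ w x v x∉v = begin
      usedOfColour w (x Vec.∷ v)
        ≡⟨ N.Σ-cong (allFin n) split ⟩
      N.Σ (allFin n) (λ a → (if does (a ≟ x) then b2n (eqB (colour a) w) else 0) + b2n (eqB (colour a) w ∧ elemᵇ a v))
        ≡⟨ N.Σ-∙ (allFin n) _ _ ⟩
      N.Σ (allFin n) (λ a → if does (a ≟ x) then b2n (eqB (colour a) w) else 0) + usedOfColour w v
        ≡⟨ cong (_+ usedOfColour w v) (N.Σ-allFin-indicator n (λ a → b2n (eqB (colour a) w)) x) ⟩
      b2n (eqB (colour x) w) + usedOfColour w v ∎
      where
      split : ∀ a → b2n (eqB (colour a) w ∧ (if does (x ≟ a) then true else elemᵇ a v)) ≡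
                    (if does (a ≟ x) then b2n (eqB (colour a) w) else 0) + b2n (eqB (colour a) w ∧ elemᵇ a v)
      split a with x ≟ a | a ≟ x
      ... | yes refl | yes _ rewrite x∉v = b2n-∧-true (eqB (colour a) w)
      ... | yes refl | no a≢a = ⊥-elim (a≢a refl)
      ... | no x≢a | yes a≡x = ⊥-elim (x≢a (sym a≡x))
      ... | no _ | no _ = refl

    usedOfColour≡countColourIn : ∀ {m} w (v : Vec (Fin n) m) → distinctᵇ v ≡ true → usedOfColour w v ≡ countColourIn w v
    usedOfColour≡countColourIn w Vec.[] _ = N.Σ-zero (allFin n) (λ a → cong b2n (∧-zeroʳ (eqB (colour a) w)))
    usedOfColour≡countColourIn w (x Vec.∷ v) distinct with elemᵇ x v in x∈v | distinctᵇ v in distinct-v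
    ... | true | _ = ⊥-elim (false≢true distinct)
    ... | false | false = ⊥-elim (false≢true distinct)
    ... | false | true = trans (usedOfColour-∷ w x v x∈v) (cong (b2n (eqB (colour x) w) +_) (usedOfColour≡countColourIn w v distinct-v))

    countColourIn≡countColour : ∀ {m} w (ws : Vec Bool m) (v : Vec (Fin n) m) → hasColoursᵇ ws v ≡ true →
      countColourIn w v ≡ countColour w ws
    countColourIn≡countColour w Vec.[] Vec.[] _ = refl
    countColourIn≡countColour w (w′ Vec.∷ ws) (x Vec.∷ v) coloured with colour x ≟B w′ | hasColoursᵇ ws v in coloured-v
    ... | no _ | _ = ⊥-elim (false≢true coloured)
    ... | yes _ | false = ⊥-elim (false≢true coloured)
    ... | yes refl | true with eqB (colour x) w
    ...   | true = cong suc (countColourIn≡countColour w ws v coloured-v)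
    ...   | false = countColourIn≡countColour w ws v coloured-v

    unusedOfColour≡ : ∀ {m} w (ws : Vec Bool m) (v : Vec (Fin n) m) → distinctᵇ v ≡ true → hasColoursᵇ ws v ≡ true →
      unusedOfColour w v ≡ classSize w ∸ countColour w ws
    unusedOfColour≡ w ws v distinct coloured = begin
      unusedOfColour w v                                              ≡⟨ sym (m+n∸n≡m _ (countColour w ws)) ⟩
      unusedOfColour w v + countColour w ws ∸ countColour w ws        ≡⟨ cong (λ k → unusedOfColour w v + k ∸ countColour w ws) used≡ ⟩
      unusedOfColour w v + usedOfColour w v ∸ countColour w ws        ≡⟨ cong (_∸ countColour w ws) (unused+used≡classSize w v) ⟩
      classSize w ∸ countColour w ws                                  ∎
      where
      used≡ : countColour w ws ≡ usedOfColour w v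
      used≡ = sym (trans (usedOfColour≡countColourIn w v distinct) (countColourIn≡countColour w ws v coloured))

    arrangements-∷ : ∀ {m} w (ws : Vec Bool m) → arrangements ws * (classSize w ∸ countColour w ws) ≡ arrangements (w Vec.∷ ws)
    arrangements-∷ true ws =
      trans (*-comm (arrangements ws) _) (sym (*-assoc (classSize true ∸ countColour true ws) _ _))
    arrangements-∷ false ws =
      trans (*-assoc (classSize true P′ countColour true ws) _ _)
            (cong ((classSize true P′ countColour true ws) *_) (*-comm (classSize false P′ countColour false ws) _))

    count-distinct-coloured : ∀ m (ws : Vec Bool m) →
      N.Σ (allVecs m n) (λ v → b2n (distinctᵇ v ∧ hasColoursᵇ ws v)) ≡ arrangements ws
    count-distinct-coloured zero Vec.[] = refl
    count-distinct-coloured (suc m) (w Vec.∷ ws) = begin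
      N.Σ (allVecs (suc m) n) (λ v → b2n (distinctᵇ v ∧ hasColoursᵇ (w Vec.∷ ws) v))
        ≡⟨ N.Σ-concatMap (λ v → map (Vec._∷ v) (allFin n)) (allVecs m n) _ ⟩
      N.Σ (allVecs m n) (λ v → N.Σ (map (Vec._∷ v) (allFin n)) (λ v′ → b2n (distinctᵇ v′ ∧ hasColoursᵇ (w Vec.∷ ws) v′)))
        ≡⟨ N.Σ-cong (allVecs m n) extend ⟩
      N.Σ (allVecs m n) (λ v → b2n (distinctᵇ v ∧ hasColoursᵇ ws v) * (classSize w ∸ countColour w ws))
        ≡⟨ N-Σ-*ʳ (classSize w ∸ countColour w ws) (allVecs m n) _ ⟩
      N.Σ (allVecs m n) (λ v → b2n (distinctᵇ v ∧ hasColoursᵇ ws v)) * (classSize w ∸ countColour w ws)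
        ≡⟨ cong (_* (classSize w ∸ countColour w ws)) (count-distinct-coloured m ws) ⟩
      arrangements ws * (classSize w ∸ countColour w ws)
        ≡⟨ arrangements-∷ w ws ⟩
      arrangements (w Vec.∷ ws) ∎
      where
      good : Vec (Fin n) m → ℕ
      good v = b2n (distinctᵇ v ∧ hasColoursᵇ ws v)
      good-* : ∀ v → good v * unusedOfColour w v ≡ good v * (classSize w ∸ countColour w ws)
      good-* v with distinctᵇ v in distinct | hasColoursᵇ ws v in coloured
      ... | true | true = cong (1 *_) (unusedOfColour≡ w ws v distinct coloured)
      ... | true | false = refl
      ... | false | _ = refl
      extend : ∀ v → N.Σ (map (Vec._∷ v) (allFin n)) (λ v′ → b2n (distinctᵇ v′ ∧ hasColoursᵇ (w Vec.∷ ws) v′)) ≡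
                     good v * (classSize w ∸ countColour w ws)
      extend v = begin
        N.Σ (map (Vec._∷ v) (allFin n)) (λ v′ → b2n (distinctᵇ v′ ∧ hasColoursᵇ (w Vec.∷ ws) v′))
          ≡⟨ N.Σ-map (Vec._∷ v) (allFin n) _ ⟩
        N.Σ (allFin n) (λ a → b2n ((not (elemᵇ a v) ∧ distinctᵇ v) ∧ (eqB (colour a) w ∧ hasColoursᵇ ws v)))
          ≡⟨ N.Σ-cong (allFin n) (λ a → b2n-regroup (not (elemᵇ a v)) (distinctᵇ v) (eqB (colour a) w) (hasColoursᵇ ws v)) ⟩
        N.Σ (allFin n) (λ a → good v * b2n (eqB (colour a) w ∧ not (elemᵇ a v)))
          ≡⟨ N-Σ-*ˡ (good v) (allFin n) _ ⟩
        good v * unusedOfColour w v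
          ≡⟨ good-* v ⟩
        good v * (classSize w ∸ countColour w ws) ∎

    countColour-tabulate : ∀ {m} (f : Fin m → Bool) w → countColour w (tabulate f) ≡ N.Σ (allFin m) (λ i → b2n (eqB (f i) w))
    countColour-tabulate {zero} f w = refl
    countColour-tabulate {suc m} f w =
      trans (head (eqB (f Fin.zero) w)) (sym (N.Σ-allFin-suc m (λ i → b2n (eqB (f i) w))))
      where
      head : ∀ b → (if b then suc (countColour w (tabulate (f ∘ Fin.suc))) else countColour w (tabulate (f ∘ Fin.suc))) ≡
                   b2n b + N.Σ (allFin m) (λ i → b2n (eqB (f (Fin.suc i)) w))
      head true = cong suc (countColour-tabulate (f ∘ Fin.suc) w)
      head false = countColour-tabulate (f ∘ Fin.suc) w

    count-colour-preserving : N.Σ (allVecs n n) (λ v → b2n (distinctᵇ v ∧ hasColoursᵇ (tabulate colour) v)) ≡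
                              classSize true ! * classSize false !
    count-colour-preserving = begin
      N.Σ (allVecs n n) (λ v → b2n (distinctᵇ v ∧ hasColoursᵇ (tabulate colour) v))
        ≡⟨ count-distinct-coloured n (tabulate colour) ⟩
      arrangements (tabulate colour)
        ≡⟨ cong₂ _*_ (trans (cong (classSize true P′_) (countColour-tabulate colour true)) (nP′n≡n! (classSize true)))
                     (trans (cong (classSize false P′_) (countColour-tabulate colour false)) (nP′n≡n! (classSize false))) ⟩
      classSize true ! * classSize false ! ∎

    classSize-true+false : classSize true + classSize false ≡ n
    classSize-true+false =
      trans (sym (N.Σ-∙ (allFin n) _ _)) (trans (N.Σ-cong (allFin n) (λ a → exactly-one (colour a))) (Σ-one n))
      where
      exactly-one : ∀ b → b2n (eqB b true) + b2n (eqB b false) ≡ 1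
      exactly-one true = refl
      exactly-one false = refl
      Σ-one : ∀ m → N.Σ (allFin m) (λ _ → 1) ≡ m
      Σ-one zero = refl
      Σ-one (suc m) = trans (N.Σ-allFin-suc m (λ _ → 1)) (cong suc (Σ-one m))

    elemᵇ-sound : ∀ {m} a (v : Vec (Fin n) m) → elemᵇ a v ≡ true → ∃ λ i → lookup v i ≡ a
    elemᵇ-sound a (x Vec.∷ v) a∈v with x ≟ a
    ... | yes x≡a = Fin.zero , x≡a
    ... | no _ = let (i , vi≡a) = elemᵇ-sound a v a∈v in Fin.suc i , vi≡a

    elemᵇ-complete : ∀ {m} a (v : Vec (Fin n) m) i → lookup v i ≡ a → elemᵇ a v ≡ true
    elemᵇ-complete a (x Vec.∷ v) i vi≡a with x ≟ a | i
    ... | yes _ | _ = refl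
    ... | no x≢a | Fin.zero = ⊥-elim (x≢a vi≡a)
    ... | no _ | Fin.suc i′ = elemᵇ-complete a v i′ vi≡a

    distinctᵇ-sound : ∀ {m} (v : Vec (Fin n) m) → distinctᵇ v ≡ true → ∀ x y → lookup v x ≡ lookup v y → x ≡ y
    distinctᵇ-sound (a Vec.∷ v) distinct x y vx≡vy with elemᵇ a v in a∈v | x | y
    ... | true | _ | _ = ⊥-elim (false≢true distinct)
    ... | false | Fin.zero | Fin.zero = refl
    ... | false | Fin.zero | Fin.suc y′ = ⊥-elim (true≢false (trans (sym (elemᵇ-complete a v y′ (sym vx≡vy))) a∈v))
    ... | false | Fin.suc x′ | Fin.zero = ⊥-elim (true≢false (trans (sym (elemᵇ-complete a v x′ vx≡vy)) a∈v))
    ... | false | Fin.suc x′ | Fin.suc y′ = cong Fin.suc (distinctᵇ-sound v distinct x′ y′ vx≡vy)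

    distinctᵇ-complete : ∀ {m} (v : Vec (Fin n) m) → (∀ x y → lookup v x ≡ lookup v y → x ≡ y) → distinctᵇ v ≡ true
    distinctᵇ-complete Vec.[] inj = refl
    distinctᵇ-complete (a Vec.∷ v) inj with elemᵇ a v in a∈v
    ... | true = let (i , vi≡a) = elemᵇ-sound a v a∈v in ⊥-elim (0≢1+n (sym (inj (Fin.suc i) Fin.zero vi≡a)))
    ... | false = distinctᵇ-complete v (λ x y vx≡vy → suc-injective (inj (Fin.suc x) (Fin.suc y) vx≡vy))

    hasColoursᵇ-sound : ∀ {m} (ws : Vec Bool m) (v : Vec (Fin n) m) → hasColoursᵇ ws v ≡ true →
      ∀ i → colour (lookup v i) ≡ lookup ws i
    hasColoursᵇ-sound (w Vec.∷ ws) (a Vec.∷ v) coloured i with colour a ≟B w | hasColoursᵇ ws v in coloured-v | i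
    ... | no _ | _ | _ = ⊥-elim (false≢true coloured)
    ... | yes a-w | _ | Fin.zero = a-w
    ... | yes _ | true | Fin.suc i′ = hasColoursᵇ-sound ws v coloured-v i′
    ... | yes _ | false | Fin.suc _ = ⊥-elim (false≢true coloured)

    hasColoursᵇ-complete : ∀ {m} (ws : Vec Bool m) (v : Vec (Fin n) m) → (∀ i → colour (lookup v i) ≡ lookup ws i) →
      hasColoursᵇ ws v ≡ true
    hasColoursᵇ-complete Vec.[] Vec.[] h = refl
    hasColoursᵇ-complete (w Vec.∷ ws) (a Vec.∷ v) h with colour a ≟B w
    ... | yes _ = hasColoursᵇ-complete ws v (λ i → h (Fin.suc i))
    ... | no a≢w = ⊥-elim (a≢w (h Fin.zero))


module ColumnSwaps where

  open import Data.Nat as ℕ using (ℕ; suc; _≤_)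
  open import Data.Integer using (-_)
  import Data.Integer.Properties as ℤP
  open import Data.Bool using (Bool; true; false; if_then_else_; not)
  open import Data.Fin using (Fin; _≟_)
  open import Data.List using (List; []; _∷_; map; length)
  open import Data.Vec using (tabulate; lookup)
  open import Data.Vec.Properties using (lookup-zipWith; lookup∘tabulate; lookup-replicate)
  open import Data.Product using (_×_; _,_; proj₁; proj₂)
  import Data.Sum as Sum
  open Sum using (_⊎_; inj₁; inj₂)
  open import Data.Empty using (⊥-elim)
  open import Function using (_∘_)
  open import Relation.Binary.PropositionalEquality
  open import Relation.Nullary using (¬_; yes; no; does; Dec)
  open import Defs
  open Sign using (Inj; swap; swap-matchˡ; swap-matchʳ; swap-other; swap-involutive; swap-injective; sgn-swap; sgn-id)
  open Coefficients using (choiceSign; choiceExps; unitExps)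
  open Permutations using (vec-ext; lookup-actExps-involution)
  open ≡-Reasoning

  occurrences : ∀ {n} → Fin n → List (Fin n) → ℕ
  occurrences x [] = 0
  occurrences x (y ∷ l) = if does (y ≟ x) then suc (occurrences x l) else occurrences x l

  data IsColumn {n} : List (Fin n) → List (Fin n) → Fin n → Fin n → Set where
    here : ∀ {t b ts bs} → IsColumn (t ∷ ts) (b ∷ bs) t b
    there : ∀ {t b ts bs t′ b′} → IsColumn ts bs t′ b′ → IsColumn (t ∷ ts) (b ∷ bs) t′ b′

  NotIn : ∀ {n} → Fin n → List (Fin n) → List (Fin n) → Set
  NotIn k ts bs = ∀ {t b} → IsColumn ts bs t b → (¬ k ≡ t) × (¬ k ≡ b)

  SameColumn : ∀ {n} → List (Fin n) → List (Fin n) → Fin n → Fin n → Set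
  SameColumn ts bs x y = (x ≡ y) ⊎ (IsColumn ts bs x y ⊎ IsColumn ts bs y x)

  data DisjointColumns {n} : List (Fin n) → List (Fin n) → Set where
    g[] : ∀ {bs} → DisjointColumns [] bs
    g∷[] : ∀ {t ts} → DisjointColumns (t ∷ ts) []
    g∷ : ∀ {t b ts bs} → ¬ t ≡ b → NotIn t ts bs → NotIn b ts bs → DisjointColumns ts bs → DisjointColumns (t ∷ ts) (b ∷ bs)

  data FitsColumns {n} : List (Fin n) → List (Fin n) → List Bool → Set where
    f[] : ∀ {bs} → FitsColumns [] bs []
    f∷[] : ∀ {t ts} → FitsColumns (t ∷ ts) [] []
    f∷ : ∀ {t b ts bs x c} → FitsColumns ts bs c → FitsColumns (t ∷ ts) (b ∷ bs) (x ∷ c)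

  columnSwap : ∀ {n} → List (Fin n) → List (Fin n) → List Bool → Map n
  columnSwap (t ∷ ts) (b ∷ bs) (x ∷ c) k = columnSwap ts bs c (if x then swap t b k else k)
  columnSwap [] _ _ k = k
  columnSwap (t ∷ ts) [] _ k = k
  columnSwap (t ∷ ts) (b ∷ bs) [] k = k

  columnSwap-off : ∀ {n} {ts bs : List (Fin n)} c k → NotIn k ts bs → columnSwap ts bs c k ≡ k
  columnSwap-off {ts = t ∷ ts} {b ∷ bs} (true ∷ c) k nk =
    trans (cong (columnSwap ts bs c) (swap-other t b k (proj₁ (nk here)) (proj₂ (nk here)))) (columnSwap-off c k (λ ip → nk (there ip)))
  columnSwap-off {ts = t ∷ ts} {b ∷ bs} (false ∷ c) k nk = columnSwap-off c k (λ ip → nk (there ip))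
  columnSwap-off {ts = []} c k nk = refl
  columnSwap-off {ts = t ∷ ts} {[]} c k nk = refl
  columnSwap-off {ts = t ∷ ts} {b ∷ bs} [] k nk = refl

  columnSwap-injective : ∀ {n} {ts bs : List (Fin n)} → DisjointColumns ts bs → ∀ c → Inj (columnSwap ts bs c)
  columnSwap-injective (g∷ {t} {b} tb nt nb g) (true ∷ c) x y e = swap-injective t b tb x y (columnSwap-injective g c _ _ e)
  columnSwap-injective (g∷ tb nt nb g) (false ∷ c) x y e = columnSwap-injective g c x y e
  columnSwap-injective (g∷ tb nt nb g) [] x y e = e
  columnSwap-injective g[] c x y e = e
  columnSwap-injective g∷[] c x y e = e

  columnSwap-involutive : ∀ {n} {ts bs : List (Fin n)} → DisjointColumns ts bs → ∀ c k → columnSwap ts bs c (columnSwap ts bs c k) ≡ k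
  columnSwap-involutive (g∷ tb nt nb g) (false ∷ c) k = columnSwap-involutive g c k
  columnSwap-involutive {n} (g∷ {t} {b} {ts} {bs} tb nt nb g) (true ∷ c) k = go (k ≟ t) (k ≟ b)
    where
    R : Map n
    R = columnSwap ts bs c
    go : Dec (k ≡ t) → Dec (k ≡ b) → R (swap t b (R (swap t b k))) ≡ k
    go (yes refl) _ = trans (cong (λ z → R (swap k b z)) (trans (cong R (swap-matchˡ k b)) (columnSwap-off c b nb)))
                       (trans (cong R (swap-matchʳ k b tb)) (columnSwap-off c k nt))
    go (no _) (yes refl) = trans (cong (λ z → R (swap t k z)) (trans (cong R (swap-matchʳ t k tb)) (columnSwap-off c t nt)))
                       (trans (cong R (swap-matchˡ t k)) (columnSwap-off c k nb))
    go (no kt) (no kb) =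
      trans (cong (λ z → R (swap t b (R z))) (swap-other t b k kt kb))
      (trans (cong R (swap-other t b (R k) mt mb)) (columnSwap-involutive g c k))
      where
      mt : ¬ R k ≡ t
      mt e = kt (columnSwap-injective g c k t (trans e (sym (columnSwap-off c t nt))))
      mb : ¬ R k ≡ b
      mb e = kb (columnSwap-injective g c k b (trans e (sym (columnSwap-off c b nb))))
  columnSwap-involutive (g∷ tb nt nb g) [] k = refl
  columnSwap-involutive g[] c k = refl
  columnSwap-involutive g∷[] c k = refl

  columnSwap-top : ∀ {n} {t b : Fin n} {ts bs} → DisjointColumns (t ∷ ts) (b ∷ bs) → ∀ x c → columnSwap (t ∷ ts) (b ∷ bs) (x ∷ c) t ≡ (if x then b else t)
  columnSwap-top {t = t} {b} {ts} {bs} (g∷ tb nt nb g) true c = trans (cong (columnSwap ts bs c) (swap-matchˡ t b)) (columnSwap-off c b nb)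
  columnSwap-top (g∷ tb nt nb g) false c = columnSwap-off c _ nt

  columnSwap-bottom : ∀ {n} {t b : Fin n} {ts bs} → DisjointColumns (t ∷ ts) (b ∷ bs) → ∀ x c → columnSwap (t ∷ ts) (b ∷ bs) (x ∷ c) b ≡ (if x then t else b)
  columnSwap-bottom {t = t} {b} {ts} {bs} (g∷ tb nt nb g) true c = trans (cong (columnSwap ts bs c) (swap-matchʳ t b tb)) (columnSwap-off c t nt)
  columnSwap-bottom (g∷ tb nt nb g) false c = columnSwap-off c _ nb

  columnSwap-rest : ∀ {n} {t b : Fin n} {ts bs} → DisjointColumns (t ∷ ts) (b ∷ bs) → ∀ x c k → (¬ k ≡ t) → (¬ k ≡ b) →
    columnSwap (t ∷ ts) (b ∷ bs) (x ∷ c) k ≡ columnSwap ts bs c k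
  columnSwap-rest {t = t} {b} {ts} {bs} g true c k kt kb = cong (columnSwap ts bs c) (swap-other t b k kt kb)
  columnSwap-rest g false c k kt kb = refl

  later-columns-apart : ∀ {n} {t b : Fin n} {ts bs t′ b′} → NotIn t ts bs → NotIn b ts bs → IsColumn ts bs t′ b′ →
    (¬ t′ ≡ t) × (¬ t′ ≡ b) × (¬ b′ ≡ t) × (¬ b′ ≡ b)
  later-columns-apart t∉ b∉ p = proj₁ (t∉ p) ∘ sym , proj₁ (b∉ p) ∘ sym , proj₂ (t∉ p) ∘ sym , proj₂ (b∉ p) ∘ sym

  columnSwap-later-top : ∀ {n} {t b : Fin n} {ts bs} → DisjointColumns (t ∷ ts) (b ∷ bs) → ∀ x c {t′ b′} → IsColumn ts bs t′ b′ →
    columnSwap (t ∷ ts) (b ∷ bs) (x ∷ c) t′ ≡ columnSwap ts bs c t′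
  columnSwap-later-top gg@(g∷ _ t∉ b∉ _) x c p =
    let (t′≢t , t′≢b , _ , _) = later-columns-apart t∉ b∉ p in columnSwap-rest gg x c _ t′≢t t′≢b

  columnSwap-SameColumn : ∀ {n} {ts bs : List (Fin n)} → DisjointColumns ts bs → ∀ c k → SameColumn ts bs (columnSwap ts bs c k) k
  columnSwap-SameColumn g[] c k = inj₁ refl
  columnSwap-SameColumn g∷[] c k = inj₁ refl
  columnSwap-SameColumn (g∷ _ _ _ _) [] k = inj₁ refl
  columnSwap-SameColumn {ts = t ∷ ts} {b ∷ bs} gg@(g∷ _ _ _ g) (x ∷ c) k = go x (k ≟ t) (k ≟ b)
    where
    there-SameColumn : ∀ {y} → SameColumn ts bs y k → SameColumn (t ∷ ts) (b ∷ bs) y k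
    there-SameColumn (inj₁ y≡k) = inj₁ y≡k
    there-SameColumn (inj₂ (inj₁ p)) = inj₂ (inj₁ (there p))
    there-SameColumn (inj₂ (inj₂ p)) = inj₂ (inj₂ (there p))
    go : ∀ x → Dec (k ≡ t) → Dec (k ≡ b) → SameColumn (t ∷ ts) (b ∷ bs) (columnSwap (t ∷ ts) (b ∷ bs) (x ∷ c) k) k
    go true (yes refl) _ = inj₂ (inj₂ (subst (IsColumn (k ∷ ts) (b ∷ bs) k) (sym (columnSwap-top gg true c)) here))
    go false (yes refl) _ = inj₁ (columnSwap-top gg false c)
    go true (no _) (yes refl) = inj₂ (inj₁ (subst (λ z → IsColumn (t ∷ ts) (k ∷ bs) z k) (sym (columnSwap-bottom gg true c)) here))
    go false (no _) (yes refl) = inj₁ (columnSwap-bottom gg false c)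
    go x (no k≢t) (no k≢b) = subst (λ z → SameColumn (t ∷ ts) (b ∷ bs) z k)
                                   (sym (columnSwap-rest gg x c k k≢t k≢b)) (there-SameColumn (columnSwap-SameColumn g c k))

  sgn-columnSwap : ∀ {n} {ts bs : List (Fin n)} {c} → DisjointColumns ts bs → FitsColumns ts bs c → sgn (columnSwap ts bs c) ≡ choiceSign c
  sgn-columnSwap {n} g[] f[] = sgn-id n
  sgn-columnSwap {n} g∷[] f∷[] = sgn-id n
  sgn-columnSwap (g∷ {t} {b} {ts} {bs} tb nt nb g) (f∷ {x = true} {c} fc) =
    trans (sgn-swap (columnSwap ts bs c) t b tb (columnSwap-injective g c)) (trans (cong -_ (sgn-columnSwap g fc)) (sym (ℤP.-1*i≡-i (choiceSign c))))
  sgn-columnSwap (g∷ tb nt nb g) (f∷ {x = false} {c} fc) = trans (sgn-columnSwap g fc) (sym (ℤP.*-identityˡ (choiceSign c)))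

  chosenEntries : ∀ {n} → List (Fin n) → List (Fin n) → List Bool → List (Fin n)
  chosenEntries (t ∷ ts) (b ∷ bs) (x ∷ c) = (if x then b else t) ∷ chosenEntries ts bs c
  chosenEntries [] _ _ = []
  chosenEntries (t ∷ ts) [] _ = []
  chosenEntries (t ∷ ts) (b ∷ bs) [] = []

  map-cong-tops : ∀ {n} {ts bs : List (Fin n)} (f g : Map n) → length ts ≤ length bs →
    (∀ {t′ b′} → IsColumn ts bs t′ b′ → f t′ ≡ g t′) → map f ts ≡ map g ts
  map-cong-tops {ts = []} f g le h = refl
  map-cong-tops {ts = t ∷ ts} {b ∷ bs} f g (ℕ.s≤s le) h = cong₂ _∷_ (h here) (map-cong-tops f g le (λ ip → h (there ip)))

  map-columnSwap-tops : ∀ {n} {ts bs : List (Fin n)} {c} → DisjointColumns ts bs → FitsColumns ts bs c → length ts ≤ length bs →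
    map (columnSwap ts bs c) ts ≡ chosenEntries ts bs c
  map-columnSwap-tops g[] f[] le = refl
  map-columnSwap-tops gg@(g∷ {t} {b} {ts} {bs} tb nt nb g) (f∷ {x = x} {c} fc) (ℕ.s≤s le) =
    cong₂ _∷_ (columnSwap-top gg x c)
      (trans (map-cong-tops _ _ le (columnSwap-later-top gg x c)) (map-columnSwap-tops g fc le))

  lookup-choiceExps : ∀ {n} (ts bs : List (Fin n)) c j → lookup (choiceExps ts bs c) j ≡ occurrences j (chosenEntries ts bs c)
  lookup-choiceExps (t ∷ ts) (b ∷ bs) (x ∷ c) j =
    trans (lookup-zipWith ℕ._+_ j (unitExps (if x then b else t)) (choiceExps ts bs c))
    (trans (cong₂ ℕ._+_ (lookup∘tabulate _ j) (lookup-choiceExps ts bs c j)) (if-+ (does ((if x then b else t) ≟ j))))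
    where
    if-+ : ∀ d → (if d then 1 else 0) ℕ.+ occurrences j (chosenEntries ts bs c) ≡
                 (if d then suc (occurrences j (chosenEntries ts bs c)) else occurrences j (chosenEntries ts bs c))
    if-+ true = refl
    if-+ false = refl
  lookup-choiceExps [] bs c j = lookup-replicate j 0
  lookup-choiceExps (t ∷ ts) [] c j = lookup-replicate j 0
  lookup-choiceExps (t ∷ ts) (b ∷ bs) [] j = lookup-replicate j 0

  occurrences-involution : ∀ {n} (f : Map n) → (∀ i → f (f i) ≡ i) → ∀ j (l : List (Fin n)) → occurrences (f j) l ≡ occurrences j (map f l)
  occurrences-involution f inv j [] = refl
  occurrences-involution f inv j (y ∷ l) with y ≟ f j | f y ≟ j
  ... | yes _ | yes _ = cong suc (occurrences-involution f inv j l)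
  ... | no _ | no _ = occurrences-involution f inv j l
  ... | yes e | no ne = ⊥-elim (ne (trans (cong f e) (inv j)))
  ... | no ne | yes e = ⊥-elim (ne (trans (sym (inv y)) (cong f e)))

  actExps-columnSwap : ∀ {n} {ts bs : List (Fin n)} {c} → DisjointColumns ts bs → FitsColumns ts bs c → length ts ≤ length bs →
    actExps (columnSwap ts bs c) (tabulate (λ k → occurrences k ts)) ≡ choiceExps ts bs c
  actExps-columnSwap {ts = ts} {bs} {c} g fc le = vec-ext _ _ (λ j → begin
    lookup (actExps (columnSwap ts bs c) (tabulate (λ k → occurrences k ts))) j
      ≡⟨ lookup-actExps-involution (columnSwap ts bs c) (columnSwap-involutive g c) (tabulate (λ k → occurrences k ts)) j ⟩
    lookup (tabulate (λ k → occurrences k ts)) (columnSwap ts bs c j)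
      ≡⟨ lookup∘tabulate (λ k → occurrences k ts) (columnSwap ts bs c j) ⟩
    occurrences (columnSwap ts bs c j) ts
      ≡⟨ occurrences-involution _ (columnSwap-involutive g c) j ts ⟩
    occurrences j (map (columnSwap ts bs c) ts)
      ≡⟨ cong (occurrences j) (map-columnSwap-tops g fc le) ⟩
    occurrences j (chosenEntries ts bs c)
      ≡⟨ sym (lookup-choiceExps ts bs c j) ⟩
    lookup (choiceExps ts bs c) j ∎)

  swappedColumns : ∀ {n} → List (Fin n) → List (Fin n) → Map n → List Bool
  swappedColumns (t ∷ ts) (b ∷ bs) ω = not (does (ω t ≟ t)) ∷ swappedColumns ts bs ω
  swappedColumns [] _ ω = []
  swappedColumns (t ∷ ts) [] ω = []

  swappedColumns-Fits : ∀ {n} (ts bs : List (Fin n)) ω → FitsColumns ts bs (swappedColumns ts bs ω)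
  swappedColumns-Fits (t ∷ ts) (b ∷ bs) ω = f∷ (swappedColumns-Fits ts bs ω)
  swappedColumns-Fits [] bs ω = f[]
  swappedColumns-Fits (t ∷ ts) [] ω = f∷[]

  swappedColumns-cong : ∀ {n} {ts bs : List (Fin n)} (f g : Map n) → (∀ {t′ b′} → IsColumn ts bs t′ b′ → f t′ ≡ g t′) →
    swappedColumns ts bs f ≡ swappedColumns ts bs g
  swappedColumns-cong {ts = t ∷ ts} {b ∷ bs} f g h = cong₂ (λ z w → not (does (z ≟ t)) ∷ w) (h here) (swappedColumns-cong f g (λ ip → h (there ip)))
  swappedColumns-cong {ts = []} f g h = refl
  swappedColumns-cong {ts = t ∷ ts} {[]} f g h = refl

  swappedColumns-columnSwap : ∀ {n} {ts bs : List (Fin n)} {c} → DisjointColumns ts bs → FitsColumns ts bs c → swappedColumns ts bs (columnSwap ts bs c) ≡ c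
  swappedColumns-columnSwap g[] f[] = refl
  swappedColumns-columnSwap g∷[] f∷[] = refl
  swappedColumns-columnSwap gg@(g∷ {t} {b} {ts} {bs} tb nt nb g) (f∷ {x = x} {c} fc) =
    cong₂ _∷_ (trans (cong (λ z → not (does (z ≟ t))) (columnSwap-top gg x c)) (hd x))
      (trans (swappedColumns-cong _ _ (columnSwap-later-top gg x c)) (swappedColumns-columnSwap g fc))
    where
    hd : ∀ x → not (does ((if x then b else t) ≟ t)) ≡ x
    hd true with b ≟ t
    ... | yes e = ⊥-elim (tb (sym e))
    ... | no _ = refl
    hd false with t ≟ t
    ... | yes _ = refl
    ... | no ne = ⊥-elim (ne refl)

  record PreservesColumns {n} (ts bs : List (Fin n)) (ω : Map n) : Set where
    field
      maps-into-pair : ∀ {t b} → IsColumn ts bs t b → ((ω t ≡ t) ⊎ (ω t ≡ b)) × ((ω b ≡ t) ⊎ (ω b ≡ b))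
      fixes-others : ∀ k → NotIn k ts bs → ω k ≡ k

  open PreservesColumns

  module _ {n} {t b : Fin n} {ts bs : List (Fin n)} (t≢b : ¬ t ≡ b) (t∉ : NotIn t ts bs) (b∉ : NotIn b ts bs)
           (ω : Map n) (ω-inj : Inj ω) (pres : PreservesColumns (t ∷ ts) (b ∷ bs) ω) where

    not-in-first-column : ∀ {k} → ¬ k ≡ t → ¬ k ≡ b → NotIn k ts bs → NotIn k (t ∷ ts) (b ∷ bs)
    not-in-first-column k≢t k≢b k∉ here = k≢t , k≢b
    not-in-first-column k≢t k≢b k∉ (there p) = k∉ p

    PreservesColumns-fixed : ω t ≡ t → PreservesColumns ts bs ω
    PreservesColumns-fixed ωt≡t = record { maps-into-pair = maps-into-pair pres ∘ there ; fixes-others = fixes }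
      where
      ωb≡b : ω b ≡ b
      ωb≡b with proj₂ (maps-into-pair pres here)
      ... | inj₂ ωb≡b = ωb≡b
      ... | inj₁ ωb≡t = ⊥-elim (t≢b (sym (ω-inj b t (trans ωb≡t (sym ωt≡t)))))
      fixes : ∀ k → NotIn k ts bs → ω k ≡ k
      fixes k k∉ with k ≟ t | k ≟ b
      ... | yes refl | _ = ωt≡t
      ... | no _ | yes refl = ωb≡b
      ... | no k≢t | no k≢b = fixes-others pres k (not-in-first-column k≢t k≢b k∉)

    PreservesColumns-swapped : ¬ ω t ≡ t → PreservesColumns ts bs (ω ∘ swap t b)
    PreservesColumns-swapped ωt≢t = record { maps-into-pair = maps-into-pair′ ; fixes-others = fixes }
      where
      ωt≡b : ω t ≡ b
      ωt≡b with proj₁ (maps-into-pair pres here)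
      ... | inj₁ ωt≡t = ⊥-elim (ωt≢t ωt≡t)
      ... | inj₂ ωt≡b = ωt≡b
      ωb≡t : ω b ≡ t
      ωb≡t with proj₂ (maps-into-pair pres here)
      ... | inj₁ ωb≡t = ωb≡t
      ... | inj₂ ωb≡b = ⊥-elim (t≢b (ω-inj t b (trans ωt≡b (sym ωb≡b))))
      unmoved : ∀ {t′ b′} → IsColumn ts bs t′ b′ → (ω (swap t b t′) ≡ ω t′) × (ω (swap t b b′) ≡ ω b′)
      unmoved p = let (t′≢t , t′≢b , b′≢t , b′≢b) = later-columns-apart t∉ b∉ p in
        cong ω (swap-other t b _ t′≢t t′≢b) , cong ω (swap-other t b _ b′≢t b′≢b)
      maps-into-pair′ : ∀ {t′ b′} → IsColumn ts bs t′ b′ →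
        ((ω (swap t b t′) ≡ t′) ⊎ (ω (swap t b t′) ≡ b′)) × ((ω (swap t b b′) ≡ t′) ⊎ (ω (swap t b b′) ≡ b′))
      maps-into-pair′ p = Sum.map (trans (proj₁ (unmoved p))) (trans (proj₁ (unmoved p))) (proj₁ (maps-into-pair pres (there p)))
                        , Sum.map (trans (proj₂ (unmoved p))) (trans (proj₂ (unmoved p))) (proj₂ (maps-into-pair pres (there p)))
      fixes : ∀ k → NotIn k ts bs → ω (swap t b k) ≡ k
      fixes k k∉ with k ≟ t | k ≟ b
      ... | yes refl | _ = ωb≡t
      ... | no _ | yes refl = ωt≡b
      ... | no k≢t | no k≢b = fixes-others pres k (not-in-first-column k≢t k≢b k∉)

  columnSwap-complete : ∀ {n} {ts bs : List (Fin n)} → DisjointColumns ts bs → ∀ ω → Inj ω → PreservesColumns ts bs ω →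
    ∀ k → ω k ≡ columnSwap ts bs (swappedColumns ts bs ω) k
  columnSwap-complete g[] ω _ pres k = fixes-others pres k (λ ())
  columnSwap-complete g∷[] ω _ pres k = fixes-others pres k (λ ())
  columnSwap-complete (g∷ {t} {b} {ts} {bs} t≢b t∉ b∉ g) ω ω-inj pres k with ω t ≟ t
  ... | yes ωt≡t = columnSwap-complete g ω ω-inj (PreservesColumns-fixed t≢b t∉ b∉ ω ω-inj pres ωt≡t) k
  ... | no ωt≢t = begin
    ω k
      ≡⟨ cong ω (sym (swap-involutive t b t≢b k)) ⟩
    ω (swap t b (swap t b k))
      ≡⟨ columnSwap-complete g (ω ∘ swap t b) (λ x y eq → swap-injective t b t≢b x y (ω-inj _ _ eq))
                            (PreservesColumns-swapped t≢b t∉ b∉ ω ω-inj pres ωt≢t) (swap t b k) ⟩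
    columnSwap ts bs (swappedColumns ts bs (ω ∘ swap t b)) (swap t b k)
      ≡⟨ cong (λ c → columnSwap ts bs c (swap t b k)) (swappedColumns-cong (ω ∘ swap t b) ω unmoved) ⟩
    columnSwap ts bs (swappedColumns ts bs ω) (swap t b k) ∎
    where
    unmoved : ∀ {t′ b′} → IsColumn ts bs t′ b′ → ω (swap t b t′) ≡ ω t′
    unmoved p = let (t′≢t , t′≢b , _ , _) = later-columns-apart t∉ b∉ p in cong ω (swap-other t b _ t′≢t t′≢b)


module TwoRowFilling where

  open import Data.Nat using (ℕ; zero; suc; _+_; _≤_; _<_; z≤n; s≤s; _≡ᵇ_)
  open import Data.Nat.Properties as ℕP using (≤-trans; m≤m+n; m≤n+m)
  open import Data.Bool using (Bool; true; false)
  open import Data.Fin using (Fin; _≟_)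
  open import Data.List as List using (List; []; _∷_; _++_; map; length)
  open import Data.List.Membership.Propositional using (_∈_)
  open import Data.List.Membership.Propositional.Properties using (∈-++⁺ˡ)
  open import Data.List.Relation.Unary.Any using (here; there)
  open import Data.List.Relation.Unary.All using (All; []; _∷_)
  open import Data.List.Relation.Unary.AllPairs using ([]; _∷_)
  open import Data.List.Relation.Unary.Unique.Propositional using (Unique)
  open import Data.Maybe using (Maybe; just; nothing)
  open import Data.Product using (_×_; _,_; proj₁; proj₂; ∃)
  open import Data.Sum using (_⊎_; inj₁; inj₂)
  open import Data.Empty using (⊥; ⊥-elim)
  open import Relation.Binary.PropositionalEquality
  open import Relation.Nullary using (¬_; yes; no; does)
  open import Defs
  open ColumnSwaps

  module _ {n : ℕ} where

    AtMostOnce : List (Fin n) → Set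
    AtMostOnce l = ∀ x → occurrences x l ≤ 1

    occurrences-∷ : ∀ (x y : Fin n) l → occurrences x (y ∷ l) ≡ occurrences x (y ∷ []) + occurrences x l
    occurrences-∷ x y l with does (y ≟ x)
    ... | true = refl
    ... | false = refl

    occurrences-++ : ∀ (x : Fin n) l m → occurrences x (l ++ m) ≡ occurrences x l + occurrences x m
    occurrences-++ x [] m = refl
    occurrences-++ x (y ∷ l) m = trans (occurrences-∷ x y (l ++ m)) (trans (cong (occurrences x (y ∷ []) +_) (occurrences-++ x l m))
                          (trans (sym (ℕP.+-assoc (occurrences x (y ∷ [])) _ _)) (cong (_+ occurrences x m) (sym (occurrences-∷ x y l)))))

    occurrences-self : ∀ (x : Fin n) → occurrences x (x ∷ []) ≡ 1
    occurrences-self x with x ≟ x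
    ... | yes _ = refl
    ... | no ne = ⊥-elim (ne refl)

    occurrences-∈ : ∀ {x : Fin n} {l} → x ∈ l → 1 ≤ occurrences x l
    occurrences-∈ {x} {y ∷ l} (here refl) =
      ≤-trans (ℕP.≤-reflexive (sym (occurrences-self x))) (subst (occurrences x (x ∷ []) ≤_) (sym (occurrences-∷ x x l)) (m≤m+n _ _))
    occurrences-∈ {x} {y ∷ l} (there m) = ≤-trans (occurrences-∈ m) (subst (occurrences x l ≤_) (sym (occurrences-∷ x y l)) (m≤n+m _ _))

    occurrences-∉ : ∀ (x : Fin n) l → All (λ z → ¬ x ≡ z) l → occurrences x l ≡ 0
    occurrences-∉ x [] _ = refl
    occurrences-∉ x (y ∷ l) (ne ∷ a) with y ≟ x
    ... | yes e = ⊥-elim (ne (sym e))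
    ... | no _ = occurrences-∉ x l a

    Unique⇒AtMostOnce : ∀ {l : List (Fin n)} → Unique l → AtMostOnce l
    Unique⇒AtMostOnce {[]} [] x = z≤n
    Unique⇒AtMostOnce {y ∷ l} (a ∷ u) x with y ≟ x
    ... | yes refl = s≤s (ℕP.≤-reflexive (occurrences-∉ y l a))
    ... | no _ = Unique⇒AtMostOnce u x

    positive-sum-≰1 : ∀ {a b : ℕ} → 1 ≤ a → 1 ≤ b → a + b ≤ 1 → ⊥
    positive-sum-≰1 {suc a} {suc b} _ _ (s≤s le) = ℕP.<-irrefl refl (≤-trans (s≤s z≤n) (subst (_≤ 0) (ℕP.+-suc a b) le))

    IsColumn⇒∈ : ∀ {ts bs : List (Fin n)} {t b} → IsColumn ts bs t b → (t ∈ ts) × (b ∈ bs)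
    IsColumn⇒∈ here = here refl , here refl
    IsColumn⇒∈ (there ip) = there (proj₁ (IsColumn⇒∈ ip)) , there (proj₂ (IsColumn⇒∈ ip))

    AtMostOnce-++ˡ : ∀ {l m} → AtMostOnce (l ++ m) → AtMostOnce l
    AtMostOnce-++ˡ {l} {m} d x = ≤-trans (subst (occurrences x l ≤_) (sym (occurrences-++ x l m)) (m≤m+n _ _)) (d x)

    AtMostOnce-++ʳ : ∀ {l m} → AtMostOnce (l ++ m) → AtMostOnce m
    AtMostOnce-++ʳ {l} {m} d x = ≤-trans (subst (occurrences x m ≤_) (sym (occurrences-++ x l m)) (m≤n+m _ _)) (d x)

    AtMostOnce-disjoint : ∀ {l m x} → AtMostOnce (l ++ m) → x ∈ l → x ∈ m → ⊥
    AtMostOnce-disjoint {l} {m} {x} d x∈l x∈m =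
      positive-sum-≰1 (occurrences-∈ x∈l) (occurrences-∈ x∈m) (subst (_≤ 1) (occurrences-++ x l m) (d x))

    AtMostOnce-head : ∀ {y l} → AtMostOnce (y ∷ l) → y ∈ l → ⊥
    AtMostOnce-head {y} {l} d = AtMostOnce-disjoint {y ∷ []} {l} d (here refl)

    AtMostOnce-drop : ∀ l y m → AtMostOnce (l ++ y ∷ m) → AtMostOnce (l ++ m)
    AtMostOnce-drop l y m d x = ≤-trans (subst₂ _≤_ (sym (occurrences-++ x l m)) (sym (occurrences-++ x l (y ∷ m))) fewer) (d x)
      where
      fewer : occurrences x l + occurrences x m ≤ occurrences x l + occurrences x (y ∷ m)
      fewer = ℕP.+-monoʳ-≤ (occurrences x l) (subst (occurrences x m ≤_) (sym (occurrences-∷ x y m)) (m≤n+m _ _))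

    AtMostOnce⇒Good : ∀ (P B : List (Fin n)) → AtMostOnce (B ++ P) → DisjointColumns P B
    AtMostOnce⇒Good [] B d = g[]
    AtMostOnce⇒Good (t ∷ ts) [] d = g∷[]
    AtMostOnce⇒Good (t ∷ ts) (b ∷ bs) d = g∷ t≢b t∉ b∉ (AtMostOnce⇒Good ts bs (AtMostOnce-drop bs t ts (AtMostOnce-++ʳ {b ∷ []} {bs ++ t ∷ ts} d)))
      where
      disjoint : ∀ {x} → x ∈ b ∷ bs → x ∈ t ∷ ts → ⊥
      disjoint = AtMostOnce-disjoint {b ∷ bs} {t ∷ ts} d
      t≢b : ¬ t ≡ b
      t≢b refl = disjoint (here refl) (here refl)
      t∉ : NotIn t ts bs
      t∉ p = (λ { refl → AtMostOnce-head (AtMostOnce-++ʳ {b ∷ bs} {t ∷ ts} d) (proj₁ (IsColumn⇒∈ p)) })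
           , (λ { refl → disjoint (there (proj₂ (IsColumn⇒∈ p))) (here refl) })
      b∉ : NotIn b ts bs
      b∉ p = (λ { refl → disjoint (here refl) (there (proj₁ (IsColumn⇒∈ p))) })
           , (λ { refl → AtMostOnce-head d (∈-++⁺ˡ (proj₂ (IsColumn⇒∈ p))) })

    data At : List (Fin n) → ℕ → Fin n → Set where
      at0 : ∀ {x l} → At (x ∷ l) 0 x
      atS : ∀ {x y l i} → At l i x → At (y ∷ l) (suc i) x

    At-functional : ∀ {l i x y} → At l i x → At l i y → x ≡ y
    At-functional at0 at0 = refl
    At-functional (atS a) (atS b) = At-functional a b

    At⇒∈ : ∀ {l i x} → At l i x → x ∈ l
    At⇒∈ at0 = here refl
    At⇒∈ (atS a) = there (At⇒∈ a)

    ∈⇒At : ∀ {l x} → x ∈ l → ∃ λ i → At l i x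
    ∈⇒At (here refl) = 0 , at0
    ∈⇒At (there m) = let (i , a) = ∈⇒At m in suc i , atS a

    At⇒<length : ∀ {l i x} → At l i x → i < length l
    At⇒<length at0 = s≤s z≤n
    At⇒<length (atS a) = s≤s (At⇒<length a)

    <length⇒At : ∀ (l : List (Fin n)) i → i < length l → ∃ λ x → At l i x
    <length⇒At (y ∷ l) zero _ = y , at0
    <length⇒At (y ∷ l) (suc i) (s≤s lt) = let (x , a) = <length⇒At l i lt in x , atS a

    IsColumn⇒At : ∀ {ts bs t b} → IsColumn ts bs t b → ∃ λ i → At ts i t × At bs i b
    IsColumn⇒At here = 0 , at0 , at0
    IsColumn⇒At (there ip) = let (i , a , b) = IsColumn⇒At ip in suc i , atS a , atS b

    At⇒IsColumn : ∀ {ts bs t b i} → At ts i t → At bs i b → IsColumn ts bs t b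
    At⇒IsColumn {bs = _ ∷ _} at0 at0 = here
    At⇒IsColumn (atS a) (atS b) = there (At⇒IsColumn a b)

    import Data.Maybe as M

    findIn-at : ∀ {l i k} → AtMostOnce l → At l i k → findIn l k ≡ just i
    findIn-at {y ∷ l} {zero} {k} d at0 with k ≟ k
    ... | yes _ = refl
    ... | no ne = ⊥-elim (ne refl)
    findIn-at {y ∷ l} {suc i} {k} d (atS a) with y ≟ k
    ... | yes refl = ⊥-elim (AtMostOnce-head d (At⇒∈ a))
    ... | no _ = cong (M.map suc) (findIn-at (AtMostOnce-++ʳ {y ∷ []} {l} d) a)

    findIn-none : ∀ {l : List (Fin n)} {k} → occurrences k l ≡ 0 → findIn l k ≡ nothing
    findIn-none {[]} c = refl
    findIn-none {y ∷ l} {k} c with y ≟ k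
    ... | yes refl = ⊥-elim (ℕP.1+n≢0 c)
    ... | no _ = cong (M.map suc) (findIn-none {l} {k} c)

    open import Data.List.Membership.Propositional.Properties using (∈-++⁻)
    open BooleanTests using (≡ᵇ≡true⇒≡; ≡⇒≡ᵇ≡true)
    open Permutations using (allB-allFin-true⇒; allB-allFin-true⇐)

    m+n≤1⇒n≡0 : ∀ {a b : ℕ} → 1 ≤ a → a + b ≤ 1 → b ≡ 0
    m+n≤1⇒n≡0 {a} {b} h le = ℕP.n≤0⇒n≡0 (ℕP.≤-pred (≤-trans (ℕP.+-monoˡ-≤ b h) le))

    module TwoRows (B P : List (Fin n)) (dist : AtMostOnce (B ++ P)) (cov : ∀ k → k ∈ B ++ P) where
      tableau : Tab (Fin n)
      tableau = B ∷ P ∷ []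
      dB : AtMostOnce B
      dB = AtMostOnce-++ˡ {B} {P} dist
      dP : AtMostOnce P
      dP = AtMostOnce-++ʳ {B} {P} dist

      row-classify : ∀ k → ((∃ λ i → At B i k) × occurrences k P ≡ 0) ⊎ (occurrences k B ≡ 0 × (∃ λ i → At P i k))
      row-classify k with ∈-++⁻ B (cov k)
      ... | inj₁ m = inj₁ (∈⇒At m , m+n≤1⇒n≡0 (occurrences-∈ m) (subst (_≤ 1) (occurrences-++ k B P) (dist k)))
      ... | inj₂ m =
        inj₂ (m+n≤1⇒n≡0 (occurrences-∈ m) (subst (_≤ 1) (trans (occurrences-++ k B P) (ℕP.+-comm (occurrences k B) (occurrences k P))) (dist k))
             , ∈⇒At m)

      rowOf≡occurrences : ∀ k → rowOf tableau k ≡ occurrences k P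
      rowOf≡occurrences k with row-classify k
      ... | inj₁ ((i , a) , cP) rewrite findIn-at dB a = sym cP
      ... | inj₂ (cB , (i , a)) rewrite findIn-none {B} {k} cB | findIn-at dP a = ℕP.≤-antisym (occurrences-∈ (At⇒∈ a)) (dP k)

      colOf-classify : ∀ k → At B (colOf tableau k) k ⊎ (At P (colOf tableau k) k × occurrences k B ≡ 0)
      colOf-classify k with row-classify k
      ... | inj₁ ((i , a) , cP) rewrite findIn-at dB a = inj₁ a
      ... | inj₂ (cB , (i , a)) rewrite findIn-none {B} {k} cB | findIn-at dP a = inj₂ (a , cB)

      colOf-bottom : ∀ {i k} → At B i k → colOf tableau k ≡ i
      colOf-bottom a rewrite findIn-at dB a = refl

      colOf-top : ∀ {i k} → At P i k → colOf tableau k ≡ i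
      colOf-top {i} {k} a with row-classify k
      ... | inj₁ ((j , b) , cP) = ⊥-elim (ℕP.1+n≢0 (trans (ℕP.≤-antisym (occurrences-∈ (At⇒∈ a)) (dP k)) cP))
      ... | inj₂ (cB , _) rewrite findIn-none {B} {k} cB | findIn-at dP a = refl

      colOf-pair : ∀ {x y} → IsColumn P B x y → colOf tableau x ≡ colOf tableau y
      colOf-pair ip = let (i , a , b) = IsColumn⇒At ip in trans (colOf-top a) (sym (colOf-bottom b))

      PreservesColumns-from-colOf : ∀ (ω : Map n) → (∀ k → colOf tableau (ω k) ≡ colOf tableau k) → length P ≤ length B → PreservesColumns P B ω
      PreservesColumns-from-colOf ω cc le = record { maps-into-pair = maps-into-column ; fixes-others = fixes-rest }
        where
        column-member : ∀ {i t b} → At P i t → At B i b → ∀ z → colOf tableau z ≡ i → (z ≡ t) ⊎ (z ≡ b)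
        column-member at ab z cz with colOf-classify z
        ... | inj₁ az = inj₂ (At-functional (subst (λ j → At B j z) cz az) ab)
        ... | inj₂ (az , _) = inj₁ (At-functional (subst (λ j → At P j z) cz az) at)
        maps-into-column : ∀ {t b} → IsColumn P B t b → ((ω t ≡ t) ⊎ (ω t ≡ b)) × ((ω b ≡ t) ⊎ (ω b ≡ b))
        maps-into-column ip = let (i , at , ab) = IsColumn⇒At ip in
          column-member at ab (ω _) (trans (cc _) (colOf-top at)) , column-member at ab (ω _) (trans (cc _) (colOf-bottom ab))
        fixes-rest : ∀ k → NotIn k P B → ω k ≡ k
        fixes-rest k nk with colOf-classify k
        ... | inj₂ (ak , _) = let (b , ab) = <length⇒At B _ (≤-trans (At⇒<length ak) le) in ⊥-elim (proj₁ (nk (At⇒IsColumn ak ab)) refl)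
        ... | inj₁ ak with colOf-classify (ω k)
        ...   | inj₁ az = At-functional (subst (λ j → At B j (ω k)) (cc k) az) ak
        ...   | inj₂ (az , _) = ⊥-elim (proj₂ (nk (At⇒IsColumn (subst (λ j → At P j (ω k)) (cc k) az) ak)) refl)

      inC-sound : ∀ ω → inC tableau ω ≡ true → ∀ k → colOf tableau (ω k) ≡ colOf tableau k
      inC-sound ω eq k = ≡ᵇ≡true⇒≡ (allB-allFin-true⇒ n _ eq k)

      inC-complete : ∀ ω → (∀ k → colOf tableau (ω k) ≡ colOf tableau k) → inC tableau ω ≡ true
      inC-complete ω h = allB-allFin-true⇐ n _ (λ k → ≡⇒≡ᵇ≡true (h k))

      SameColumn⇒colOf : ∀ {x y} → SameColumn P B x y → colOf tableau x ≡ colOf tableau y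
      SameColumn⇒colOf (inj₁ x≡y) = cong (colOf tableau) x≡y
      SameColumn⇒colOf (inj₂ (inj₁ p)) = colOf-pair p
      SameColumn⇒colOf (inj₂ (inj₂ p)) = sym (colOf-pair p)

      inC-columnSwap : DisjointColumns P B → ∀ c → inC tableau (columnSwap P B c) ≡ true
      inC-columnSwap g c = inC-complete _ (λ k → SameColumn⇒colOf (columnSwap-SameColumn g c k))


module Antisymmetrizer where

  open import Data.Nat as ℕ using (ℕ; zero; suc; _+_; _*_; _∸_; _≤_; _≡ᵇ_)
  open import Data.Nat.Base using (_!)
  import Data.Nat.Properties as ℕP
  open import Data.Integer as ℤ using (ℤ; +_)
  import Data.Integer.Properties as ℤP
  open import Data.Bool using (Bool; true; false; if_then_else_; _∧_; not)
  open import Data.Fin using (Fin; _≟_)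
  open import Data.List using (List; []; _∷_; _++_; map; allFin; length; zipWith)
  open import Data.List.Properties using (∷-injectiveʳ)
  open import Data.List.Membership.Propositional using (_∈_)
  open import Data.Vec using (Vec; tabulate; lookup)
  open import Data.Vec.Properties using (lookup∘tabulate; tabulate∘lookup; tabulate-cong) renaming (≡-dec to ≡-decᵛ)
  open import Data.Product using (proj₁; proj₂)
  open import Data.Sum using (_⊎_; inj₁; inj₂)
  open import Data.Empty using (⊥-elim)
  open import Relation.Binary.PropositionalEquality
  open import Relation.Nullary using (¬_; yes; no; does)
  open import Function using (_∘_)
  open import Defs
  open Sign using (sgn-cong)
  open BooleanTests using (bool-ext; false≢true; true≢false; ≡ᵇ≡true⇒≡; ≡⇒≡ᵇ≡true)
  open Permutations
  open Arrangements
  open Coefficients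
  open ColumnSwaps
  open TwoRowFilling
  open ≡-Reasoning

  Σz-choices-zero : ∀ {n} (ts bs : List (Fin n)) (f : List Bool → ℤ) → (∀ c → FitsColumns ts bs c → f c ≡ + 0) →
    Z.Σ (choices ts bs) f ≡ + 0
  Σz-choices-zero (t ∷ ts) (b ∷ bs) f f≡0 =
    trans (Z.Σ-++ (map (false ∷_) (choices ts bs)) (map (true ∷_) (choices ts bs)) f)
    (cong₂ ℤ._+_ (trans (Z.Σ-map (false ∷_) (choices ts bs) f) (Σz-choices-zero ts bs (f ∘ (false ∷_)) (λ c fc → f≡0 _ (f∷ fc))))
                 (trans (Z.Σ-map (true ∷_) (choices ts bs) f) (Σz-choices-zero ts bs (f ∘ (true ∷_)) (λ c fc → f≡0 _ (f∷ fc)))))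
  Σz-choices-zero [] bs f f≡0 = trans (ℤP.+-identityʳ (f [])) (f≡0 [] f[])
  Σz-choices-zero (t ∷ ts) [] f f≡0 = trans (ℤP.+-identityʳ (f [])) (f≡0 [] f∷[])

  Σz-choices-single : ∀ {n} (ts bs : List (Fin n)) (f : List Bool → ℤ) c₀ → FitsColumns ts bs c₀ →
    (∀ c → FitsColumns ts bs c → ¬ c ≡ c₀ → f c ≡ + 0) → Z.Σ (choices ts bs) f ≡ f c₀
  Σz-choices-single (t ∷ ts) (b ∷ bs) f (false ∷ c₀) (f∷ fits) off =
    trans (Z.Σ-++ (map (false ∷_) (choices ts bs)) (map (true ∷_) (choices ts bs)) f)
    (trans (cong₂ ℤ._+_
             (trans (Z.Σ-map (false ∷_) (choices ts bs) f)
                    (Σz-choices-single ts bs (f ∘ (false ∷_)) c₀ fits (λ c fc c≢c₀ → off _ (f∷ fc) (c≢c₀ ∘ ∷-injectiveʳ))))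
             (trans (Z.Σ-map (true ∷_) (choices ts bs) f)
                    (Σz-choices-zero ts bs (f ∘ (true ∷_)) (λ c fc → off _ (f∷ fc) (λ ())))))
    (ℤP.+-identityʳ _))
  Σz-choices-single (t ∷ ts) (b ∷ bs) f (true ∷ c₀) (f∷ fits) off =
    trans (Z.Σ-++ (map (false ∷_) (choices ts bs)) (map (true ∷_) (choices ts bs)) f)
    (trans (cong₂ ℤ._+_
             (trans (Z.Σ-map (false ∷_) (choices ts bs) f)
                    (Σz-choices-zero ts bs (f ∘ (false ∷_)) (λ c fc → off _ (f∷ fc) (λ ()))))
             (trans (Z.Σ-map (true ∷_) (choices ts bs) f)
                    (Σz-choices-single ts bs (f ∘ (true ∷_)) c₀ fits (λ c fc c≢c₀ → off _ (f∷ fc) (c≢c₀ ∘ ∷-injectiveʳ)))))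
    (ℤP.+-identityˡ _))
  Σz-choices-single [] bs f [] f[] _ = ℤP.+-identityʳ (f [])
  Σz-choices-single (t ∷ ts) [] f [] f∷[] _ = ℤP.+-identityʳ (f [])

  allB-cong : ∀ {X : Set} (l : List X) (p q : X → Bool) → (∀ x → p x ≡ q x) → allB p l ≡ allB q l
  allB-cong [] p q p≗q = refl
  allB-cong (x ∷ l) p q p≗q = cong₂ _∧_ (p≗q x) (allB-cong l p q p≗q)

  isInjective-cong : ∀ {n} (f g : Map n) → (∀ k → f k ≡ g k) → isInjective f ≡ isInjective g
  isInjective-cong {n} f g f≗g =
    allB-cong (pairsLt n) _ _ (λ ij → cong₂ (λ x y → not (does (x ≟ y))) (f≗g (proj₁ ij)) (f≗g (proj₂ ij)))

  inC-cong : ∀ {n} (T : Tab (Fin n)) (f g : Map n) → (∀ k → f k ≡ g k) → inC T f ≡ inC T g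
  inC-cong {n} T f g f≗g = allB-cong (allFin n) _ _ (λ k → cong (λ x → colOf T x ≡ᵇ colOf T k) (f≗g k))

  actExps-cong : ∀ {n} (f g : Map n) (e : Exps n) → (∀ k → f k ≡ g k) → actExps f e ≡ actExps g e
  actExps-cong {n} f g e f≗g = vec-ext _ _ (λ j → begin
    lookup (actExps f e) j                                            ≡⟨ lookup-actExps f e j ⟩
    N.Σ (allFin n) (λ i → if does (f i ≟ j) then lookup e i else 0)   ≡⟨ N.Σ-cong (allFin n) (λ i → cong (λ x → if does (x ≟ j) then lookup e i else 0) (f≗g i)) ⟩
    N.Σ (allFin n) (λ i → if does (g i ≟ j) then lookup e i else 0)   ≡⟨ sym (lookup-actExps g e j) ⟩
    lookup (actExps g e) j                                            ∎)

  Σz-if-const : ∀ {A : Set} (l : List A) (f : A → Bool) (y : ℤ) →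
    Z.Σ l (λ v → if f v then y else + 0) ≡ + N.Σ l (λ v → b2n (f v)) ℤ.* y
  Σz-if-const [] f y = sym (ℤP.*-zeroˡ y)
  Σz-if-const (v ∷ l) f y with f v
  ... | true = begin
    y ℤ.+ Z.Σ l (λ v → if f v then y else + 0)      ≡⟨ cong (λ z → y ℤ.+ z) (Σz-if-const l f y) ⟩
    y ℤ.+ + N.Σ l (λ v → b2n (f v)) ℤ.* y          ≡⟨ cong (ℤ._+ (+ N.Σ l (λ v → b2n (f v)) ℤ.* y)) (sym (ℤP.*-identityˡ y)) ⟩
    + 1 ℤ.* y ℤ.+ + N.Σ l (λ v → b2n (f v)) ℤ.* y  ≡⟨ sym (ℤP.*-distribʳ-+ y (+ 1) (+ N.Σ l (λ v → b2n (f v)))) ⟩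
    (+ 1 ℤ.+ + N.Σ l (λ v → b2n (f v))) ℤ.* y      ∎
  ... | false = trans (ℤP.+-identityˡ _) (Σz-if-const l f y)

  Σz-allPerms : ∀ {n} (p : Map n → Bool) (F : Map n → ℤ) →
    Z.Σ (filterB p (allPerms n)) F ≡
    Z.Σ (allVecs n n) (λ v → if isInjective (lookup v) then (if p (lookup v) then F (lookup v) else + 0) else + 0)
  Σz-allPerms {n} p F =
    trans (Z.Σ-filterB p (allPerms n) F)
    (trans (Z.Σ-filterB isInjective (map lookup (allVecs n n)) _)
    (Z.Σ-map lookup (allVecs n n) _))

  module OfTwoRowFilling {n : ℕ} (B P : List (Fin n)) (dist : AtMostOnce (B ++ P)) (cov : ∀ k → k ∈ B ++ P) (le : length P ≤ length B) where
    open TwoRows B P dist cov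

    topExps : Exps n
    topExps = tabulate (λ k → occurrences k P)

    good : DisjointColumns P B
    good = AtMostOnce⇒Good P B dist

    inTop : Fin n → Bool
    inTop k = occurrences k P ≡ᵇ 1

    occurrences-top-0-or-1 : ∀ k → (occurrences k P ≡ 0) ⊎ (occurrences k P ≡ 1)
    occurrences-top-0-or-1 k with occurrences k P | dP k
    ... | zero | _ = inj₁ refl
    ... | suc zero | _ = inj₂ refl
    ... | suc (suc _) | ℕ.s≤s ()

    inTop-≡⇒occurrences-≡ : ∀ x y → inTop x ≡ inTop y → occurrences x P ≡ occurrences y P
    inTop-≡⇒occurrences-≡ x y eq with occurrences-top-0-or-1 x | occurrences-top-0-or-1 y
    ... | inj₁ x0 | inj₁ y0 = trans x0 (sym y0)
    ... | inj₂ x1 | inj₂ y1 = trans x1 (sym y1)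
    ... | inj₁ x0 | inj₂ y1 rewrite x0 | y1 = ⊥-elim (false≢true eq)
    ... | inj₂ x1 | inj₁ y0 rewrite x1 | y0 = ⊥-elim (true≢false eq)

    inR-sound : ∀ ω → inR tableau ω ≡ true → ∀ k → occurrences (ω k) P ≡ occurrences k P
    inR-sound ω eq k = trans (sym (rowOf≡occurrences (ω k))) (trans (≡ᵇ≡true⇒≡ (allB-allFin-true⇒ n _ eq k)) (rowOf≡occurrences k))

    inR-complete : ∀ ω → (∀ k → occurrences (ω k) P ≡ occurrences k P) → inR tableau ω ≡ true
    inR-complete ω h =
      allB-allFin-true⇐ n _ (λ k → ≡⇒≡ᵇ≡true (trans (rowOf≡occurrences (ω k)) (trans (h k) (sym (rowOf≡occurrences k)))))

    isInjective≡distinctᵇ : ∀ v → isInjective (lookup v) ≡ distinctᵇ inTop v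
    isInjective≡distinctᵇ v = bool-ext (distinctᵇ-complete inTop v ∘ isInjective-sound _)
                                       (isInjective-complete _ ∘ distinctᵇ-sound inTop v)

    inR≡hasColoursᵇ : ∀ (v : Vec (Fin n) n) → inR tableau (lookup v) ≡ hasColoursᵇ inTop (tabulate inTop) v
    inR≡hasColoursᵇ v = bool-ext
      (λ eq → hasColoursᵇ-complete inTop (tabulate inTop) v
                (λ i → trans (cong (_≡ᵇ 1) (inR-sound _ eq i)) (sym (lookup∘tabulate inTop i))))
      (λ eq → inR-complete _
                (λ i → inTop-≡⇒occurrences-≡ _ _ (trans (hasColoursᵇ-sound inTop (tabulate inTop) v eq i) (lookup∘tabulate inTop i))))

    occurrences≡Σ : ∀ (a : Fin n) l → occurrences a l ≡ N.Σ l (λ x → if does (x ≟ a) then 1 else 0)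
    occurrences≡Σ a [] = refl
    occurrences≡Σ a (y ∷ l) with does (y ≟ a)
    ... | true = cong suc (occurrences≡Σ a l)
    ... | false = occurrences≡Σ a l

    Σ-one≡length : ∀ {A : Set} (l : List A) → N.Σ l (λ _ → 1) ≡ length l
    Σ-one≡length [] = refl
    Σ-one≡length (x ∷ l) = cong suc (Σ-one≡length l)

    classSize-top : classSize inTop true ≡ length P
    classSize-top = begin
      N.Σ (allFin n) (λ a → b2n (eqB (inTop a) true))
        ≡⟨ N.Σ-cong (allFin n) b2n-inTop ⟩
      N.Σ (allFin n) (λ a → occurrences a P)
        ≡⟨ N.Σ-cong (allFin n) (λ a → occurrences≡Σ a P) ⟩
      N.Σ (allFin n) (λ a → N.Σ P (λ x → if does (x ≟ a) then 1 else 0))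
        ≡⟨ N.Σ-swap (allFin n) P (λ a x → if does (x ≟ a) then 1 else 0) ⟩
      N.Σ P (λ x → N.Σ (allFin n) (λ a → if does (x ≟ a) then 1 else 0))
        ≡⟨ N.Σ-cong P (λ x → N.Σ-allFin-single n _ x (off x)) ⟩
      N.Σ P (λ x → if does (x ≟ x) then 1 else 0)
        ≡⟨ N.Σ-cong P (λ x → on x) ⟩
      N.Σ P (λ _ → 1)
        ≡⟨ Σ-one≡length P ⟩
      length P ∎
      where
      b2n-inTop : ∀ a → b2n (eqB (inTop a) true) ≡ occurrences a P
      b2n-inTop a with occurrences-top-0-or-1 a
      ... | inj₁ a0 rewrite a0 = refl
      ... | inj₂ a1 rewrite a1 = refl
      off : ∀ x a → ¬ a ≡ x → (if does (x ≟ a) then 1 else 0) ≡ 0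
      off x a a≢x with x ≟ a
      ... | yes x≡a = ⊥-elim (a≢x (sym x≡a))
      ... | no _ = refl
      on : ∀ x → (if does (x ≟ x) then 1 else 0) ≡ 1
      on x with x ≟ x
      ... | yes _ = refl
      ... | no x≢x = ⊥-elim (x≢x refl)

    classSize-bottom : classSize inTop false ≡ n ∸ length P
    classSize-bottom =
      trans (sym (ℕP.m+n∸m≡n (classSize inTop true) (classSize inTop false))) (cong₂ _∸_ (classSize-true+false inTop) classSize-top)

    rowGroupOrder : ℕ
    rowGroupOrder = length P ! * (n ∸ length P) !

    Σz-rowGroup : ∀ (F : Exps n → ℤ) → Z.Σ (filterB (inR tableau) (allPerms n)) (λ σ → F (actExps σ topExps)) ≡ + rowGroupOrder ℤ.* F topExps
    Σz-rowGroup F = begin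
      Z.Σ (filterB (inR tableau) (allPerms n)) (λ σ → F (actExps σ topExps))
        ≡⟨ Σz-allPerms (inR tableau) (λ σ → F (actExps σ topExps)) ⟩
      Z.Σ (allVecs n n) (λ v → if isInjective (lookup v) then (if inR tableau (lookup v) then F (actExps (lookup v) topExps) else + 0) else + 0)
        ≡⟨ Z.Σ-cong (allVecs n n) summand ⟩
      Z.Σ (allVecs n n) (λ v → if distinctᵇ inTop v ∧ hasColoursᵇ inTop (tabulate inTop) v then F topExps else + 0)
        ≡⟨ Σz-if-const (allVecs n n) (λ v → distinctᵇ inTop v ∧ hasColoursᵇ inTop (tabulate inTop) v) (F topExps) ⟩
      + N.Σ (allVecs n n) (λ v → b2n (distinctᵇ inTop v ∧ hasColoursᵇ inTop (tabulate inTop) v)) ℤ.* F topExps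
        ≡⟨ cong (λ z → + z ℤ.* F topExps) (trans (count-colour-preserving inTop) (cong₂ (λ x y → x ! * y !) classSize-top classSize-bottom)) ⟩
      + rowGroupOrder ℤ.* F topExps ∎
      where
      summand : ∀ v → (if isInjective (lookup v) then (if inR tableau (lookup v) then F (actExps (lookup v) topExps) else + 0) else + 0)
                      ≡ (if distinctᵇ inTop v ∧ hasColoursᵇ inTop (tabulate inTop) v then F topExps else + 0)
      summand v rewrite isInjective≡distinctᵇ v | inR≡hasColoursᵇ v
        with distinctᵇ inTop v in distinct | hasColoursᵇ inTop (tabulate inTop) v in coloured
      ... | false | _ = refl
      ... | true | false = refl
      ... | true | true = cong F (actExps-invariant (lookup v) (distinctᵇ-sound inTop v distinct) topExps row-stable)
        where
        row-stable : ∀ i → lookup topExps (lookup v i) ≡ lookup topExps i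
        row-stable i = begin
          lookup topExps (lookup v i)   ≡⟨ lookup∘tabulate _ (lookup v i) ⟩
          occurrences (lookup v i) P    ≡⟨ inTop-≡⇒occurrences-≡ _ _ (trans (hasColoursᵇ-sound inTop (tabulate inTop) v coloured i) (lookup∘tabulate inTop i)) ⟩
          occurrences i P               ≡⟨ sym (lookup∘tabulate _ i) ⟩
          lookup topExps i              ∎

    choiceTerm : Exps n → List Bool → ℤ
    choiceTerm a c = contribution (choiceExps P B c) a (choiceSign c)

    swapVector : List Bool → Vec (Fin n) n
    swapVector c = tabulate (columnSwap P B c)

    selected : Exps n → Vec (Fin n) n → List Bool → ℤ
    selected a v c = if does (≡-decᵛ _≟_ v (swapVector c)) then choiceTerm a c else + 0

    lookup-swapVector : ∀ {v} c → v ≡ swapVector c → ∀ k → lookup v k ≡ columnSwap P B c k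
    lookup-swapVector c refl k = lookup∘tabulate (columnSwap P B c) k

    columnTerm : Exps n → Map n → ℤ
    columnTerm a τ = contribution (actExps τ topExps) a (sgn τ ℤ.* + 1)

    Σz-selected-columnPerm : ∀ a (v : Vec (Fin n) n) → isInjective (lookup v) ≡ true → inC tableau (lookup v) ≡ true →
      Z.Σ (choices P B) (selected a v) ≡ columnTerm a (lookup v)
    Σz-selected-columnPerm a v injective inColumns = trans (Σz-choices-single P B (selected a v) c₀ fits off) on
      where
      ω : Map n
      ω = lookup v
      c₀ : List Bool
      c₀ = swappedColumns P B ω
      fits : FitsColumns P B c₀
      fits = swappedColumns-Fits P B ω
      ω≗swap : ∀ k → ω k ≡ columnSwap P B c₀ k
      ω≗swap = columnSwap-complete good ω (isInjective-sound ω injective) (PreservesColumns-from-colOf ω (inC-sound ω inColumns) le)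
      on : selected a v c₀ ≡ columnTerm a ω
      on with ≡-decᵛ _≟_ v (swapVector c₀)
      ... | no v≢ = ⊥-elim (v≢ (trans (sym (tabulate∘lookup v)) (tabulate-cong ω≗swap)))
      ... | yes _ = sym (cong₂ (λ x y → contribution x a y)
                          (trans (actExps-cong ω (columnSwap P B c₀) topExps ω≗swap) (actExps-columnSwap good fits le))
                          (trans (ℤP.*-identityʳ (sgn ω)) (trans (sgn-cong ω (columnSwap P B c₀) ω≗swap) (sgn-columnSwap good fits))))
      off : ∀ c → FitsColumns P B c → ¬ c ≡ c₀ → selected a v c ≡ + 0
      off c fc c≢c₀ with ≡-decᵛ _≟_ v (swapVector c)
      ... | no _ = refl
      ... | yes v≡ = ⊥-elim (c≢c₀ (trans (sym (swappedColumns-columnSwap good fc))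
                                          (swappedColumns-cong (columnSwap P B c) ω (λ {t′} _ → sym (lookup-swapVector c v≡ t′)))))

    Σz-selected-outside : ∀ a (v : Vec (Fin n) n) → (∀ c → FitsColumns P B c → ¬ v ≡ swapVector c) → Z.Σ (choices P B) (selected a v) ≡ + 0
    Σz-selected-outside a v outside = Σz-choices-zero P B (selected a v) unselected
      where
      unselected : ∀ c → FitsColumns P B c → selected a v c ≡ + 0
      unselected c fc with ≡-decᵛ _≟_ v (swapVector c)
      ... | no _ = refl
      ... | yes v≡ = ⊥-elim (outside c fc v≡)

    Σz-selected : ∀ a (v : Vec (Fin n) n) →
      (if isInjective (lookup v) then (if inC tableau (lookup v) then columnTerm a (lookup v) else + 0) else + 0)
      ≡ Z.Σ (choices P B) (selected a v)
    Σz-selected a v with isInjective (lookup v) in injective | inC tableau (lookup v) in inColumns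
    ... | true | true = sym (Σz-selected-columnPerm a v injective inColumns)
    ... | true | false = sym (Σz-selected-outside a v (λ c _ v≡ → true≢false (trans (sym (in-column-group c v≡)) inColumns)))
      where
      in-column-group : ∀ c → v ≡ swapVector c → inC tableau (lookup v) ≡ true
      in-column-group c v≡ = trans (inC-cong tableau (lookup v) (columnSwap P B c) (lookup-swapVector c v≡)) (inC-columnSwap good c)
    ... | false | _ = sym (Σz-selected-outside a v (λ c _ v≡ → true≢false (trans (sym (injective-swap c v≡)) injective)))
      where
      injective-swap : ∀ c → v ≡ swapVector c → isInjective (lookup v) ≡ true
      injective-swap c v≡ =
        trans (isInjective-cong (lookup v) (columnSwap P B c) (lookup-swapVector c v≡)) (isInjective-complete _ (columnSwap-injective good c))

    -- Each column permutation is columnSwap c for exactly one choice c of columns to swap.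
    Σz-columnGroup : ∀ a → Z.Σ (filterB (inC tableau) (allPerms n)) (columnTerm a) ≡ Z.Σ (choices P B) (choiceTerm a)
    Σz-columnGroup a = begin
      Z.Σ (filterB (inC tableau) (allPerms n)) (columnTerm a)
        ≡⟨ Σz-allPerms (inC tableau) (columnTerm a) ⟩
      Z.Σ (allVecs n n) (λ v → if isInjective (lookup v) then (if inC tableau (lookup v) then columnTerm a (lookup v) else + 0) else + 0)
        ≡⟨ Z.Σ-cong (allVecs n n) (Σz-selected a) ⟩
      Z.Σ (allVecs n n) (λ v → Z.Σ (choices P B) (selected a v))
        ≡⟨ Z.Σ-swap (allVecs n n) (choices P B) (selected a) ⟩
      Z.Σ (choices P B) (λ c → Z.Σ (allVecs n n) (λ v → selected a v c))
        ≡⟨ Z.Σ-cong (choices P B) (λ c → Z.Σ-allVecs-single n n _ (swapVector c) (off c)) ⟩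
      Z.Σ (choices P B) (λ c → selected a (swapVector c) c)
        ≡⟨ Z.Σ-cong (choices P B) on ⟩
      Z.Σ (choices P B) (choiceTerm a) ∎
      where
      off : ∀ c v → ¬ v ≡ swapVector c → selected a v c ≡ + 0
      off c v v≢ with ≡-decᵛ _≟_ v (swapVector c)
      ... | yes v≡ = ⊥-elim (v≢ v≡)
      ... | no _ = refl
      on : ∀ c → selected a (swapVector c) c ≡ choiceTerm a c
      on c with ≡-decᵛ _≟_ (swapVector c) (swapVector c)
      ... | yes _ = refl
      ... | no v≢v = ⊥-elim (v≢v refl)

    coeff-εT-topExps : ∀ a → coeff (εT tableau (monomial topExps)) a ≡
                             coeff (scaleP (+ rowGroupOrder) (prodP (zipWith (λ t b → var t -P var b) P B))) a
    coeff-εT-topExps a = begin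
      coeff (εT tableau (monomial topExps)) a
        ≡⟨ coeff-εT-monomial tableau topExps a ⟩
      Z.Σ C (λ τ → Z.Σ R (λ σ → contribution (actExps τ (actExps σ topExps)) a (sgn τ ℤ.* + 1)))
        ≡⟨ Z.Σ-cong C (λ τ → Σz-rowGroup (λ e → contribution (actExps τ e) a (sgn τ ℤ.* + 1))) ⟩
      Z.Σ C (λ τ → + rowGroupOrder ℤ.* columnTerm a τ)
        ≡⟨ Σz-*ˡ (+ rowGroupOrder) C (columnTerm a) ⟩
      + rowGroupOrder ℤ.* Z.Σ C (columnTerm a)
        ≡⟨ cong (+ rowGroupOrder ℤ.*_) (Σz-columnGroup a) ⟩
      + rowGroupOrder ℤ.* Z.Σ (choices P B) (choiceTerm a)
        ≡⟨ cong (+ rowGroupOrder ℤ.*_) (sym (Σz-prodP-varDiff P B (λ t → contribution (proj₂ t) a (proj₁ t)))) ⟩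
      + rowGroupOrder ℤ.* Z.Σ Π (λ t → contribution (proj₂ t) a (proj₁ t))
        ≡⟨ cong (+ rowGroupOrder ℤ.*_) (sym (coeff≡Σ Π a)) ⟩
      + rowGroupOrder ℤ.* coeff Π a
        ≡⟨ sym (coeff-scaleP (+ rowGroupOrder) Π a) ⟩
      coeff (scaleP (+ rowGroupOrder) Π) a ∎
      where
      C R : List (Map n)
      C = filterB (inC tableau) (allPerms n)
      R = filterB (inR tableau) (allPerms n)
      Π : Poly n
      Π = prodP (zipWith (λ t b → var t -P var b) P B)


module Cocharge where

  open import Data.Nat as ℕ using (ℕ; zero; suc; _+_; _≤_; _<_; _<ᵇ_; _≡ᵇ_; z≤n; s≤s)
  import Data.Nat.Properties as ℕP
  open import Data.Bool using (Bool; true; false; if_then_else_; _∧_; not)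
  open import Data.List as List using (List; []; _∷_; _++_; map; length; replicate; foldl; foldr; zip; upTo; applyUpTo)
  open import Data.List.Properties using (foldl-++; ++-identityʳ; length-++; length-replicate; map-cong; map-++)
  open import Data.List.Membership.Propositional using (_∈_)
  open import Data.List.Membership.Propositional.Properties using (∈-++⁻)
  open import Data.List.Relation.Unary.Any using (here; there)
  open import Data.List.Relation.Unary.Any.Properties using (¬Any[])
  open import Data.Bool.Properties using (∧-zeroʳ)
  open import Data.Maybe using (Maybe; just; nothing)
  open import Data.Maybe.Properties using (just-injective)
  open import Data.Product using (_×_; _,_; proj₁; proj₂; ∃)
  open import Data.Sum using (_⊎_; inj₁; inj₂)
  open import Data.Empty using (⊥-elim)
  open import Relation.Binary.PropositionalEquality
  open import Relation.Nullary using (¬_; yes; no)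
  open import Function using (_∘_)
  open import Defs
  open BooleanTests

  open ≡-Reasoning

  Entry : Set
  Entry = ℕ × ℕ

  block : ℕ → ℕ → ℕ → Rem
  block s zero c = []
  block s (suc a) c = (s , c) ∷ block (suc s) a c

  block-snoc : ∀ s a c → block s (suc a) c ≡ block s a c ++ (s + a , c) ∷ []
  block-snoc s zero c = cong (λ z → (z , c) ∷ []) (sym (ℕP.+-identityʳ s))
  block-snoc s (suc a) c = cong ((s , c) ∷_) (trans (block-snoc (suc s) a c) (cong (λ z → block (suc s) a c ++ (z , c) ∷ []) (sym (ℕP.+-suc s a))))

  ∈-block : ∀ {s a c pl} → pl ∈ block s a c → (proj₂ pl ≡ c) × (s ≤ proj₁ pl) × (proj₁ pl < s + a)
  ∈-block {s} {suc a} (here refl) = refl , ℕP.≤-refl , subst (s <_) (sym (ℕP.+-suc s a)) (s≤s (ℕP.m≤m+n s a))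
  ∈-block {s} {suc a} {pl = pl} (there m) = let (e , l , u) = ∈-block m in e , ℕP.≤-trans (ℕP.n≤1+n s) l , subst (λ z → proj₁ pl < z) (sym (ℕP.+-suc s a)) u

  lastMatch : (Entry → Bool) → Maybe ℕ → Rem → Maybe ℕ
  lastMatch pr z l = foldl (λ acc pl → if pr pl then just (proj₁ pl) else acc) z l

  lastMatch-none : ∀ pr z l → (∀ {pl} → pl ∈ l → pr pl ≡ false) → lastMatch pr z l ≡ z
  lastMatch-none pr z [] h = refl
  lastMatch-none pr z (pl ∷ l) h rewrite h (here refl) = lastMatch-none pr z l (λ m → h (there m))

  lastMatch-++ : ∀ pr z xs ys → lastMatch pr z (xs ++ ys) ≡ lastMatch pr (lastMatch pr z xs) ys
  lastMatch-++ pr z xs ys = foldl-++ _ z xs ys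

  lastMatch-snoc : ∀ pr z l pl → pr pl ≡ true → lastMatch pr z (l ++ pl ∷ []) ≡ just (proj₁ pl)
  lastMatch-snoc pr z l pl e rewrite lastMatch-++ pr z l (pl ∷ []) | e = refl

  lastMatch-sound : ∀ pr z l {q} → lastMatch pr z l ≡ just q → (z ≡ just q) ⊎ (∃ λ pl → pl ∈ l × pr pl ≡ true × proj₁ pl ≡ q)
  lastMatch-sound pr z [] e = inj₁ e
  lastMatch-sound pr z (pl ∷ l) e with pr pl in epr
  ... | false with lastMatch-sound pr z l e
  ...   | inj₁ e′ = inj₁ e′
  ...   | inj₂ (p , m , a , b) = inj₂ (p , there m , a , b)
  lastMatch-sound pr z (pl ∷ l) e | true with lastMatch-sound pr (just (proj₁ pl)) l e
  ...   | inj₁ e′ = inj₂ (pl , here refl , epr , just-injective e′)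
  ...   | inj₂ (p , m , a , b) = inj₂ (p , there m , a , b)

  cprev-before : ∀ m p rem q → rightmostBefore m p rem ≡ just q → cprev m p rem ≡ just q
  cprev-before m p rem q e rewrite e = refl

  cprev-nothing : ∀ m p rem → rightmostBefore m p rem ≡ nothing → rightmost m rem ≡ nothing → cprev m p rem ≡ nothing
  cprev-nothing m p rem e1 e2 rewrite e1 | e2 = refl

  cprev-after : ∀ m p rem → rightmostBefore m p rem ≡ nothing → cprev m p rem ≡ rightmost m rem
  cprev-after m p rem e rewrite e = refl

  chain-step : ∀ f j p label rem q → cprev (suc j) p rem ≡ just q →
    chain (suc f) j p label rem ≡ (q , (if p <ᵇ q then label else suc label)) ∷ chain f (suc j) q (if p <ᵇ q then label else suc label) rem
  chain-step f j p label rem q e rewrite e = refl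

  chain-stop : ∀ f j p label rem → cprev (suc j) p rem ≡ nothing → chain f j p label rem ≡ []
  chain-stop zero j p label rem e = refl
  chain-stop (suc f) j p label rem e rewrite e = refl

  firstSubword-just : ∀ f rem p → rightmost 1 rem ≡ just p → firstSubword f rem ≡ (p , 0) ∷ chain f 1 p 0 rem
  firstSubword-just f rem p e rewrite e = refl

  filterB-++ : ∀ {A : Set} (p : A → Bool) xs ys → filterB p (xs ++ ys) ≡ filterB p xs ++ filterB p ys
  filterB-++ p [] ys = refl
  filterB-++ p (x ∷ xs) ys with p x
  ... | true = cong (x ∷_) (filterB-++ p xs ys)
  ... | false = filterB-++ p xs ys

  filterB-all : ∀ {A : Set} (p : A → Bool) l → (∀ {x} → x ∈ l → p x ≡ true) → filterB p l ≡ l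
  filterB-all p [] h = refl
  filterB-all p (x ∷ l) h rewrite h (here refl) = cong (x ∷_) (filterB-all p l (λ m → h (there m)))

  filterB-⊆ : ∀ {A : Set} (p : A → Bool) l {x} → x ∈ filterB p l → x ∈ l
  filterB-⊆ p (y ∷ l) m with p y
  filterB-⊆ p (y ∷ l) (here e) | true = here e
  filterB-⊆ p (y ∷ l) (there m) | true = there (filterB-⊆ p l m)
  ... | false = there (filterB-⊆ p l m)

  OnlyLetters12 : Rem → Set
  OnlyLetters12 rem = ∀ {pl} → pl ∈ rem → (proj₂ pl ≡ 1) ⊎ (proj₂ pl ≡ 2)

  cprev-3≡nothing : ∀ rem → OnlyLetters12 rem → ∀ q → cprev 3 q rem ≡ nothing
  cprev-3≡nothing rem h q =
    cprev-nothing 3 q rem (lastMatch-none (λ pl → (proj₂ pl ≡ᵇ 3) ∧ (proj₁ pl <ᵇ q)) nothing rem (λ {pl} m → not-3-before {pl} (h m)))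
                          (lastMatch-none (λ pl → proj₂ pl ≡ᵇ 3) nothing rem (λ {pl} m → not-3 {pl} (h m)))
    where
    not-3-before : ∀ {pl : Entry} → (proj₂ pl ≡ 1) ⊎ (proj₂ pl ≡ 2) → ((proj₂ pl ≡ᵇ 3) ∧ (proj₁ pl <ᵇ q)) ≡ false
    not-3-before (inj₁ e) rewrite e = refl
    not-3-before (inj₂ e) rewrite e = refl
    not-3 : ∀ {pl : Entry} → (proj₂ pl ≡ 1) ⊎ (proj₂ pl ≡ 2) → (proj₂ pl ≡ᵇ 3) ≡ false
    not-3 (inj₁ e) rewrite e = refl
    not-3 (inj₂ e) rewrite e = refl

  module TwoRowWord (d x y : ℕ) (dx : d ≤ x) where

    -- What is left of 2^d 1^x 2^y, as (position, letter) pairs, after d − a rounds of the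
    -- decomposition: the first a leading 2s, the first b of the 1s and all trailing 2s.
    trailingTwos : Rem
    trailingTwos = block (d + x) y 2

    remaining : ℕ → ℕ → Rem
    remaining a b = block 0 a 2 ++ (block d b 1 ++ trailingTwos)

    ∈-remaining : ∀ {a b pl} → pl ∈ remaining a b → (pl ∈ block 0 a 2) ⊎ ((pl ∈ block d b 1) ⊎ (pl ∈ trailingTwos))
    ∈-remaining {a} {b} m with ∈-++⁻ (block 0 a 2) m
    ... | inj₁ m1 = inj₁ m1
    ... | inj₂ m2 = inj₂ (∈-++⁻ (block d b 1) m2)

    remaining-OnlyLetters12 : ∀ a b → OnlyLetters12 (remaining a b)
    remaining-OnlyLetters12 a b m with ∈-remaining {a} {b} m
    ... | inj₁ m1 = inj₂ (proj₁ (∈-block m1))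
    ... | inj₂ (inj₁ m1) = inj₁ (proj₁ (∈-block m1))
    ... | inj₂ (inj₂ m1) = inj₂ (proj₁ (∈-block m1))

    module Step (a b : ℕ) (ad : suc a ≤ d) (bx : suc b ≤ x) where
      rem : Rem
      rem = remaining (suc a) (suc b)

      rightmost-1 : rightmost 1 rem ≡ just (d + b)
      rightmost-1 = begin
        lastMatch is1 nothing (block 0 (suc a) 2 ++ (block d (suc b) 1 ++ trailingTwos))
          ≡⟨ lastMatch-++ is1 nothing (block 0 (suc a) 2) _ ⟩
        lastMatch is1 (lastMatch is1 nothing (block 0 (suc a) 2)) (block d (suc b) 1 ++ trailingTwos)
          ≡⟨ cong (λ z → lastMatch is1 z (block d (suc b) 1 ++ trailingTwos)) (lastMatch-none is1 nothing (block 0 (suc a) 2) not-1) ⟩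
        lastMatch is1 nothing (block d (suc b) 1 ++ trailingTwos)
          ≡⟨ lastMatch-++ is1 nothing (block d (suc b) 1) trailingTwos ⟩
        lastMatch is1 (lastMatch is1 nothing (block d (suc b) 1)) trailingTwos
          ≡⟨ cong (λ z → lastMatch is1 (lastMatch is1 nothing z) trailingTwos) (block-snoc d b 1) ⟩
        lastMatch is1 (lastMatch is1 nothing (block d b 1 ++ (d + b , 1) ∷ [])) trailingTwos
          ≡⟨ cong (λ z → lastMatch is1 z trailingTwos) (lastMatch-snoc is1 nothing (block d b 1) (d + b , 1) refl) ⟩
        lastMatch is1 (just (d + b)) trailingTwos
          ≡⟨ lastMatch-none is1 (just (d + b)) trailingTwos not-1 ⟩
        just (d + b) ∎
        where
        is1 : Entry → Bool
        is1 pl = proj₂ pl ≡ᵇ 1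
        not-1 : ∀ {c s k pl} → pl ∈ block s k (suc (suc c)) → is1 pl ≡ false
        not-1 pl∈ = cong (_≡ᵇ 1) (proj₁ (∈-block pl∈))

      a<db : a < d + b
      a<db = ℕP.≤-trans ad (ℕP.m≤m+n d b)

      rightmostBefore-2 : rightmostBefore 2 (d + b) rem ≡ just a
      rightmostBefore-2 = begin
        lastMatch is2-before nothing (block 0 (suc a) 2 ++ rest)
          ≡⟨ lastMatch-++ is2-before nothing (block 0 (suc a) 2) rest ⟩
        lastMatch is2-before (lastMatch is2-before nothing (block 0 (suc a) 2)) rest
          ≡⟨ cong (λ z → lastMatch is2-before (lastMatch is2-before nothing z) rest) (block-snoc 0 a 2) ⟩
        lastMatch is2-before (lastMatch is2-before nothing (block 0 a 2 ++ (a , 2) ∷ [])) rest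
          ≡⟨ cong (λ z → lastMatch is2-before z rest) (lastMatch-snoc is2-before nothing (block 0 a 2) (a , 2) (cong (true ∧_) (<⇒<ᵇ≡true a<db))) ⟩
        lastMatch is2-before (just a) rest
          ≡⟨ lastMatch-none is2-before (just a) rest rest-skipped ⟩
        just a ∎
        where
        rest : Rem
        rest = block d (suc b) 1 ++ trailingTwos
        is2-before : Entry → Bool
        is2-before pl = (proj₂ pl ≡ᵇ 2) ∧ (proj₁ pl <ᵇ d + b)
        rest-skipped : ∀ {pl} → pl ∈ rest → is2-before pl ≡ false
        rest-skipped {pl} pl∈ with ∈-++⁻ (block d (suc b) 1) pl∈
        ... | inj₁ pl∈ones rewrite proj₁ (∈-block pl∈ones) = refl
        ... | inj₂ pl∈twos = let (is2 , late , _) = ∈-block pl∈twos in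
            trans (cong (λ z → (z ≡ᵇ 2) ∧ (proj₁ pl <ᵇ d + b)) is2)
                  (≥⇒<ᵇ≡false (ℕP.≤-trans (ℕP.+-monoʳ-≤ d (ℕP.≤-trans (ℕP.n≤1+n b) bx)) late))

      label-a : (if d + b <ᵇ a then 0 else suc 0) ≡ 1
      label-a rewrite ≥⇒<ᵇ≡false {d + b} {a} (ℕP.<⇒≤ a<db) = refl

      firstSubword-step : firstSubword (length rem) rem ≡ (d + b , 0) ∷ (a , 1) ∷ []
      firstSubword-step = trans (firstSubword-just (length rem) rem (d + b) rightmost-1)
            (cong ((d + b , 0) ∷_) (trans (chain-step L′ 1 (d + b) 0 rem a (cprev-before 2 (d + b) rem a rightmostBefore-2))
            (cong₂ (λ l c → (a , l) ∷ c) label-a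
                   (trans (cong (λ z → chain L′ 2 a z rem) label-a)
                          (chain-stop L′ 2 a 1 rem (cprev-3≡nothing rem (remaining-OnlyLetters12 (suc a) (suc b)) a))))))
        where
        L′ : ℕ
        L′ = length (block 1 a 2 ++ (block d (suc b) 1 ++ trailingTwos))

      keep : Entry → Bool
      keep pl = not (anyB (λ c → proj₁ c ≡ᵇ proj₁ pl) ((d + b , 0) ∷ (a , 1) ∷ []))

      keep-true : ∀ {pl} → ¬ proj₁ pl ≡ d + b → ¬ proj₁ pl ≡ a → keep pl ≡ true
      keep-true {pl} ≢d+b ≢a rewrite ≢⇒≡ᵇ≡false {d + b} {proj₁ pl} (≢d+b ∘ sym) | ≢⇒≡ᵇ≡false {a} {proj₁ pl} (≢a ∘ sym) = refl

      keep-all-but-last : ∀ l y → (∀ {pl} → pl ∈ l → keep pl ≡ true) → keep y ≡ false → filterB keep (l ++ y ∷ []) ≡ l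
      keep-all-but-last l y kept dropped = begin
        filterB keep (l ++ y ∷ [])                ≡⟨ filterB-++ keep l (y ∷ []) ⟩
        filterB keep l ++ filterB keep (y ∷ [])   ≡⟨ cong₂ _++_ (filterB-all keep l kept) (cong (λ k → if k then y ∷ [] else []) dropped) ⟩
        l ++ []                                    ≡⟨ ++-identityʳ l ⟩
        l                                          ∎

      removePos-step : removePos ((d + b , 0) ∷ (a , 1) ∷ []) rem ≡ remaining a b
      removePos-step = begin
        filterB keep (block 0 (suc a) 2 ++ (block d (suc b) 1 ++ trailingTwos))
          ≡⟨ cong₂ (λ u v → filterB keep (u ++ (v ++ trailingTwos))) (block-snoc 0 a 2) (block-snoc d b 1) ⟩
        filterB keep ((block 0 a 2 ++ (a , 2) ∷ []) ++ ((block d b 1 ++ (d + b , 1) ∷ []) ++ trailingTwos))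
          ≡⟨ filterB-++ keep (block 0 a 2 ++ (a , 2) ∷ []) _ ⟩
        filterB keep (block 0 a 2 ++ (a , 2) ∷ []) ++ filterB keep ((block d b 1 ++ (d + b , 1) ∷ []) ++ trailingTwos)
          ≡⟨ cong₂ _++_ (keep-all-but-last (block 0 a 2) (a , 2) keeps-leading-twos drops-a)
                        (filterB-++ keep (block d b 1 ++ (d + b , 1) ∷ []) trailingTwos) ⟩
        block 0 a 2 ++ (filterB keep (block d b 1 ++ (d + b , 1) ∷ []) ++ filterB keep trailingTwos)
          ≡⟨ cong (block 0 a 2 ++_) (cong₂ _++_ (keep-all-but-last (block d b 1) (d + b , 1) keeps-ones drops-d+b)
                                               (filterB-all keep trailingTwos keeps-trailing-twos)) ⟩
        block 0 a 2 ++ (block d b 1 ++ trailingTwos) ∎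
        where
        keeps-leading-twos : ∀ {pl} → pl ∈ block 0 a 2 → keep pl ≡ true
        keeps-leading-twos {pl} pl∈ = let (_ , _ , <a) = ∈-block pl∈ in
          keep-true {pl} (λ eq → ℕP.<-irrefl eq (ℕP.<-trans <a a<db)) (λ eq → ℕP.<-irrefl eq <a)
        drops-a : keep (a , 2) ≡ false
        drops-a rewrite ≢⇒≡ᵇ≡false {d + b} {a} (λ eq → ℕP.<-irrefl (sym eq) a<db) | ≡ᵇ-refl a = refl
        keeps-ones : ∀ {pl} → pl ∈ block d b 1 → keep pl ≡ true
        keeps-ones {pl} pl∈ = let (_ , d≤ , <d+b) = ∈-block pl∈ in
          keep-true {pl} (λ eq → ℕP.<-irrefl eq <d+b) (λ eq → ℕP.<-irrefl (sym eq) (ℕP.<-≤-trans ad d≤))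
        drops-d+b : keep (d + b , 1) ≡ false
        drops-d+b rewrite ≡ᵇ-refl (d + b) = refl
        keeps-trailing-twos : ∀ {pl} → pl ∈ trailingTwos → keep pl ≡ true
        keeps-trailing-twos {pl} pl∈ = let (_ , d+x≤ , _) = ∈-block pl∈ in
          keep-true {pl} (λ eq → ℕP.<-irrefl (sym eq) (ℕP.<-≤-trans (ℕP.+-monoʳ-< d bx) d+x≤))
                         (λ eq → ℕP.<-irrefl (sym eq) (ℕP.<-≤-trans (ℕP.<-≤-trans ad (ℕP.m≤m+n d x)) d+x≤))

      decompose-step : ∀ f → decompose (suc f) rem ≡ (d + b , 0) ∷ (a , 1) ∷ decompose f (remaining a b)
      decompose-step f rewrite firstSubword-step | removePos-step = refl

    expectedLabel : ℕ → ℕ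
    expectedLabel i = if i <ᵇ d then 1 else 0

    LabelledCorrectly : Rem → Set
    LabelledCorrectly entries = ∀ {pl} → pl ∈ entries → proj₂ pl ≡ expectedLabel (proj₁ pl)

    LabelsBelow : ℕ → Rem → Set
    LabelsBelow a entries = ∀ i → i < a → ∃ λ l → (i , l) ∈ entries

    Invariant : Rem → Set
    Invariant rem = ∀ {pl} → pl ∈ rem → ((proj₂ pl ≡ 1) × (d ≤ proj₁ pl) × (proj₁ pl < d + x)) ⊎ ((proj₂ pl ≡ 2) × (d + x ≤ proj₁ pl))

    Invariant⇒OnlyLetters12 : ∀ {rem} → Invariant rem → OnlyLetters12 rem
    Invariant⇒OnlyLetters12 h m with h m
    ... | inj₁ (e , _) = inj₁ e
    ... | inj₂ (e , _) = inj₂ e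

    LabelledZero : Entry → Set
    LabelledZero pl = (proj₂ pl ≡ 0) × (d ≤ proj₁ pl)

    start-bounds : ∀ rem → Invariant rem → ∀ {p} → rightmost 1 rem ≡ just p → (d ≤ p) × (p < d + x)
    start-bounds rem inv {p} found with lastMatch-sound (λ pl → proj₂ pl ≡ᵇ 1) nothing rem found
    ... | inj₁ ()
    ... | inj₂ (pl , pl∈ , is1 , at-p) with inv pl∈
    ...   | inj₁ (_ , d≤ , <dx) = subst (d ≤_) at-p d≤ , subst (_< d + x) at-p <dx
    ...   | inj₂ (is2 , _) = ⊥-elim (true≢false (trans (sym is1) (cong (_≡ᵇ 1) is2)))

    no-2-before : ∀ rem → Invariant rem → ∀ {p} → p < d + x → rightmostBefore 2 p rem ≡ nothing
    no-2-before rem inv {p} p<dx with rightmostBefore 2 p rem in found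
    ... | nothing = refl
    ... | just q with lastMatch-sound (λ pl → (proj₂ pl ≡ᵇ 2) ∧ (proj₁ pl <ᵇ p)) nothing rem found
    ...   | inj₁ ()
    ...   | inj₂ (pl , pl∈ , matches , _) with inv pl∈
    ...     | inj₁ (is1 , _) = ⊥-elim (true≢false (trans (sym matches) (cong (λ z → (z ≡ᵇ 2) ∧ (proj₁ pl <ᵇ p)) is1)))
    ...     | inj₂ (_ , dx≤) = ⊥-elim (true≢false (trans (sym matches)
                                 (trans (cong ((proj₂ pl ≡ᵇ 2) ∧_) (≥⇒<ᵇ≡false {proj₁ pl} {p} (ℕP.≤-trans (ℕP.<⇒≤ p<dx) dx≤))) (∧-zeroʳ _))))

    chain-labels-zero : ∀ rem → Invariant rem → ∀ {p} → p < d + x → rightmostBefore 2 p rem ≡ nothing →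
      ∀ f {pl} → pl ∈ chain f 1 p 0 rem → LabelledZero pl
    chain-labels-zero rem inv p<dx none zero ()
    chain-labels-zero rem inv {p} p<dx none (suc f) {pl} pl∈ with rightmost 2 rem in found
    ... | nothing = ⊥-elim (¬Any[] (subst (pl ∈_) (chain-stop (suc f) 1 p 0 rem (trans (cprev-after 2 p rem none) found)) pl∈))
    ... | just q with lastMatch-sound (λ pl → proj₂ pl ≡ᵇ 2) nothing rem found
    ...   | inj₁ ()
    ...   | inj₂ (ql , ql∈ , is2 , at-q) = second (subst (pl ∈_) (chain-step f 1 p 0 rem q (trans (cprev-after 2 p rem none) found)) pl∈)
      where
      dx≤q : d + x ≤ q
      dx≤q with inv ql∈
      ... | inj₂ (_ , dx≤) = subst (d + x ≤_) at-q dx≤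
      ... | inj₁ (is1 , _) = ⊥-elim (true≢false (trans (sym is2) (cong (_≡ᵇ 2) is1)))
      label-q : (if p <ᵇ q then 0 else suc 0) ≡ 0
      label-q rewrite <⇒<ᵇ≡true (ℕP.<-≤-trans p<dx dx≤q) = refl
      second : pl ∈ (q , (if p <ᵇ q then 0 else suc 0)) ∷ chain f 2 q (if p <ᵇ q then 0 else suc 0) rem → LabelledZero pl
      second (here refl) = label-q , ℕP.≤-trans (ℕP.m≤m+n d x) dx≤q
      second (there pl∈′) = ⊥-elim (¬Any[] (subst (pl ∈_) (chain-stop f 2 q _ rem (cprev-3≡nothing rem (Invariant⇒OnlyLetters12 inv) q)) pl∈′))

    firstSubword-labels-zero : ∀ f rem → Invariant rem → ∀ {pl} → pl ∈ firstSubword f rem → LabelledZero pl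
    firstSubword-labels-zero f rem inv {pl} pl∈ with rightmost 1 rem in found
    ... | nothing = ⊥-elim (¬Any[] pl∈)
    ... | just p with start-bounds rem inv found
    ...   | d≤p , p<dx = first pl∈
      where
      first : pl ∈ (p , 0) ∷ chain f 1 p 0 rem → LabelledZero pl
      first (here refl) = refl , d≤p
      first (there pl∈′) = chain-labels-zero rem inv p<dx (no-2-before rem inv p<dx) f pl∈′

    decompose-labels-zero : ∀ f rem → Invariant rem → ∀ {pl} → pl ∈ decompose f rem → LabelledZero pl
    decompose-labels-zero zero rem inv ()
    decompose-labels-zero (suc f) rem inv m with ∈-++⁻ (firstSubword (length rem) rem) m
    ... | inj₁ m1 = firstSubword-labels-zero (length rem) rem inv m1
    ... | inj₂ m2 = decompose-labels-zero f (removePos (firstSubword (length rem) rem) rem) (λ mm → inv (filterB-⊆ _ rem mm)) m2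

    Invariant-remaining0 : ∀ b → b ≤ x → Invariant (remaining 0 b)
    Invariant-remaining0 b bx m with ∈-++⁻ (block d b 1) m
    ... | inj₁ m1 = let (e , l , u) = ∈-block m1 in inj₁ (e , l , ℕP.<-≤-trans u (ℕP.+-monoʳ-≤ d bx))
    ... | inj₂ m2 = let (e , l , _) = ∈-block m2 in inj₂ (e , l)

    decompose-labels : ∀ a b f → a ≤ d → a ≤ b → b ≤ x → a ≤ f →
      LabelledCorrectly (decompose f (remaining a b)) × LabelsBelow a (decompose f (remaining a b))
    decompose-labels zero b f _ _ bx _ = labelled , (λ i ())
      where
      labelled : LabelledCorrectly (decompose f (remaining 0 b))
      labelled {pl} pl∈ = let (label≡0 , d≤) = decompose-labels-zero f (remaining 0 b) (Invariant-remaining0 b bx) pl∈ in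
        trans label≡0 (sym (cong (λ z → if z then 1 else 0) (≥⇒<ᵇ≡false {proj₁ pl} {d} d≤)))
    decompose-labels (suc a) (suc b) (suc f) ad (s≤s ab) bx (s≤s af) rewrite Step.decompose-step a b ad bx f =
      (λ { (here refl) → sym (cong (λ z → if z then 1 else 0) (≥⇒<ᵇ≡false {d + b} {d} (ℕP.m≤m+n d b)))
         ; (there (here refl)) → sym (cong (λ z → if z then 1 else 0) (<⇒<ᵇ≡true {a} {d} ad))
         ; (there (there m)) → proj₁ IH m })
      , covers-below
      where
      IH : LabelledCorrectly (decompose f (remaining a b)) × LabelsBelow a (decompose f (remaining a b))
      IH = decompose-labels a b f (ℕP.≤-trans (ℕP.n≤1+n a) ad) ab (ℕP.≤-trans (ℕP.n≤1+n b) bx) af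
      covers-below : ∀ i → i < suc a → ∃ λ l → (i , l) ∈ (d + b , 0) ∷ (a , 1) ∷ decompose f (remaining a b)
      covers-below i (s≤s i≤a) with ℕP.m≤n⇒m<n∨m≡n i≤a
      ... | inj₂ refl = 1 , there (here refl)
      ... | inj₁ i<a = let (l , m) = proj₂ IH i i<a in l , there (there m)

    label-lookup : ∀ (entries : Rem) i → LabelledCorrectly entries → (¬ expectedLabel i ≡ 0 → ∃ λ l → (i , l) ∈ entries) →
      foldr (λ pl acc → if proj₁ pl ≡ᵇ i then proj₂ pl else acc) 0 entries ≡ expectedLabel i
    label-lookup [] i h covers with expectedLabel i ℕ.≟ 0
    ... | yes e = sym e
    ... | no ne = ⊥-elim (¬Any[] (proj₂ (covers ne)))
    label-lookup (pl ∷ entries) i h covers with proj₁ pl ≡ᵇ i in e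
    ... | true = trans (h (here refl)) (cong expectedLabel (≡ᵇ≡true⇒≡ e))
    ... | false = label-lookup entries i (λ m → h (there m)) covers′
      where
      covers′ : ¬ expectedLabel i ≡ 0 → ∃ λ l → (i , l) ∈ entries
      covers′ ne with covers ne
      ... | l , here refl = ⊥-elim (false≢true (trans (sym e) (≡ᵇ-refl i)))
      ... | l , there m = l , m

  upFrom : ℕ → ℕ → List ℕ
  upFrom s zero = []
  upFrom s (suc n) = s ∷ upFrom (suc s) n

  applyUpTo-from : ∀ (f : ℕ → ℕ) s n → (∀ i → f i ≡ s + i) → applyUpTo f n ≡ upFrom s n
  applyUpTo-from f s zero h = refl
  applyUpTo-from f s (suc n) h = cong₂ _∷_ (trans (h 0) (ℕP.+-identityʳ s)) (applyUpTo-from (f ∘ suc) (suc s) n (λ i → trans (h (suc i)) (ℕP.+-suc s i)))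

  upTo-from : ∀ n → upTo n ≡ upFrom 0 n
  upTo-from n = applyUpTo-from (λ i → i) 0 n (λ i → refl)

  zip-gen : ∀ s a m c (w′ : List ℕ) → zip (upFrom s (a + m)) (replicate a c ++ w′) ≡ block s a c ++ zip (upFrom (s + a) m) w′
  zip-gen s zero m c w′ = cong (λ z → zip (upFrom z m) w′) (sym (ℕP.+-identityʳ s))
  zip-gen s (suc a) m c w′ = cong ((s , c) ∷_) (trans (zip-gen (suc s) a m c w′) (cong (λ z → block (suc s) a c ++ zip (upFrom z m) w′) (sym (ℕP.+-suc s a))))

  zip-gen0 : ∀ s a c → zip (upFrom s a) (replicate a c) ≡ block s a c
  zip-gen0 s zero c = refl
  zip-gen0 s (suc a) c = cong ((s , c) ∷_) (zip-gen0 (suc s) a c)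

  upFrom-++ : ∀ s a m → upFrom s (a + m) ≡ upFrom s a ++ upFrom (s + a) m
  upFrom-++ s zero m = cong (λ z → upFrom z m) (sym (ℕP.+-identityʳ s))
  upFrom-++ s (suc a) m = cong (s ∷_) (trans (upFrom-++ (suc s) a m) (cong (λ z → upFrom (suc s) a ++ upFrom z m) (sym (ℕP.+-suc s a))))

  module Reading (d x y : ℕ) (dx : d ≤ x) where
    open TwoRowWord d x y dx

    word : List ℕ
    word = replicate d 2 ++ (replicate x 1 ++ replicate y 2)

    length-word : length word ≡ d + (x + y)
    length-word = trans (length-++ (replicate d 2)) (cong₂ _+_ (length-replicate d) (trans (length-++ (replicate x 1)) (cong₂ _+_ (length-replicate x) (length-replicate y))))

    zip-word : zip (upTo (length word)) word ≡ remaining d x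
    zip-word = trans (cong (λ z → zip (upTo z) word) length-word)
           (trans (cong (λ z → zip z word) (upTo-from (d + (x + y))))
           (trans (zip-gen 0 d (x + y) 2 (replicate x 1 ++ replicate y 2))
           (cong (block 0 d 2 ++_) (trans (zip-gen d x y 1 (replicate y 2)) (cong (block d x 1 ++_) (zip-gen0 (d + x) y 2))))))

    d≤L : d ≤ length word
    d≤L = subst (d ≤_) (sym length-word) (ℕP.m≤m+n d (x + y))

    labels-word : ∀ i → foldr (λ pl acc → if proj₁ pl ≡ᵇ i then proj₂ pl else acc) 0 (decompose (length word) (zip (upTo (length word)) word)) ≡ expectedLabel i
    labels-word i rewrite zip-word = label-lookup (decompose (length word) (remaining d x)) i (proj₁ decomposition) covers
      where
      decomposition : LabelledCorrectly (decompose (length word) (remaining d x)) × LabelsBelow d (decompose (length word) (remaining d x))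
      decomposition = decompose-labels d x (length word) ℕP.≤-refl dx ℕP.≤-refl d≤L
      covers : ¬ expectedLabel i ≡ 0 → ∃ λ l → (i , l) ∈ decompose (length word) (remaining d x)
      covers ne with i <ᵇ d in e
      ... | true = proj₂ decomposition i (<ᵇ≡true⇒< e)
      ... | false = ⊥-elim (ne refl)

    expectedLabels-ones : ∀ s a → s + a ≤ d → map expectedLabel (upFrom s a) ≡ replicate a 1
    expectedLabels-ones s zero _ = refl
    expectedLabels-ones s (suc a) le = cong₂ _∷_ (cong (λ z → if z then 1 else 0) (<⇒<ᵇ≡true {s} {d} (ℕP.<-≤-trans (ℕP.m<m+n s (s≤s z≤n)) le)))
                                   (expectedLabels-ones (suc s) a (subst (_≤ d) (ℕP.+-suc s a) le))

    expectedLabels-zeros : ∀ s m → d ≤ s → map expectedLabel (upFrom s m) ≡ replicate m 0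
    expectedLabels-zeros s zero _ = refl
    expectedLabels-zeros s (suc m) le =
      cong₂ _∷_ (cong (λ z → if z then 1 else 0) (≥⇒<ᵇ≡false {s} {d} le)) (expectedLabels-zeros (suc s) m (ℕP.≤-trans le (ℕP.n≤1+n s)))

    cocharge-word : cocharge word ≡ replicate d 1 ++ replicate (x + y) 0
    cocharge-word = trans (map-cong labels-word (upTo (length word)))
           (trans (cong (λ z → map expectedLabel (upTo z)) length-word)
           (trans (cong (map expectedLabel) (trans (upTo-from (d + (x + y))) (upFrom-++ 0 d (x + y))))
           (trans (map-++ expectedLabel (upFrom 0 d) (upFrom d (x + y)))
           (cong₂ _++_ (expectedLabels-ones 0 d ℕP.≤-refl) (expectedLabels-zeros d (x + y) ℕP.≤-refl)))))


module TwoLetterTableaux where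

  open import Data.Nat using (ℕ; zero; suc; _+_; _≤_; _<_; _≡ᵇ_; z≤n; s≤s)
  import Data.Nat.Properties as ℕP
  open import Data.Bool using (true; false)
  open import Data.List as List using (List; []; _∷_; _++_; length; replicate; concat)
  open import Data.List.Properties using (++-identityʳ; length-++; length-replicate)
  open import Data.List.Membership.Propositional using (_∈_)
  open import Data.List.Membership.Propositional.Properties using (∈-++⁺ˡ; ∈-++⁺ʳ)
  open import Data.List.Relation.Unary.Any using (here; there)
  open import Data.Product using (_×_; _,_; ∃)
  open import Data.Sum using (_⊎_; inj₁; inj₂)
  open import Data.Empty using (⊥; ⊥-elim)
  open import Relation.Binary.PropositionalEquality
  open import Defs
  open BooleanTests using (≡ᵇ-refl)

  OnlyOnesTwos : List ℕ → Set
  OnlyOnesTwos l = ∀ {z} → z ∈ l → (z ≡ 1) ⊎ (z ≡ 2)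

  countB-≥1 : ∀ z (l : List ℕ) → z ∈ l → 1 ≤ countB (λ x → x ≡ᵇ z) l
  countB-≥1 z (y ∷ l) (here refl) rewrite ≡ᵇ-refl z = s≤s z≤n
  countB-≥1 z (y ∷ l) (there m) with y ≡ᵇ z
  ... | true = s≤s z≤n
  ... | false = countB-≥1 z l m

  content⇒OnlyOnesTwos : ∀ S μ₁ μ₂ → HasContent S μ₁ μ₂ → OnlyOnesTwos (concat S)
  content⇒OnlyOnesTwos S μ₁ μ₂ hc {z} m with z
  ... | 0 = ⊥-elim (ℕP.<-irrefl refl (ℕP.≤-trans (countB-≥1 0 _ m) (ℕP.≤-reflexive (hc 0))))
  ... | 1 = inj₁ refl
  ... | 2 = inj₂ refl
  ... | suc (suc (suc k)) = ⊥-elim (ℕP.<-irrefl refl (ℕP.≤-trans (countB-≥1 (suc (suc (suc k))) _ m) (ℕP.≤-reflexive (hc (suc (suc (suc k)))))))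

  weaklyIncreasing⇒ones-twos : ∀ r → WeaklyInc r → OnlyOnesTwos r → ∃ λ x → ∃ λ y → r ≡ replicate x 1 ++ replicate y 2
  weaklyIncreasing⇒ones-twos [] _ _ = 0 , 0 , refl
  weaklyIncreasing⇒ones-twos (a ∷ []) _ h with h (here refl)
  ... | inj₁ refl = 1 , 0 , refl
  ... | inj₂ refl = 0 , 1 , refl
  weaklyIncreasing⇒ones-twos (a ∷ b ∷ r) (two a≤b w) h with weaklyIncreasing⇒ones-twos (b ∷ r) w (λ m → h (there m)) | h (here refl)
  ... | x , y , e | inj₁ refl = suc x , y , cong (1 ∷_) e
  ... | zero , y , e | inj₂ refl = 0 , suc y , cong (2 ∷_) e
  ... | suc x , y , e | inj₂ refl = ⊥-elim (ℕP.<-irrefl refl (ℕP.≤-trans a≤b (ℕP.≤-reflexive (cong head′ e))))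
    where
    head′ : List ℕ → ℕ
    head′ [] = 0
    head′ (z ∷ _) = z

  strictlyAbove⇒twos : ∀ x y r → StrictAbove (replicate x 1 ++ replicate y 2) r → OnlyOnesTwos r → (r ≡ replicate (length r) 2) × (length r ≤ x)
  strictlyAbove⇒twos x y [] _ _ = refl , z≤n
  strictlyAbove⇒twos (suc x) y (b ∷ r) (step a<b sa) h with h (here refl)
  ... | inj₁ refl = ⊥-elim (ℕP.<-irrefl refl a<b)
  ... | inj₂ refl = let (e , l) = strictlyAbove⇒twos x y r sa (λ m → h (there m)) in cong (2 ∷_) e , s≤s l
  strictlyAbove⇒twos zero (suc y) (b ∷ r) (step a<b sa) h with h (here refl)
  ... | inj₁ refl = ⊥-elim (ℕP.<-asym a<b (s≤s (s≤s z≤n)))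
  ... | inj₂ refl = ⊥-elim (ℕP.<-irrefl refl a<b)
  strictlyAbove⇒twos zero zero (b ∷ r) () h

  record ReadingShape (S : Tab ℕ) : Set where
    field
      d x y : ℕ
      d≤x : d ≤ x
      readingWord-S : readingWord S ≡ replicate d 2 ++ (replicate x 1 ++ replicate y 2)
      length≤2 : length S ≤ 2
      top-length : length (rowOr[] S 1) ≡ d
      bottom-length : length (rowOr[] S 0) ≡ x + y

  length-ones-twos : ∀ x y → length (replicate x 1 ++ replicate y 2) ≡ x + y
  length-ones-twos x y = trans (length-++ (replicate x 1)) (cong₂ _+_ (length-replicate x) (length-replicate y))

  first-row-WeaklyInc : ∀ {r rs} → AllRows WeaklyInc (r ∷ rs) → WeaklyInc r
  first-row-WeaklyInc (inc ∷ _) = inc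

  first-rows-StrictAbove : ∀ {r r′ rs} → ColsStrict (r ∷ r′ ∷ rs) → StrictAbove r r′
  first-rows-StrictAbove (two above _) = above

  first-row-nonempty : ∀ {r : List ℕ} {rs} → IsShape (r ∷ rs) → 0 < length r
  first-row-nonempty (one nonempty) = nonempty
  first-row-nonempty (two nonempty _ _) = nonempty

  no-three-strict-rows : ∀ u v w → 0 < length w → StrictAbove u v → StrictAbove v w → OnlyOnesTwos u → OnlyOnesTwos w → ⊥
  no-three-strict-rows (a ∷ u) (b ∷ v) (c ∷ w) _ (step a<b _) (step b<c _) u-letters w-letters
    with u-letters (here refl) | w-letters (here refl)
  ... | inj₁ refl | inj₁ refl = ℕP.<-irrefl refl (ℕP.<-trans a<b b<c)
  ... | inj₁ refl | inj₂ refl = strictly-between a<b b<c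
    where
    strictly-between : ∀ {b} → 1 < b → b < 2 → ⊥
    strictly-between (s≤s (s≤s z≤n)) (s≤s (s≤s ()))
  ... | inj₂ refl | inj₁ refl = ℕP.<-asym (ℕP.<-trans a<b b<c) (s≤s (s≤s z≤n))
  ... | inj₂ refl | inj₂ refl = ℕP.<-irrefl refl (ℕP.<-trans a<b b<c)

  readingShape : ∀ S μ₁ μ₂ → Semistandard S → HasContent S μ₁ μ₂ → ReadingShape S
  readingShape [] μ₁ μ₂ ss hc =
    record { d = 0 ; x = 0 ; y = 0 ; d≤x = z≤n ; readingWord-S = refl ; length≤2 = z≤n ; top-length = refl ; bottom-length = refl }
  readingShape (r0 ∷ []) μ₁ μ₂ ss hc
    with weaklyIncreasing⇒ones-twos r0 (first-row-WeaklyInc (Semistandard.rowsInc ss)) (λ m → content⇒OnlyOnesTwos (r0 ∷ []) μ₁ μ₂ hc (∈-++⁺ˡ m))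
  ... | x , y , r0≡ =
    record { d = 0 ; x = x ; y = y ; d≤x = z≤n ; readingWord-S = trans (++-identityʳ r0) r0≡ ; length≤2 = s≤s z≤n
           ; top-length = refl ; bottom-length = trans (cong length r0≡) (length-ones-twos x y) }
  readingShape (r0 ∷ r1 ∷ []) μ₁ μ₂ ss hc
    with weaklyIncreasing⇒ones-twos r0 (first-row-WeaklyInc (Semistandard.rowsInc ss)) (λ m → content⇒OnlyOnesTwos (r0 ∷ r1 ∷ []) μ₁ μ₂ hc (∈-++⁺ˡ m))
  ... | x , y , r0≡
    with strictlyAbove⇒twos x y r1 (subst (λ z → StrictAbove z r1) r0≡ (first-rows-StrictAbove (Semistandard.colsInc ss)))
                                   (λ m → content⇒OnlyOnesTwos (r0 ∷ r1 ∷ []) μ₁ μ₂ hc (∈-++⁺ʳ r0 (∈-++⁺ˡ m)))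
  ... | r1≡ , d≤x =
    record { d = length r1 ; x = x ; y = y ; d≤x = d≤x ; readingWord-S = cong₂ _++_ r1≡ (trans (++-identityʳ r0) r0≡)
           ; length≤2 = s≤s (s≤s z≤n) ; top-length = refl ; bottom-length = trans (cong length r0≡) (length-ones-twos x y) }
  readingShape (r0 ∷ r1 ∷ r2 ∷ rs) μ₁ μ₂ ss hc with Semistandard.shape ss | Semistandard.colsInc ss
  ... | two _ _ (two _ _ shape₂) | two above₀₁ (two above₁₂ _) =
    ⊥-elim (no-three-strict-rows r0 r1 r2 (first-row-nonempty shape₂) above₀₁ above₁₂
              (λ m → letters (∈-++⁺ˡ m)) (λ m → letters (∈-++⁺ʳ r0 (∈-++⁺ʳ r1 (∈-++⁺ˡ m)))))
    where
    letters : OnlyOnesTwos (concat (r0 ∷ r1 ∷ r2 ∷ rs))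
    letters = content⇒OnlyOnesTwos (r0 ∷ r1 ∷ r2 ∷ rs) μ₁ μ₂ hc


module Fillings where

  open import Data.Nat as ℕ using (ℕ; zero; suc; _+_; _*_; _∸_; _≤_; s≤s)
  open import Data.Nat.Base using (_!)
  import Data.Nat.Properties as ℕP
  open import Data.Integer using (+_)
  open import Data.Bool using (Bool; true; false; if_then_else_)
  open import Data.Fin using (Fin; _≟_)
  open import Data.List using (List; []; _∷_; _++_; map; concatMap; length; zipWith; replicate; concat; allFin)
  open import Data.List.Properties using (++-identityʳ; length-map; ∷-injective)
  open import Data.List.Membership.Propositional using (_∈_)
  open import Data.List.Membership.Propositional.Properties using (∈-++⁻)
  open import Data.List.Relation.Unary.Any using (here; there)
  open import Data.List.Relation.Unary.Any.Properties using (¬Any[])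
  open import Data.Vec as Vec using (Vec)
  open import Data.Vec.Properties using (tabulate-cong)
  open import Data.Maybe using (Maybe; just)
  open import Data.Product using (_×_; _,_; proj₁; proj₂; ∃)
  open import Data.Sum using (inj₁; inj₂)
  open import Data.Empty using (⊥-elim)
  open import Relation.Binary.PropositionalEquality
  open import Relation.Nullary using (¬_; yes; no; does)
  open import Defs
  open ColumnSwaps using (occurrences)
  open TwoRowFilling using (AtMostOnce; Unique⇒AtMostOnce)
  open Antisymmetrizer using (allB-cong; module OfTwoRowFilling)
  open Cocharge using (module Reading)
  open TwoLetterTableaux
  import Data.Maybe as M
  open ≡-Reasoning

  filterB-cong : ∀ {A : Set} (p q : A → Bool) l → (∀ x → p x ≡ q x) → filterB p l ≡ filterB q l
  filterB-cong p q [] h = refl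
  filterB-cong p q (x ∷ l) h rewrite h x with q x
  ... | true = cong (x ∷_) (filterB-cong p q l h)
  ... | false = filterB-cong p q l h

  εT-cong : ∀ {n} (T T′ : Tab (Fin n)) f → (∀ z → rowOf T z ≡ rowOf T′ z) → (∀ z → colOf T z ≡ colOf T′ z) → εT T f ≡ εT T′ f
  εT-cong {n} T T′ f hr hc =
    cong₂ (λ R C → sumP (concatMap (λ τ → map (λ σ → scaleP (sgn τ) (act τ (act σ f))) R) C))
      (filterB-cong (inR T) (inR T′) (allPerms n) (λ ω → allB-cong (allFin n) _ _ (λ k → cong₂ ℕ._≡ᵇ_ (hr (ω k)) (hr k))))
      (filterB-cong (inC T) (inC T′) (allPerms n) (λ ω → allB-cong (allFin n) _ _ (λ k → cong₂ ℕ._≡ᵇ_ (hc (ω k)) (hc k))))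

  findIn-mem : ∀ {n} {l : List (Fin n)} {z} → z ∈ l → ∃ λ i → findIn l z ≡ just i
  findIn-mem {l = y ∷ l} {z} m with y ≟ z
  ... | yes _ = 0 , refl
  ... | no ne with m
  ...   | here e = ⊥-elim (ne (sym e))
  ...   | there m′ = let (i , e) = findIn-mem m′ in suc i , cong (M.map suc) e

  weightedCount-zeros : ∀ {n} (k : Fin n) (B : List (Fin n)) m → sumℕ (zipWith (λ t c → if does (t ≟ k) then c else 0) B (replicate m 0)) ≡ 0
  weightedCount-zeros k [] m = refl
  weightedCount-zeros k (b ∷ B) zero = refl
  weightedCount-zeros k (b ∷ B) (suc m) with does (b ≟ k)
  ... | true = weightedCount-zeros k B m
  ... | false = weightedCount-zeros k B m

  weightedCount-top : ∀ {n} (k : Fin n) (P B : List (Fin n)) m →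
    sumℕ (zipWith (λ t c → if does (t ≟ k) then c else 0) (P ++ B) (replicate (length P) 1 ++ replicate m 0)) ≡ occurrences k P
  weightedCount-top k [] B m = weightedCount-zeros k B m
  weightedCount-top k (p ∷ P) B m with does (p ≟ k)
  ... | true = cong suc (weightedCount-top k P B m)
  ... | false = weightedCount-top k P B m

  record NormalisedRows {n} (T : Tab (Fin n)) : Set where
    field
      concat-rows : concat T ≡ rowOr[] T 0 ++ rowOr[] T 1
      readingWord-rows : readingWord T ≡ rowOr[] T 1 ++ rowOr[] T 0
      rowOf-rows : ∀ z → rowOf T z ≡ rowOf (rowOr[] T 0 ∷ rowOr[] T 1 ∷ []) z
      colOf-rows : ∀ z → colOf T z ≡ colOf (rowOr[] T 0 ∷ rowOr[] T 1 ∷ []) z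

  normalisedRows : ∀ {n} (T : Tab (Fin n)) → length T ≤ 2 → (∀ z → z ∈ concat T) → NormalisedRows T
  normalisedRows [] _ covers =
    record { concat-rows = refl ; readingWord-rows = refl
           ; rowOf-rows = λ z → ⊥-elim (¬Any[] (covers z)) ; colOf-rows = λ z → ⊥-elim (¬Any[] (covers z)) }
  normalisedRows (B ∷ []) _ covers =
    record { concat-rows = refl ; readingWord-rows = ++-identityʳ B ; rowOf-rows = rowOf-rows ; colOf-rows = colOf-rows }
    where
    z∈B : ∀ z → z ∈ B
    z∈B z with ∈-++⁻ B (covers z)
    ... | inj₁ z∈ = z∈
    ... | inj₂ ()
    rowOf-rows : ∀ z → rowOf (B ∷ []) z ≡ rowOf (B ∷ [] ∷ []) z
    rowOf-rows z with findIn-mem (z∈B z)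
    ... | i , found rewrite found = refl
    colOf-rows : ∀ z → colOf (B ∷ []) z ≡ colOf (B ∷ [] ∷ []) z
    colOf-rows z with findIn-mem (z∈B z)
    ... | i , found rewrite found = refl
  normalisedRows (B ∷ P ∷ []) _ covers =
    record { concat-rows = cong (B ++_) (++-identityʳ P) ; readingWord-rows = cong (P ++_) (++-identityʳ B)
           ; rowOf-rows = λ z → refl ; colOf-rows = λ z → refl }
  normalisedRows (_ ∷ _ ∷ _ ∷ _) (s≤s (s≤s ())) covers

  length-rowOr[] : ∀ {A B : Set} (T : Tab A) (S : Tab B) → map length T ≡ map length S → ∀ i →
    length (rowOr[] T i) ≡ length (rowOr[] S i)
  length-rowOr[] [] [] eq i = refl
  length-rowOr[] (r ∷ T) (s ∷ S) eq zero = proj₁ (∷-injective eq)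
  length-rowOr[] (r ∷ T) (s ∷ S) eq (suc i) = length-rowOr[] T S (proj₂ (∷-injective eq)) i

  module _ {n : ℕ} (S : Tab ℕ) (shape : ReadingShape S) (T : Tab (Fin n)) (fill : IsFilling T S) where
    open ReadingShape shape
    open IsFilling fill

    private
      bottom top : List (Fin n)
      bottom = rowOr[] T 0
      top = rowOr[] T 1

      length-T≤2 : length T ≤ 2
      length-T≤2 = subst (_≤ 2) (trans (sym (length-map length S)) (trans (cong length (sym sameShape)) (length-map length T))) length≤2

      normal : NormalisedRows T
      normal = normalisedRows T length-T≤2 covers
      open NormalisedRows normal

      length-top : length top ≡ d
      length-top = trans (length-rowOr[] T S sameShape 1) top-length

      length-top≤length-bottom : length top ≤ length bottom
      length-top≤length-bottom = subst₂ _≤_ (sym length-top) (sym (trans (length-rowOr[] T S sameShape 0) bottom-length))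
                                         (ℕP.≤-trans d≤x (ℕP.m≤m+n x y))

    open OfTwoRowFilling bottom top (subst AtMostOnce concat-rows (Unique⇒AtMostOnce unique)) (λ k → subst (k ∈_) concat-rows (covers k))
              length-top≤length-bottom

    xTS≡monomial-topExps : xTS T S ≡ monomial topExps
    xTS≡monomial-topExps = cong monomial (tabulate-cong (λ k → begin
      sumℕ (zipWith (λ t c → if does (t ≟ k) then c else 0) (readingWord T) (cocharge (readingWord S)))
        ≡⟨ cong₂ (λ u v → sumℕ (zipWith (λ t c → if does (t ≟ k) then c else 0) u v)) readingWord-rows cocharge-S ⟩
      sumℕ (zipWith (λ t c → if does (t ≟ k) then c else 0) (top ++ bottom) (replicate (length top) 1 ++ replicate (x + y) 0))
        ≡⟨ weightedCount-top k top bottom (x + y) ⟩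
      occurrences k top ∎))
      where
      cocharge-S : cocharge (readingWord S) ≡ replicate (length top) 1 ++ replicate (x + y) 0
      cocharge-S = trans (cong cocharge readingWord-S)
                         (trans (Reading.cocharge-word d x y d≤x) (cong (λ z → replicate z 1 ++ replicate (x + y) 0) (sym length-top)))

    F-twoRow : F T S ≈P scaleP (+ (length (rowOr[] S 1) ! * (n ∸ length (rowOr[] S 1)) !))
                              (prodP (zipWith (λ t b → var t -P var b) top bottom))
    F-twoRow a = begin
      coeff (εT T (xTS T S)) a
        ≡⟨ cong (λ f → coeff (εT T f) a) xTS≡monomial-topExps ⟩
      coeff (εT T (monomial topExps)) a
        ≡⟨ cong (λ e → coeff e a) (εT-cong T (bottom ∷ top ∷ []) (monomial topExps) rowOf-rows colOf-rows) ⟩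
      coeff (εT (bottom ∷ top ∷ []) (monomial topExps)) a
        ≡⟨ coeff-εT-topExps a ⟩
      coeff (scaleP (+ rowGroupOrder) (prodP (zipWith (λ t b → var t -P var b) top bottom))) a
        ≡⟨ cong (λ m → coeff (scaleP (+ (m ! * (n ∸ m) !)) (prodP (zipWith (λ t b → var t -P var b) top bottom))) a)
                (trans length-top (sym top-length)) ⟩
      coeff (scaleP (+ (length (rowOr[] S 1) ! * (n ∸ length (rowOr[] S 1)) !)) (prodP (zipWith (λ t b → var t -P var b) top bottom))) a ∎


open import Defs
open import Data.Nat using (ℕ; _+_; _*_; _∸_; _≤_)
open import Data.Nat.Base using (_!)
open import Data.Integer using (+_)
open import Data.List using (List; length; zipWith)
open import Data.Fin using (Fin)
open import Data.Product using (_×_; _,_)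

lemma3p23 : (n μ₁ μ₂ : ℕ) → μ₂ ≤ μ₁ → n ≡ μ₁ + μ₂ →
    (S : Tab ℕ) → Semistandard S → HasContent S μ₁ μ₂ →
    (length S ≤ 2) ×
    ((T : Tab (Fin n)) → IsFilling T S →
    F T S ≈P scaleP (+ ((length (rowOr[] S 1)) ! * (n ∸ length (rowOr[] S 1)) !))
    (prodP (zipWith (λ t b → var t -P var b) (rowOr[] T 1) (rowOr[] T 0))))
lemma3p23 n μ₁ μ₂ _ _ S semistandard content = ReadingShape.length≤2 shape , F-twoRow S shape
  where
  open TwoLetterTableaux using (ReadingShape; readingShape)
  open Fillings using (F-twoRow)
  shape : ReadingShape S
  shape = readingShape S μ₁ μ₂ semistandard content
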